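{- Let $n\ge1$ be an integer not divisible by $3$ and let $\Pi$ be a $(3,n)$-Dyck path. Apply the following construction with $a=\operatorname{area}(\Pi)$, $s=\operatorname{skip}(\Pi)$, $d=\operatorname{dinv}(\Pi)$: take the rank word for $n=a+s+d+1$ with no entries boxed; box its rightmost $d$ entries; then repeat $s$ times: starting immediately to the left of the leftmost boxed entry and moving left, pass over ("skip") the maximal run of consecutive entries all having the same column-color as one another, and then box the rightmost entry that has been neither skipped nor boxed. Then the resulting marked word equals the rank word of $\Pi$.
   Context: A $(3,n)$-Dyck path is a lattice path from $(0,0)$ to $(3,n)$ using unit north and east steps that stays weakly above the line $y=\frac{n}{3}x$. The cell $(a,b)$ ($a\in\{1,2,3\}$ column from left, $b\in\{1,\dots,n\}$ row from bottom) is $[a-1,a]\times[b-1,b]$. $\lambda(\Pi)$ is the set of cells lying above (north-west of) $\Pi$. $\operatorname{area}(\Pi)$ is the number of cells lying entirely below $\Pi$ and above the line $y=\frac n3x$. For $x\in\lambda(\Pi)$, $\operatorname{arm}(x)$ (resp. $\operatorname{leg}(x)$) is the number of cells of $\lambda(\Pi)$ strictly east (resp. strictly south) of $x$ in its row (resp. column). $\operatorname{dinv}(\Pi)$ is the number of $x\in\lambda(\Pi)$ with $\frac{\operatorname{arm}(x)}{\operatorname{leg}(x)+1}<\frac{3}{n}<\frac{\operatorname{arm}(x)+1}{\operatorname{leg}(x)}$ (right side $+\infty$ if $\operatorname{leg}(x)=0$). The rank of cell $(a,b)$ is $-an+3(b-1)$. The rank word is the list of all positive ranks of cells in increasing order (they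 lie in columns 1 and 2 and are distinct), each entry colored $1$ or $2$ according to the column of its cell. The rank word of $\Pi$ is this colored list with each entry whose cell lies in $\lambda(\Pi)$ marked ("boxed"). A skip of $\Pi$ is a maximal block of consecutive unboxed entries of the rank word having at least one boxed entry somewhere to its left and at least one somewhere to its right; $\operatorname{skip}(\Pi)$ is the number of skips. -}

module Defs where

open import Data.Nat using (ℕ; zero; suc; _+_; _*_; _∸_; _≤_; _<_; _≡ᵇ_)
open import Data.Nat.Properties using (_≤?_; _<?_; _≟_)
open import Data.Integer using (ℤ; +_; -_) renaming (_+_ to _+ℤ_)
import Data.Integer.Properties as ℤP
open import Data.Bool using (Bool; true; false; if_then_else_; not; _∧_; _∨_)
open import Data.List using (List; []; _∷_; _++_; map; concatMap; filter; length; reverse; applyUpTo)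
open import Data.Bool.ListAction using (any)
open import Data.List.Relation.Unary.All using (All)
open import Data.Product using (_×_; _,_; proj₁)
open import Data.Sum using (_⊎_)
open import Relation.Binary.PropositionalEquality using (_≡_)
open import Relation.Nullary.Decidable using (Dec; does; _×-dec_; _⊎-dec_; ¬?)
open import Data.Product using (proj₂)

data Step : Set where
  N E : Step

#N : List Step → ℕ
#N [] = 0
#N (N ∷ p) = suc (#N p)
#N (E ∷ p) = #N p

#E : List Step → ℕ
#E [] = 0
#E (N ∷ p) = #E p
#E (E ∷ p) = suc (#E p)

pointsFrom : ℕ → ℕ → List Step → List (ℕ × ℕ)
pointsFrom x y [] = (x , y) ∷ []
pointsFrom x y (N ∷ p) = (x , y) ∷ pointsFrom x (suc y) p
pointsFrom x y (E ∷ p) = (x , y) ∷ pointsFrom (suc x) y p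

-- (3,n)-Dyck path: from (0,0) to (3,n) with N/E unit steps, weakly above
-- the line y = (n/3) x, i.e. 3y ≥ n x at every visited lattice point
-- (segments between lattice points then stay above by convexity).
IsDyckPath : ℕ → List Step → Set
IsDyckPath n p =
  (#E p ≡ 3) × (#N p ≡ n) ×
  All (λ q → n * proj₁ q ≤ 3 * proj₂ q) (pointsFrom 0 0 p)

eastHeightsFrom : ℕ → List Step → List ℕ
eastHeightsFrom y [] = []
eastHeightsFrom y (N ∷ p) = eastHeightsFrom (suc y) p
eastHeightsFrom y (E ∷ p) = y ∷ eastHeightsFrom y p

-- k-th element (0-based) of a list, default 0 (never used out of range)
nth : List ℕ → ℕ → ℕ
nth [] _ = 0
nth (h ∷ _) zero = h
nth (_ ∷ hs) (suc k) = nth hs k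

-- the height of the east step of the path in column a (a = 1,2,3),
-- i.e. the east step from x = a-1 to x = a
colHeight : List Step → ℕ → ℕ
colHeight p a = nth (eastHeightsFrom 0 p) (a ∸ 1)

-- Cells: (a , b) = [a-1,a] × [b-1,b], a ∈ {1,2,3}, b ∈ {1..n}

Cell : Set
Cell = ℕ × ℕ

cells : ℕ → List Cell
cells n = concatMap (λ a → map (λ b → (a , b)) (applyUpTo suc n)) (applyUpTo suc 3)

-- cell (a,b) lies above (north-west of) the path: its bottom edge is at
-- height ≥ the height of the path's east step in column a
Inλ : List Step → Cell → Set
Inλ p (a , b) = colHeight p a ≤ b ∸ 1

inλ? : (p : List Step) → (c : Cell) → Dec (Inλ p c)
inλ? p (a , b) = colHeight p a ≤? b ∸ 1

lam : ℕ → List Step → List Cell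
lam n p = filter (inλ? p) (cells n)

-- area: cells lying entirely below Π (i.e. not in λ) and entirely above
-- the line y = (n/3)x, i.e. the lower-right corner (a , b-1) satisfies
-- 3(b-1) ≥ n a.
area : ℕ → List Step → ℕ
area n p = length (filter (λ c → ¬? (inλ? p c) ×-dec (proj₁ c * n ≤? 3 * (proj₂ c ∸ 1))) (cells n))

arm : ℕ → List Step → Cell → ℕ
arm n p (a , b) = length (filter (λ c → (a <? proj₁ c) ×-dec (proj₂ c ≟ b)) (lam n p))

leg : ℕ → List Step → Cell → ℕ
leg n p (a , b) = length (filter (λ c → (proj₁ c ≟ a) ×-dec (proj₂ c <? b)) (lam n p))

-- arm/(leg+1) < 3/n < (arm+1)/leg   (right side = ∞ when leg = 0),
-- cross-multiplied by the positive denominators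
DinvCell : ℕ → List Step → Cell → Set
DinvCell n p x = (arm n p x * n < 3 * (leg n p x + 1)) ×
                 ((leg n p x ≡ 0) ⊎ (3 * leg n p x < n * (arm n p x + 1)))

dinvCell? : (n : ℕ) (p : List Step) (x : Cell) → Dec (DinvCell n p x)
dinvCell? n p x = (arm n p x * n <? 3 * (leg n p x + 1)) ×-dec
                  ((leg n p x ≟ 0) ⊎-dec (3 * leg n p x <? n * (arm n p x + 1)))

dinv : ℕ → List Step → ℕ
dinv n p = length (filter (dinvCell? n p) (lam n p))

rank : ℕ → Cell → ℤ
rank n (a , b) = (- (+ (a * n))) +ℤ (+ (3 * (b ∸ 1)))

-- cells of positive rank, listed in increasing order of rank
-- (all ranks are < 3n, so r ranges over 1 .. 3n)
rankCells : ℕ → List Cell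
rankCells n = concatMap (λ r → filter (λ c → rank n c ℤP.≟ + r) (cells n)) (applyUpTo suc (3 * n))

-- rank word: entries (rank , colour = column)
rankWord : ℕ → List (ℤ × ℕ)
rankWord n = map (λ c → (rank n c , proj₁ c)) (rankCells n)

-- marked entries: (rank , colour , boxed?)
MarkedWord : Set
MarkedWord = List (ℤ × ℕ × Bool)

isTrue : ∀ {P : Set} → Dec P → Bool
isTrue d = does d

rankWordOf : ℕ → List Step → MarkedWord
rankWordOf n p = map (λ c → (rank n c , proj₁ c , isTrue (inλ? p c))) (rankCells n)

eqB : Bool → Bool → Bool
eqB true true = true
eqB false false = true
eqB _ _ = false

runs : List Bool → List (Bool × ℕ)
runs [] = []
runs (x ∷ xs) with runs xs
... | [] = (x , 1) ∷ []
... | (y , k) ∷ rs = if eqB x y then (y , suc k) ∷ rs else (x , 1) ∷ (y , k) ∷ rs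

-- number of maximal unboxed runs (value false) having a boxed entry
-- somewhere to the left (boxedLeft) and somewhere to the right
countSkips : Bool → List (Bool × ℕ) → ℕ
countSkips boxedLeft [] = 0
countSkips boxedLeft ((b , k) ∷ rs) =
  (if not b ∧ boxedLeft ∧ any proj₁ rs then 1 else 0) + countSkips (boxedLeft ∨ b) rs

boxedFlags : MarkedWord → List Bool
boxedFlags = map (λ e → proj₂ (proj₂ e))

skip : ℕ → List Step → ℕ
skip n p = countSkips false (runs (boxedFlags (rankWordOf n p)))

data Mark : Set where
  unmarked skipped boxed : Mark

isBoxed : Mark → Bool
isBoxed boxed = true
isBoxed _ = false

Entry : Set
Entry = ℤ × ℕ × Mark

boxFirst : ℕ → List Entry → List Entry
boxFirst zero xs = xs
boxFirst (suc k) [] = []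
boxFirst (suc k) ((r , c , m) ∷ xs) = (r , c , boxed) ∷ boxFirst k xs

boxRightmost : ℕ → List Entry → List Entry
boxRightmost d w = reverse (boxFirst d (reverse w))

splitAtBoxed : List Entry → List Entry × List Entry
splitAtBoxed [] = [] , []
splitAtBoxed ((r , c , boxed) ∷ xs) = [] , (r , c , boxed) ∷ xs
splitAtBoxed ((r , c , unmarked) ∷ xs) with splitAtBoxed xs
... | (pre , rest) = (r , c , unmarked) ∷ pre , rest
splitAtBoxed ((r , c , skipped) ∷ xs) with splitAtBoxed xs
... | (pre , rest) = (r , c , skipped) ∷ pre , rest

skipSame : ℕ → List Entry → List Entry
skipSame c [] = []
skipSame c ((r , c' , m) ∷ xs) =
  if c ≡ᵇ c' then (r , c' , skipped) ∷ skipSame c xs else (r , c' , m) ∷ xs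

-- (on a reversed word) skip the maximal run of equal colour at the front
skipRun : List Entry → List Entry
skipRun [] = []
skipRun ((r , c , m) ∷ xs) = (r , c , skipped) ∷ skipSame c xs

boxFirstUnmarked : List Entry → List Entry
boxFirstUnmarked [] = []
boxFirstUnmarked ((r , c , unmarked) ∷ xs) = (r , c , boxed) ∷ xs
boxFirstUnmarked ((r , c , skipped) ∷ xs) = (r , c , skipped) ∷ boxFirstUnmarked xs
boxFirstUnmarked ((r , c , boxed) ∷ xs) = (r , c , boxed) ∷ boxFirstUnmarked xs

-- one iteration: starting immediately left of the leftmost boxed entry
-- (or at the right end if nothing is boxed) and moving left, skip the
-- maximal run of entries of the same colour; then box the rightmost entry
-- that has been neither skipped nor boxed.
constructionStep : List Entry → List Entry
constructionStep w with splitAtBoxed w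
... | (pre , rest) = reverse (boxFirstUnmarked (reverse (reverse (skipRun (reverse pre)) ++ rest)))

iter : {A : Set} → ℕ → (A → A) → A → A
iter zero f x = x
iter (suc k) f x = f (iter k f x)

construction : ℕ → ℕ → ℕ → MarkedWord
construction a s d =
  map (λ e → (proj₁ e , proj₁ (proj₂ e) , isBoxed (proj₂ (proj₂ e))))
      (iter s constructionStep
         (boxRightmost d (map (λ e → (proj₁ e , proj₂ e , unmarked)) (rankWord (a + s + d + 1)))))

-- Write n = 3m + ρ with ρ ∈ {1, 2}.  Positive ranks occur only in columns 1 and 2, and
-- grouping the ranks 3j+1, 3j+2, 3j+3 into blocks, the rank word read from the right is
-- m + ρ - 1 column-1 entries followed by m blocks holding one entry of each column.  A
-- (3,n)-Dyck path is determined by the heights h₁ ≤ h₂ of its first two east steps, and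
-- λ(Π) boxes exactly the column-1 entries of rank ≥ 3h₁ - n and the column-2 entries of
-- rank ≥ 3h₂ - 2n.  The construction only looks at colours, so its boxed flags are a
-- function of the colour word.  According to where h₁ and h₂ fall, area, dinv and skip are
-- computed in closed form, and in each case these flags agree with those of λ(Π).

module Submission where

open import Defs
open import Data.Bool using (Bool; true; false; if_then_else_)
open import Data.Empty using (⊥; ⊥-elim)
open import Data.Integer using (ℤ)
import Data.Integer as Int
import Data.Integer.Properties as ℤP
open import Data.List using (List; []; _∷_; _++_; [_]; map; filter; length; applyUpTo; reverse; concatMap)
open import Data.List.Properties
  using (++-assoc; ++-identityʳ; filter-++; filter-accept; filter-reject; length-++; length-map; map-++; map-∘;
         reverse-++; reverse-involutive; reverse-map; unfold-reverse; ∷-injectiveʳ; ∷-injectiveˡ)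
open import Data.List.Relation.Unary.All using (All; []; _∷_)
open import Data.Nat using (ℕ; zero; suc; _+_; _*_; _∸_; _≤_; _<_; z≤n; s≤s; _≡ᵇ_; _/_; _%_)
open import Data.Nat.DivMod using ([m+kn]%n≡m%n; m*n%n≡0; m%n<n; m≡m%n+[m/n]*n; m<n⇒m%n≡m)
open import Data.Nat.Divisibility using (_∣_; divides)
open import Data.Nat.Properties
open import Data.Nat.Tactic.RingSolver using (solve-∀)
open import Data.Product using (Σ; _×_; _,_; proj₁; proj₂)
open import Data.Sum using (_⊎_; inj₁; inj₂)
open import Data.Unit using (⊤; tt)
open import Level using (0ℓ)
open import Relation.Binary.PropositionalEquality hiding ([_])
open import Relation.Nullary using (¬_; Dec; yes; no; does; ¬?; _×-dec_)
open import Relation.Nullary.Decidable using (dec-true; dec-false)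
open import Relation.Unary using (Pred; Decidable)

module Construction where

  NoBoxed : List Entry → Set
  NoBoxed [] = ⊤
  NoBoxed ((r , c , boxed) ∷ xs) = ⊥
  NoBoxed ((r , c , _) ∷ xs) = NoBoxed xs

  NoUnmarked : List Entry → Set
  NoUnmarked [] = ⊤
  NoUnmarked ((r , c , unmarked) ∷ xs) = ⊥
  NoUnmarked ((r , c , _) ∷ xs) = NoUnmarked xs

  AllSkipped : List Entry → Set
  AllSkipped [] = ⊤
  AllSkipped ((r , c , skipped) ∷ xs) = AllSkipped xs
  AllSkipped ((r , c , _) ∷ xs) = ⊥

  StartsBoxed : List Entry → Set
  StartsBoxed [] = ⊤
  StartsBoxed ((r , c , boxed) ∷ xs) = ⊤
  StartsBoxed ((r , c , _) ∷ xs) = ⊥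

  BoxedThenMarked : List Entry → Set
  BoxedThenMarked [] = ⊤
  BoxedThenMarked ((r , c , boxed) ∷ xs) = NoUnmarked xs
  BoxedThenMarked ((r , c , _) ∷ xs) = ⊥

  -- The construction runs from right to left, so words are stored reversed: the word
  -- is  reverse (P ++ U)  with P the part already dealt with and U still unmarked.
  -- P is processed when its last entry (the leftmost boxed entry of the word) is boxed
  -- and it has no unmarked entry; P = [] counts as processed.
  Processed : List Entry → Set
  Processed P = BoxedThenMarked (reverse P)

  NoUnmarked-++ : ∀ A B → NoUnmarked A → NoUnmarked B → NoUnmarked (A ++ B)
  NoUnmarked-++ [] B _ nb = nb
  NoUnmarked-++ ((r , c , skipped) ∷ A) B na nb = NoUnmarked-++ A B na nb
  NoUnmarked-++ ((r , c , boxed) ∷ A) B na nb = NoUnmarked-++ A B na nb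

  NoBoxed-++ : ∀ A B → NoBoxed A → NoBoxed B → NoBoxed (A ++ B)
  NoBoxed-++ [] B _ nb = nb
  NoBoxed-++ ((r , c , skipped) ∷ A) B na nb = NoBoxed-++ A B na nb
  NoBoxed-++ ((r , c , unmarked) ∷ A) B na nb = NoBoxed-++ A B na nb

  NoUnmarked-reverse : ∀ A → NoUnmarked A → NoUnmarked (reverse A)
  NoUnmarked-reverse [] _ = tt
  NoUnmarked-reverse (e@(r , c , skipped) ∷ A) na rewrite unfold-reverse e A = NoUnmarked-++ (reverse A) _ (NoUnmarked-reverse A na) tt
  NoUnmarked-reverse (e@(r , c , boxed) ∷ A) na rewrite unfold-reverse e A = NoUnmarked-++ (reverse A) _ (NoUnmarked-reverse A na) tt

  NoBoxed-reverse : ∀ A → NoBoxed A → NoBoxed (reverse A)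
  NoBoxed-reverse [] _ = tt
  NoBoxed-reverse (e@(r , c , skipped) ∷ A) na rewrite unfold-reverse e A = NoBoxed-++ (reverse A) _ (NoBoxed-reverse A na) tt
  NoBoxed-reverse (e@(r , c , unmarked) ∷ A) na rewrite unfold-reverse e A = NoBoxed-++ (reverse A) _ (NoBoxed-reverse A na) tt

  AllSkipped⇒NoBoxed : ∀ S → AllSkipped S → NoBoxed S
  AllSkipped⇒NoBoxed [] _ = tt
  AllSkipped⇒NoBoxed ((r , c , skipped) ∷ S) as = AllSkipped⇒NoBoxed S as

  AllSkipped⇒NoUnmarked : ∀ S → AllSkipped S → NoUnmarked S
  AllSkipped⇒NoUnmarked [] _ = tt
  AllSkipped⇒NoUnmarked ((r , c , skipped) ∷ S) as = AllSkipped⇒NoUnmarked S as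

  AllSkipped-++ : ∀ A B → AllSkipped A → AllSkipped B → AllSkipped (A ++ B)
  AllSkipped-++ [] B _ b = b
  AllSkipped-++ ((r , c , skipped) ∷ A) B a b = AllSkipped-++ A B a b

  BoxedThenMarked⇒StartsBoxed : ∀ P → BoxedThenMarked P → StartsBoxed P
  BoxedThenMarked⇒StartsBoxed [] _ = tt
  BoxedThenMarked⇒StartsBoxed ((r , c , boxed) ∷ P) _ = tt

  BoxedThenMarked⇒NoUnmarked : ∀ P → BoxedThenMarked P → NoUnmarked P
  BoxedThenMarked⇒NoUnmarked [] _ = tt
  BoxedThenMarked⇒NoUnmarked ((r , c , boxed) ∷ P) nu = nu

  Processed⇒NoUnmarked : ∀ P → Processed P → NoUnmarked P
  Processed⇒NoUnmarked P g = subst NoUnmarked (reverse-involutive P)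
    (NoUnmarked-reverse (reverse P) (BoxedThenMarked⇒NoUnmarked (reverse P) g))

  Processed-∷ʳ-boxed : ∀ P r c → NoUnmarked P → Processed (P ++ [ (r , c , boxed) ])
  Processed-∷ʳ-boxed P r c nu rewrite reverse-++ P [ (r , c , boxed) ] = NoUnmarked-reverse P nu

  splitAtBoxed-++ : ∀ A B → NoBoxed A → StartsBoxed B → splitAtBoxed (A ++ B) ≡ (A , B)
  splitAtBoxed-++ [] [] _ _ = refl
  splitAtBoxed-++ [] ((r , c , boxed) ∷ B) _ _ = refl
  splitAtBoxed-++ ((r , c , unmarked) ∷ A) B na sb rewrite splitAtBoxed-++ A B na sb = refl
  splitAtBoxed-++ ((r , c , skipped) ∷ A) B na sb rewrite splitAtBoxed-++ A B na sb = refl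

  stepOnSplit : List Entry × List Entry → List Entry
  stepOnSplit (pre , rest) = reverse (boxFirstUnmarked (reverse (reverse (skipRun (reverse pre)) ++ rest)))

  constructionStep-split : ∀ w → constructionStep w ≡ stepOnSplit (splitAtBoxed w)
  constructionStep-split w with splitAtBoxed w
  ... | (pre , rest) = refl

  boxFirstUnmarked-++ : ∀ A B → NoUnmarked A → boxFirstUnmarked (A ++ B) ≡ A ++ boxFirstUnmarked B
  boxFirstUnmarked-++ [] B _ = refl
  boxFirstUnmarked-++ ((r , c , skipped) ∷ A) B na = cong (_ ∷_) (boxFirstUnmarked-++ A B na)
  boxFirstUnmarked-++ ((r , c , boxed) ∷ A) B na = cong (_ ∷_) (boxFirstUnmarked-++ A B na)

  constructionStep-reverse : ∀ P U → Processed P → NoBoxed U →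
    constructionStep (reverse (P ++ U)) ≡ reverse (P ++ boxFirstUnmarked (skipRun U))
  constructionStep-reverse P U gp nb = begin
    constructionStep (reverse (P ++ U))
      ≡⟨ constructionStep-split (reverse (P ++ U)) ⟩
    stepOnSplit (splitAtBoxed (reverse (P ++ U)))
      ≡⟨ cong (λ w → stepOnSplit (splitAtBoxed w)) (reverse-++ P U) ⟩
    stepOnSplit (splitAtBoxed (reverse U ++ reverse P))
      ≡⟨ cong stepOnSplit (splitAtBoxed-++ (reverse U) (reverse P) (NoBoxed-reverse U nb)
                             (BoxedThenMarked⇒StartsBoxed (reverse P) gp)) ⟩
    reverse (boxFirstUnmarked (reverse (reverse (skipRun (reverse (reverse U))) ++ reverse P)))
      ≡⟨ cong (λ z → reverse (boxFirstUnmarked (reverse (reverse (skipRun z) ++ reverse P)))) (reverse-involutive U) ⟩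
    reverse (boxFirstUnmarked (reverse (reverse (skipRun U) ++ reverse P)))
      ≡⟨ cong (λ z → reverse (boxFirstUnmarked z)) (reverse-++ (reverse (skipRun U)) (reverse P)) ⟩
    reverse (boxFirstUnmarked (reverse (reverse P) ++ reverse (reverse (skipRun U))))
      ≡⟨ cong₂ (λ a b → reverse (boxFirstUnmarked (a ++ b))) (reverse-involutive P) (reverse-involutive (skipRun U)) ⟩
    reverse (boxFirstUnmarked (P ++ skipRun U))
      ≡⟨ cong reverse (boxFirstUnmarked-++ P (skipRun U) (Processed⇒NoUnmarked P gp)) ⟩
    reverse (P ++ boxFirstUnmarked (skipRun U)) ∎
    where open ≡-Reasoning

  iter-suc : ∀ {A : Set} k (f : A → A) x → iter (suc k) f x ≡ iter k f (f x)
  iter-suc zero f x = refl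
  iter-suc (suc k) f x = cong f (iter-suc k f x)

  skipRun-AllSkipped : ∀ S → AllSkipped S → skipRun S ≡ S
  skipRun-AllSkipped [] _ = refl
  skipRun-AllSkipped ((r , c , skipped) ∷ S) as = cong (_ ∷_) (skipSame-AllSkipped S as)
    where
    skipSame-AllSkipped : ∀ S → AllSkipped S → skipSame c S ≡ S
    skipSame-AllSkipped [] _ = refl
    skipSame-AllSkipped ((r' , c' , skipped) ∷ S) as with c ≡ᵇ c'
    ... | true = cong (_ ∷_) (skipSame-AllSkipped S as)
    ... | false = refl

  boxFirstUnmarked-AllSkipped : ∀ S → AllSkipped S → boxFirstUnmarked S ≡ S
  boxFirstUnmarked-AllSkipped [] _ = refl
  boxFirstUnmarked-AllSkipped ((r , c , skipped) ∷ S) as = cong (_ ∷_) (boxFirstUnmarked-AllSkipped S as)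

  iter-constructionStep-done : ∀ s P S → Processed P → AllSkipped S →
    iter s constructionStep (reverse (P ++ S)) ≡ reverse (P ++ S)
  iter-constructionStep-done zero P S g as = refl
  iter-constructionStep-done (suc s) P S g as = begin
    iter (suc s) constructionStep (reverse (P ++ S))   ≡⟨ iter-suc s constructionStep _ ⟩
    iter s constructionStep (constructionStep (reverse (P ++ S)))
      ≡⟨ cong (iter s constructionStep) (constructionStep-reverse P S g (AllSkipped⇒NoBoxed S as)) ⟩
    iter s constructionStep (reverse (P ++ boxFirstUnmarked (skipRun S)))
      ≡⟨ cong (λ z → iter s constructionStep (reverse (P ++ z)))
              (trans (cong boxFirstUnmarked (skipRun-AllSkipped S as)) (boxFirstUnmarked-AllSkipped S as)) ⟩
    iter s constructionStep (reverse (P ++ S))   ≡⟨ iter-constructionStep-done s P S g as ⟩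
    reverse (P ++ S) ∎
    where open ≡-Reasoning

  -- On a reversed word v, afterBoxing d s v is the outcome of boxing d entries and then
  -- running s rounds; inRun c s is the state inside a round that is skipping colour c.
  module Outcome {X : Set} (rk : X → ℤ) (col : X → ℕ) where

    unmarkedEntry boxedEntry skippedEntry : X → Entry
    unmarkedEntry x = (rk x , col x , unmarked)
    boxedEntry x = (rk x , col x , boxed)
    skippedEntry x = (rk x , col x , skipped)

    skipThenBox : ℕ → List X → List Entry
    skipThenBox c [] = []
    skipThenBox c (x ∷ xs) = if c ≡ᵇ col x then skippedEntry x ∷ skipThenBox c xs else boxedEntry x ∷ map unmarkedEntry xs

    mutual
      afterSkips : ℕ → List X → List Entry
      afterSkips zero v = map unmarkedEntry v
      afterSkips (suc s) [] = []
      afterSkips (suc s) (u ∷ v) = skippedEntry u ∷ inRun (col u) s v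

      inRun : ℕ → ℕ → List X → List Entry
      inRun c s [] = []
      inRun c s (x ∷ xs) = if c ≡ᵇ col x then skippedEntry x ∷ inRun c s xs else boxedEntry x ∷ afterSkips s xs

    afterBoxing : ℕ → ℕ → List X → List Entry
    afterBoxing zero s v = afterSkips s v
    afterBoxing (suc d) s [] = []
    afterBoxing (suc d) s (x ∷ xs) = boxedEntry x ∷ afterBoxing d s xs

    NoBoxed-unmarked : ∀ v → NoBoxed (map unmarkedEntry v)
    NoBoxed-unmarked [] = tt
    NoBoxed-unmarked (x ∷ v) = NoBoxed-unmarked v

    boxFirstUnmarked-skipSame : ∀ c v → boxFirstUnmarked (skipSame c (map unmarkedEntry v)) ≡ skipThenBox c v
    boxFirstUnmarked-skipSame c [] = refl
    boxFirstUnmarked-skipSame c (x ∷ xs) with c ≡ᵇ col x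
    ... | true = cong (_ ∷_) (boxFirstUnmarked-skipSame c xs)
    ... | false = refl

    ∷ʳ-++ : ∀ {A : Set} (Q : List A) x ys → Q ++ x ∷ ys ≡ (Q ++ [ x ]) ++ ys
    ∷ʳ-++ Q x ys = sym (++-assoc Q [ x ] ys)

    mutual
      iter-afterSkips : ∀ s P v → Processed P →
        iter s constructionStep (reverse (P ++ map unmarkedEntry v)) ≡ reverse (P ++ afterSkips s v)
      iter-afterSkips zero P v g = refl
      iter-afterSkips (suc s) P [] g = iter-constructionStep-done (suc s) P [] g tt
      iter-afterSkips (suc s) P (u ∷ v) g = begin
        iter (suc s) constructionStep (reverse (P ++ map unmarkedEntry (u ∷ v)))
          ≡⟨ iter-suc s constructionStep _ ⟩
        iter s constructionStep (constructionStep (reverse (P ++ map unmarkedEntry (u ∷ v))))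
          ≡⟨ cong (iter s constructionStep) (constructionStep-reverse P _ g (NoBoxed-unmarked (u ∷ v))) ⟩
        iter s constructionStep (reverse (P ++ skippedEntry u ∷ boxFirstUnmarked (skipSame (col u) (map unmarkedEntry v))))
          ≡⟨ cong (λ z → iter s constructionStep (reverse z))
                  (trans (cong (λ z → P ++ skippedEntry u ∷ z) (boxFirstUnmarked-skipSame (col u) v)) (∷ʳ-++ P _ _)) ⟩
        iter s constructionStep (reverse ((P ++ [ skippedEntry u ]) ++ skipThenBox (col u) v))
          ≡⟨ iter-inRun s P [ skippedEntry u ] (col u) v g tt ⟩
        reverse ((P ++ [ skippedEntry u ]) ++ inRun (col u) s v)
          ≡⟨ cong reverse (sym (∷ʳ-++ P _ _)) ⟩
        reverse (P ++ afterSkips (suc s) (u ∷ v)) ∎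
        where open ≡-Reasoning

      iter-inRun : ∀ s P S c v → Processed P → AllSkipped S →
        iter s constructionStep (reverse ((P ++ S) ++ skipThenBox c v)) ≡ reverse ((P ++ S) ++ inRun c s v)
      iter-inRun s P S c [] g as rewrite ++-identityʳ (P ++ S) = iter-constructionStep-done s P S g as
      iter-inRun s P S c (x ∷ xs) g as with c ≡ᵇ col x
      ... | true =
        trans (cong (λ z → iter s constructionStep (reverse z)) (trans (∷ʳ-++ (P ++ S) _ _) (cong (_++ skipThenBox c xs) (++-assoc P S _))))
          (trans (iter-inRun s P (S ++ [ skippedEntry x ]) c xs g (AllSkipped-++ S _ as tt))
            (cong reverse (sym (trans (∷ʳ-++ (P ++ S) _ _) (cong (_++ inRun c s xs) (++-assoc P S _))))))
      ... | false =
        trans (cong (λ z → iter s constructionStep (reverse z)) (∷ʳ-++ (P ++ S) _ _))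
          (trans (iter-afterSkips s ((P ++ S) ++ [ boxedEntry x ]) xs (Processed-∷ʳ-boxed (P ++ S) _ _ nu))
            (cong reverse (sym (∷ʳ-++ (P ++ S) _ _))))
        where
        nu : NoUnmarked (P ++ S)
        nu = NoUnmarked-++ P S (Processed⇒NoUnmarked P g) (AllSkipped⇒NoUnmarked S as)

    iter-afterBoxing : ∀ d s P v → Processed P →
      iter s constructionStep (reverse (P ++ boxFirst d (map unmarkedEntry v))) ≡ reverse (P ++ afterBoxing d s v)
    iter-afterBoxing zero s P v g = iter-afterSkips s P v g
    iter-afterBoxing (suc d) s P [] g = iter-constructionStep-done s P [] g tt
    iter-afterBoxing (suc d) s P (x ∷ xs) g =
      trans (cong (λ z → iter s constructionStep (reverse z)) (∷ʳ-++ P _ _))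
        (trans (iter-afterBoxing d s (P ++ [ boxedEntry x ]) xs (Processed-∷ʳ-boxed P _ _ (Processed⇒NoUnmarked P g)))
          (cong reverse (sym (∷ʳ-++ P _ _))))

    construction-reverse : ∀ d s v →
      iter s constructionStep (boxRightmost d (reverse (map unmarkedEntry v))) ≡ reverse (afterBoxing d s v)
    construction-reverse d s v =
      trans (cong (λ z → iter s constructionStep (reverse (boxFirst d z))) (reverse-involutive (map unmarkedEntry v)))
            (iter-afterBoxing d s [] v tt)

  -- The same process on colours alone, recording which entries end up boxed.
  mutual
    skipFlags : ℕ → List ℕ → List Bool
    skipFlags zero cs = map (λ _ → false) cs
    skipFlags (suc s) [] = []
    skipFlags (suc s) (c ∷ cs) = false ∷ runFlags c s cs

    runFlags : ℕ → ℕ → List ℕ → List Bool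
    runFlags c s [] = []
    runFlags c s (c' ∷ cs) = if c ≡ᵇ c' then false ∷ runFlags c s cs else true ∷ skipFlags s cs

  constructionFlags : ℕ → ℕ → List ℕ → List Bool
  constructionFlags zero s cs = skipFlags s cs
  constructionFlags (suc d) s [] = []
  constructionFlags (suc d) s (c ∷ cs) = true ∷ constructionFlags d s cs

  forgetMark : Entry → ℤ × ℕ × Bool
  forgetMark e = (proj₁ e , proj₁ (proj₂ e) , isBoxed (proj₂ (proj₂ e)))

  module OutcomeFlags {X : Set} (rk : X → ℤ) (col : X → ℕ) (flag : X → Bool) where
    open Outcome rk col

    marked : X → ℤ × ℕ × Bool
    marked x = (rk x , col x , flag x)

    head-marked : ∀ x {b} → b ≡ flag x → (rk x , col x , b) ≡ marked x
    head-marked x = cong (λ b → (rk x , col x , b))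

    mutual
      afterSkips-marked : ∀ s v → skipFlags s (map col v) ≡ map flag v → map forgetMark (afterSkips s v) ≡ map marked v
      afterSkips-marked zero [] e = refl
      afterSkips-marked zero (x ∷ v) e = cong₂ _∷_ (head-marked x (∷-injectiveˡ e)) (afterSkips-marked zero v (∷-injectiveʳ e))
      afterSkips-marked (suc s) [] e = refl
      afterSkips-marked (suc s) (u ∷ v) e = cong₂ _∷_ (head-marked u (∷-injectiveˡ e)) (inRun-marked (col u) s v (∷-injectiveʳ e))

      inRun-marked : ∀ c s v → runFlags c s (map col v) ≡ map flag v → map forgetMark (inRun c s v) ≡ map marked v
      inRun-marked c s [] e = refl
      inRun-marked c s (x ∷ xs) e with c ≡ᵇ col x
      ... | true = cong₂ _∷_ (head-marked x (∷-injectiveˡ e)) (inRun-marked c s xs (∷-injectiveʳ e))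
      ... | false = cong₂ _∷_ (head-marked x (∷-injectiveˡ e)) (afterSkips-marked s xs (∷-injectiveʳ e))

    afterBoxing-marked : ∀ d s v → constructionFlags d s (map col v) ≡ map flag v → map forgetMark (afterBoxing d s v) ≡ map marked v
    afterBoxing-marked zero s v e = afterSkips-marked s v e
    afterBoxing-marked (suc d) s [] e = refl
    afterBoxing-marked (suc d) s (x ∷ xs) e = cong₂ _∷_ (head-marked x (∷-injectiveˡ e)) (afterBoxing-marked d s xs (∷-injectiveʳ e))

  construction-flags : ∀ a s d n (flag : Cell → Bool) → a + s + d + 1 ≡ n →
    constructionFlags d s (map proj₁ (reverse (rankCells n))) ≡ map flag (reverse (rankCells n)) →
    construction a s d ≡ map (λ c → (rank n c , proj₁ c , flag c)) (rankCells n)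
  construction-flags a s d .(a + s + d + 1) flag refl hyp = begin
    map forgetMark (iter s constructionStep (boxRightmost d (map unmarked′ (map rankEntry cs))))
      ≡⟨ cong (λ z → map forgetMark (iter s constructionStep (boxRightmost d z))) (sym (map-∘ cs)) ⟩
    map forgetMark (iter s constructionStep (boxRightmost d (map unmarkedEntry cs)))
      ≡⟨ cong (λ z → map forgetMark (iter s constructionStep (boxRightmost d (map unmarkedEntry z)))) (sym (reverse-involutive cs)) ⟩
    map forgetMark (iter s constructionStep (boxRightmost d (map unmarkedEntry (reverse v))))
      ≡⟨ cong (λ z → map forgetMark (iter s constructionStep (boxRightmost d z))) (reverse-map unmarkedEntry v) ⟩
    map forgetMark (iter s constructionStep (boxRightmost d (reverse (map unmarkedEntry v))))
      ≡⟨ cong (map forgetMark) (construction-reverse d s v) ⟩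
    map forgetMark (reverse (afterBoxing d s v))
      ≡⟨ reverse-map forgetMark (afterBoxing d s v) ⟩
    reverse (map forgetMark (afterBoxing d s v))
      ≡⟨ cong reverse (afterBoxing-marked d s v hyp) ⟩
    reverse (map marked v)
      ≡⟨ sym (reverse-map marked v) ⟩
    map marked (reverse v)
      ≡⟨ cong (map marked) (reverse-involutive cs) ⟩
    map marked cs ∎
    where
    open ≡-Reasoning
    cs = rankCells (a + s + d + 1)
    v = reverse cs
    rankEntry : Cell → ℤ × ℕ
    rankEntry c = (rank (a + s + d + 1) c , proj₁ c)
    unmarked′ : ℤ × ℕ → Entry
    unmarked′ e = (proj₁ e , proj₂ e , unmarked)
    open Outcome (rank (a + s + d + 1)) proj₁
    open OutcomeFlags (rank (a + s + d + 1)) proj₁ flag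


module SkipCounting where

  -- skipsFrom reads boxed flags from left to right and counts a skip whenever an
  -- unboxed gap that follows some boxed entry is closed by a boxed entry.
  data SkipState : Set where
    noBox afterBox inGap : SkipState

  skipsFrom : SkipState → List Bool → ℕ
  skipsFrom noBox [] = 0
  skipsFrom noBox (false ∷ xs) = skipsFrom noBox xs
  skipsFrom noBox (true ∷ xs) = skipsFrom afterBox xs
  skipsFrom afterBox [] = 0
  skipsFrom afterBox (true ∷ xs) = skipsFrom afterBox xs
  skipsFrom afterBox (false ∷ xs) = skipsFrom inGap xs
  skipsFrom inGap [] = 0
  skipsFrom inGap (false ∷ xs) = skipsFrom inGap xs
  skipsFrom inGap (true ∷ xs) = suc (skipsFrom afterBox xs)

  startState : Bool → SkipState
  startState false = noBox
  startState true = afterBox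

  runs-head : ∀ z zs → Σ ℕ λ k → Σ (List (Bool × ℕ)) λ rs → runs (z ∷ zs) ≡ (z , k) ∷ rs
  runs-head z zs with runs zs
  ... | [] = 1 , [] , refl
  runs-head true zs | (true , k) ∷ rs = suc k , rs , refl
  runs-head true zs | (false , k) ∷ rs = 1 , (false , k) ∷ rs , refl
  runs-head false zs | (true , k) ∷ rs = 1 , (true , k) ∷ rs , refl
  runs-head false zs | (false , k) ∷ rs = suc k , rs , refl

  runs-cons : ∀ x xs y k rs → runs xs ≡ (y , k) ∷ rs →
    runs (x ∷ xs) ≡ (if eqB x y then (y , suc k) ∷ rs else (x , 1) ∷ (y , k) ∷ rs)
  runs-cons x xs y k rs e with runs xs | e
  ... | _ | refl = refl

  countSkips-runs-∷∷ : ∀ bl x z zs k rs → runs (z ∷ zs) ≡ (z , k) ∷ rs →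
    countSkips false (runs (z ∷ zs)) ≡ skipsFrom noBox (z ∷ zs) → countSkips true (runs (z ∷ zs)) ≡ skipsFrom afterBox (z ∷ zs) →
    countSkips bl (runs (x ∷ z ∷ zs)) ≡ skipsFrom (startState bl) (x ∷ z ∷ zs)
  countSkips-runs-∷∷ bl x z zs k rs e i0 i1 rewrite runs-cons x (z ∷ zs) z k rs e | e = cases bl x z i0 i1
    where
    cases : ∀ bl x z → countSkips false ((z , k) ∷ rs) ≡ skipsFrom noBox (z ∷ zs) → countSkips true ((z , k) ∷ rs) ≡ skipsFrom afterBox (z ∷ zs) →
         countSkips bl (if eqB x z then (z , suc k) ∷ rs else (x , 1) ∷ (z , k) ∷ rs) ≡ skipsFrom (startState bl) (x ∷ z ∷ zs)
    cases false true true i0 i1 = i0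
    cases true true true i0 i1 = i1
    cases false false false i0 i1 = i0
    cases true false false i0 i1 = i1
    cases false true false i0 i1 = i1
    cases true true false i0 i1 = i1
    cases false false true i0 i1 = i0
    cases true false true i0 i1 = cong suc i1

  countSkips-runs : ∀ bl xs → countSkips bl (runs xs) ≡ skipsFrom (startState bl) xs
  countSkips-runs false [] = refl
  countSkips-runs true [] = refl
  countSkips-runs false (true ∷ []) = refl
  countSkips-runs false (false ∷ []) = refl
  countSkips-runs true (true ∷ []) = refl
  countSkips-runs true (false ∷ []) = refl
  countSkips-runs bl (x ∷ z ∷ zs) =
    let (k , rs , e) = runs-head z zs in countSkips-runs-∷∷ bl x z zs k rs e (countSkips-runs false (z ∷ zs)) (countSkips-runs true (z ∷ zs))


module Ranges where

  range : ℕ → ℕ → List ℕ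
  range a zero = []
  range a (suc k) = a ∷ range (suc a) k

  applyUpTo-range : ∀ (f : ℕ → ℕ) a n → (∀ i → f i ≡ a + i) → applyUpTo f n ≡ range a n
  applyUpTo-range f a zero e = refl
  applyUpTo-range f a (suc n) e =
    cong₂ _∷_ (trans (e 0) (+-identityʳ a)) (applyUpTo-range (λ i → f (suc i)) (suc a) n (λ i → trans (e (suc i)) (+-suc a i)))

  range-++ : ∀ a k1 k2 → range a (k1 + k2) ≡ range a k1 ++ range (a + k1) k2
  range-++ a zero k2 = cong (λ z → range z k2) (sym (+-identityʳ a))
  range-++ a (suc k1) k2 = cong (a ∷_) (trans (range-++ (suc a) k1 k2) (cong (λ z → range (suc a) k1 ++ range z k2) (sym (+-suc a k1))))

  length-range : ∀ a k → length (range a k) ≡ k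
  length-range a zero = refl
  length-range a (suc k) = cong suc (length-range (suc a) k)

  module _ {P : Pred ℕ 0ℓ} (P? : Decidable P) where

    filter-range-none : ∀ a k → (∀ b → a ≤ b → b < a + k → ¬ P b) → filter P? (range a k) ≡ []
    filter-range-none a zero h = refl
    filter-range-none a (suc k) h = trans (filter-reject P? (h a ≤-refl (m<m+n a (s≤s z≤n))))
      (filter-range-none (suc a) k (λ b l1 l2 → h b (<⇒≤ l1) (subst (b <_) (sym (+-suc a k)) l2)))

    filter-range-all : ∀ a k → (∀ b → a ≤ b → b < a + k → P b) → filter P? (range a k) ≡ range a k
    filter-range-all a zero h = refl
    filter-range-all a (suc k) h = trans (filter-accept P? (h a ≤-refl (m<m+n a (s≤s z≤n))))
      (cong (a ∷_) (filter-range-all (suc a) k (λ b l1 l2 → h b (<⇒≤ l1) (subst (b <_) (sym (+-suc a k)) l2))))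

    filter-range-single : ∀ a k b0 → (∀ b → a ≤ b → P b → b ≡ b0) → P b0 → a ≤ b0 → b0 < a + k →
      filter P? (range a k) ≡ [ b0 ]
    filter-range-single a zero b0 u p l1 l2 = ⊥-elim (<⇒≱ (subst (b0 <_) (+-identityʳ a) l2) l1)
    filter-range-single a (suc k) b0 u p l1 l2 with a ≟ b0
    ... | yes refl = trans (filter-accept P? p)
      (cong (b0 ∷_) (filter-range-none (suc b0) k (λ b l3 _ pb → <-irrefl (sym (u b (<⇒≤ l3) pb)) l3)))
    ... | no a≢b0 = trans (filter-reject P? (λ pa → a≢b0 (u a ≤-refl pa)))
      (filter-range-single (suc a) k b0 (λ b l pb → u b (<⇒≤ l) pb) p (≤∧≢⇒< l1 a≢b0) (subst (b0 <_) (+-suc a k) l2))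

    count-range-none : ∀ a k → (∀ b → a ≤ b → b < a + k → ¬ P b) → length (filter P? (range a k)) ≡ 0
    count-range-none a k h = cong length (filter-range-none a k h)

    count-range-all : ∀ a k → (∀ b → a ≤ b → b < a + k → P b) → length (filter P? (range a k)) ≡ k
    count-range-all a k h = trans (cong length (filter-range-all a k h)) (length-range a k)

  filter-map : ∀ {A B : Set} {P : Pred B 0ℓ} (P? : Decidable P) (f : A → B) xs →
    filter P? (map f xs) ≡ map f (filter (λ x → P? (f x)) xs)
  filter-map P? f [] = refl
  filter-map P? f (x ∷ xs) with P? (f x)
  ... | yes _ = cong (f x ∷_) (filter-map P? f xs)
  ... | no _ = filter-map P? f xs


module RankBlocks where

  open Int using (+_; -_) renaming (_+_ to _+ℤ_)

  open Ranges

  -x+y≡z⇒y≡z+x : ∀ x y z → (- (+ x)) +ℤ (+ y) ≡ + z → y ≡ z + x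
  -x+y≡z⇒y≡z+x x y z e with x ≤? y
  ... | yes x≤y = trans (sym (m∸n+n≡m x≤y)) (cong (_+ x) (ℤP.+-injective (trans (sym (ℤP.⊖-≥ x≤y)) (trans (sym (ℤP.-m+n≡n⊖m x y)) e))))
  ... | no x≰y = ⊥-elim (-suc≢+ (x ∸ y) z (m<n⇒0<n∸m (≰⇒> x≰y)) (trans (sym (ℤP.⊖-≰ x≰y)) (trans (sym (ℤP.-m+n≡n⊖m x y)) e)))
    where
    -suc≢+ : ∀ k z → 0 < k → - (+ k) ≢ + z
    -suc≢+ (suc k) z _ ()

  y≡z+x⇒-x+y≡z : ∀ x y z → y ≡ z + x → (- (+ x)) +ℤ (+ y) ≡ + z
  y≡z+x⇒-x+y≡z x .(z + x) z refl = trans (ℤP.-m+n≡n⊖m x (z + x)) (trans (ℤP.⊖-≥ (m≤n+m x z)) (cong +_ (m+n∸n≡m z x)))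

  rowsOfRank : ℕ → ℕ → ℕ → List ℕ
  rowsOfRank n a r = filter (λ b → rank n (a , b) ℤP.≟ + r) (range 1 n)

  cellsOfRank : ℕ → ℕ → List Cell
  cellsOfRank n r = filter (λ c → rank n c ℤP.≟ + r) (cells n)

  cells-byColumn : ∀ n → cells n ≡ map (1 ,_) (range 1 n) ++ (map (2 ,_) (range 1 n) ++ (map (3 ,_) (range 1 n) ++ []))
  cells-byColumn n rewrite applyUpTo-range suc 1 n (λ i → refl) = refl

  hasRank? : ∀ n r (c : Cell) → Dec (rank n c ≡ + r)
  hasRank? n r c = rank n c ℤP.≟ + r

  cellsOfRank-byColumn : ∀ n r → cellsOfRank n r ≡ map (1 ,_) (rowsOfRank n 1 r) ++ (map (2 ,_) (rowsOfRank n 2 r) ++ (map (3 ,_) (rowsOfRank n 3 r) ++ []))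
  cellsOfRank-byColumn n r rewrite cells-byColumn n
    | filter-++ (hasRank? n r) (map (1 ,_) (range 1 n)) (map (2 ,_) (range 1 n) ++ (map (3 ,_) (range 1 n) ++ []))
    | filter-++ (hasRank? n r) (map (2 ,_) (range 1 n)) (map (3 ,_) (range 1 n) ++ [])
    | filter-++ (hasRank? n r) (map (3 ,_) (range 1 n)) []
    | filter-map (hasRank? n r) (1 ,_) (range 1 n)
    | filter-map (hasRank? n r) (2 ,_) (range 1 n)
    | filter-map (hasRank? n r) (3 ,_) (range 1 n) = refl

  rowsOfRank-single : ∀ n a r K → 3 * K ≡ r + a * n → K < n → rowsOfRank n a r ≡ [ suc K ]
  rowsOfRank-single n a r K e lt = filter-range-single (λ b → rank n (a , b) ℤP.≟ + r) 1 n (suc K) unique (y≡z+x⇒-x+y≡z (a * n) (3 * K) r e) (s≤s z≤n) (s≤s lt)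
    where
    unique : ∀ b → 1 ≤ b → rank n (a , b) ≡ + r → b ≡ suc K
    unique (suc b) _ p = cong suc (*-cancelˡ-≡ b K 3 (trans (-x+y≡z⇒y≡z+x (a * n) (3 * b) r p) (sym e)))

  rowsOfRank-none : ∀ n a r → (∀ K → K < n → 3 * K ≢ r + a * n) → rowsOfRank n a r ≡ []
  rowsOfRank-none n a r h = filter-range-none (λ b → rank n (a , b) ℤP.≟ + r) 1 n absent
    where
    absent : ∀ b → 1 ≤ b → b < 1 + n → ¬ (rank n (a , b) ≡ + r)
    absent (suc b) _ (s≤s lt) p = h b lt (-x+y≡z⇒y≡z+x (a * n) (3 * b) r p)

  3*K≢3*X+ρ : ∀ K X ρ → 0 < ρ → ρ < 3 → 3 * K ≢ 3 * X + ρ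
  3*K≢3*X+ρ K X ρ 0<ρ ρ<3 e = <⇒≢ 0<ρ (begin
    0                ≡⟨ sym (m*n%n≡0 K 3) ⟩
    K * 3 % 3        ≡⟨ cong (_% 3) (trans (*-comm K 3) e) ⟩
    (3 * X + ρ) % 3  ≡⟨ cong (_% 3) (trans (+-comm (3 * X) ρ) (cong (λ x → ρ + x) (*-comm 3 X))) ⟩
    (ρ + X * 3) % 3  ≡⟨ [m+kn]%n≡m%n ρ X 3 ⟩
    ρ % 3            ≡⟨ m<n⇒m%n≡m ρ<3 ⟩
    ρ ∎)
    where open ≡-Reasoning

  rowsOfRank-none₁ : ∀ n a r X → r + a * n ≡ 3 * X + 1 → rowsOfRank n a r ≡ []
  rowsOfRank-none₁ n a r X e = rowsOfRank-none n a r (λ K _ e' → 3*K≢3*X+ρ K X 1 (s≤s z≤n) (s≤s (s≤s z≤n)) (trans e' e))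

  rowsOfRank-none₂ : ∀ n a r X → r + a * n ≡ 3 * X + 2 → rowsOfRank n a r ≡ []
  rowsOfRank-none₂ n a r X e = rowsOfRank-none n a r (λ K _ e' → 3*K≢3*X+ρ K X 2 (s≤s z≤n) ≤-refl (trans e' e))

  rowsOfRank-none-high : ∀ n a r X → r + a * n ≡ 3 * X → n ≤ X → rowsOfRank n a r ≡ []
  rowsOfRank-none-high n a r X e le = rowsOfRank-none n a r (λ K lt e' → <-irrefl refl (<-≤-trans lt (≤-trans le (≤-reflexive (sym (*-cancelˡ-≡ K X 3 (trans e' e)))))))

  cellsOfRank-rows : ∀ n r {A B C} → rowsOfRank n 1 r ≡ A → rowsOfRank n 2 r ≡ B → rowsOfRank n 3 r ≡ C →
    cellsOfRank n r ≡ map (1 ,_) A ++ (map (2 ,_) B ++ (map (3 ,_) C ++ []))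
  cellsOfRank-rows n r refl refl refl = cellsOfRank-byColumn n r

  block : ℕ → ℕ → List Cell
  block n j = cellsOfRank n (3 * j + 1) ++ (cellsOfRank n (3 * j + 2) ++ cellsOfRank n (3 * j + 3))

  blocks : ℕ → ℕ → ℕ → List Cell
  blocks n j zero = []
  blocks n j (suc k) = block n j ++ blocks n (suc j) k

  applyUpTo-cong : ∀ {A : Set} (f h : ℕ → A) n → (∀ i → f i ≡ h i) → applyUpTo f n ≡ applyUpTo h n
  applyUpTo-cong f h zero e = refl
  applyUpTo-cong f h (suc n) e = cong₂ _∷_ (e 0) (applyUpTo-cong (λ i → f (suc i)) (λ i → h (suc i)) n (λ i → e (suc i)))

  block-shift : ∀ j i → 3 * j + suc (3 + i) ≡ 3 * suc j + suc i
  block-shift = solve-∀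

  concatMap-cellsOfRank : ∀ n j k → concatMap (cellsOfRank n) (applyUpTo (λ i → 3 * j + suc i) (3 * k)) ≡ blocks n j k
  concatMap-cellsOfRank n j zero rewrite *-zeroʳ 3 = refl
  concatMap-cellsOfRank n j (suc k) =
    trans (cong (concatMap (cellsOfRank n)) (applyUpTo-3*suc (λ i → 3 * j + suc i) k))
    (trans (cong (cellsOfRank n (3 * j + 1) ++_) (sym (++-assoc (cellsOfRank n (3 * j + 2)) (cellsOfRank n (3 * j + 3)) _)))
     (trans (sym (++-assoc (cellsOfRank n (3 * j + 1)) _ _))
       (cong (block n j ++_)
         (trans (cong (concatMap (cellsOfRank n)) (applyUpTo-cong _ (λ i → 3 * suc j + suc i) (3 * k) (λ i → block-shift j i)))
                (concatMap-cellsOfRank n (suc j) k)))))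
    where
    applyUpTo-3*suc : ∀ {A : Set} (f : ℕ → A) k → applyUpTo f (3 * suc k) ≡ f 0 ∷ f 1 ∷ f 2 ∷ applyUpTo (λ i → f (3 + i)) (3 * k)
    applyUpTo-3*suc f k = cong (applyUpTo f) (*-suc 3 k)

  rankCells-blocks : ∀ n → rankCells n ≡ blocks n 0 n
  rankCells-blocks n = concatMap-cellsOfRank n 0 n

  blocks-snoc : ∀ n j k → blocks n j (suc k) ≡ blocks n j k ++ block n (j + k)
  blocks-snoc n j zero = trans (++-identityʳ (block n j)) (cong (block n) (sym (+-identityʳ j)))
  blocks-snoc n j (suc k) = trans (cong (block n j ++_) (blocks-snoc n (suc j) k))
                          (trans (sym (++-assoc (block n j) _ _)) (cong (λ z → (block n j ++ blocks n (suc j) k) ++ block n z) (sym (+-suc j k))))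

  reversedBlocks : ℕ → ℕ → ℕ → List Cell
  reversedBlocks n L zero = []
  reversedBlocks n L (suc k) = reverse (block n (L + k)) ++ reversedBlocks n L k

  reverse-blocks-+ : ∀ n L k → reverse (blocks n 0 (L + k)) ≡ reversedBlocks n L k ++ reverse (blocks n 0 L)
  reverse-blocks-+ n L zero = cong (λ z → reverse (blocks n 0 z)) (+-identityʳ L)
  reverse-blocks-+ n L (suc k) = begin
    reverse (blocks n 0 (L + suc k)) ≡⟨ cong (λ z → reverse (blocks n 0 z)) (+-suc L k) ⟩
    reverse (blocks n 0 (suc (L + k))) ≡⟨ cong reverse (blocks-snoc n 0 (L + k)) ⟩
    reverse (blocks n 0 (L + k) ++ block n (L + k)) ≡⟨ reverse-++ (blocks n 0 (L + k)) (block n (L + k)) ⟩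
    reverse (block n (L + k)) ++ reverse (blocks n 0 (L + k)) ≡⟨ cong (reverse (block n (L + k)) ++_) (reverse-blocks-+ n L k) ⟩
    reverse (block n (L + k)) ++ (reversedBlocks n L k ++ reverse (blocks n 0 L)) ≡⟨ sym (++-assoc (reverse (block n (L + k))) _ _) ⟩
    reversedBlocks n L (suc k) ++ reverse (blocks n 0 L) ∎
    where open ≡-Reasoning

  repeat : ∀ {A : Set} → ℕ → List A → List A
  repeat zero xs = []
  repeat (suc k) xs = xs ++ repeat k xs

  repeat-[] : ∀ {A : Set} k → repeat {A} k [] ≡ []
  repeat-[] zero = refl
  repeat-[] (suc k) = repeat-[] k

  map-reversedBlocks : ∀ {A : Set} (f : Cell → A) n L k (C : List A) → (∀ i → i < k → map f (reverse (block n (L + i))) ≡ C) →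
    map f (reversedBlocks n L k) ≡ repeat k C
  map-reversedBlocks f n L zero C h = refl
  map-reversedBlocks f n L (suc k) C h = trans (map-++ f (reverse (block n (L + k))) (reversedBlocks n L k))
    (cong₂ _++_ (h k ≤-refl) (map-reversedBlocks f n L k C (λ i lt → h i (m≤n⇒m≤1+n lt))))

  reverse-rankCells-segments : ∀ {A : Set} (f : Cell → A) n k1 k2 k3 k4 k5 → k1 + k2 + k3 + k4 + k5 ≡ n →
    (∀ i → i < k5 → map f (reverse (block n (k1 + k2 + k3 + k4 + i))) ≡ []) →
    map f (reverse (rankCells n)) ≡
      map f (reversedBlocks n (k1 + k2 + k3) k4) ++ (map f (reversedBlocks n (k1 + k2) k3) ++
        (map f (reversedBlocks n k1 k2) ++ (map f (reversedBlocks n 0 k1) ++ [])))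
  reverse-rankCells-segments f n k1 k2 k3 k4 k5 e empty = begin
    map f (reverse (rankCells n))
      ≡⟨ cong (λ z → map f (reverse z)) (trans (rankCells-blocks n) (cong (blocks n 0) (sym e))) ⟩
    map f (reverse (blocks n 0 (k1 + k2 + k3 + k4 + k5)))
      ≡⟨ split-off (k1 + k2 + k3 + k4) k5 ⟩
    map f (reversedBlocks n (k1 + k2 + k3 + k4) k5) ++ map f (reverse (blocks n 0 (k1 + k2 + k3 + k4)))
      ≡⟨ cong (_++ _) (trans (map-reversedBlocks f n _ k5 [] empty) (repeat-[] k5)) ⟩
    map f (reverse (blocks n 0 (k1 + k2 + k3 + k4)))
      ≡⟨ split-off (k1 + k2 + k3) k4 ⟩
    S₄ ++ map f (reverse (blocks n 0 (k1 + k2 + k3)))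
      ≡⟨ cong (S₄ ++_) (split-off (k1 + k2) k3) ⟩
    S₄ ++ (S₃ ++ map f (reverse (blocks n 0 (k1 + k2))))
      ≡⟨ cong (λ z → S₄ ++ (S₃ ++ z)) (split-off k1 k2) ⟩
    S₄ ++ (S₃ ++ (S₂ ++ map f (reverse (blocks n 0 k1))))
      ≡⟨ cong (λ z → S₄ ++ (S₃ ++ (S₂ ++ z))) (split-off 0 k1) ⟩
    S₄ ++ (S₃ ++ (S₂ ++ (map f (reversedBlocks n 0 k1) ++ []))) ∎
    where
    open ≡-Reasoning
    S₄ = map f (reversedBlocks n (k1 + k2 + k3) k4)
    S₃ = map f (reversedBlocks n (k1 + k2) k3)
    S₂ = map f (reversedBlocks n k1 k2)
    split-off : ∀ L k → map f (reverse (blocks n 0 (L + k))) ≡ map f (reversedBlocks n L k) ++ map f (reverse (blocks n 0 L))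
    split-off L k = trans (cong (map f) (reverse-blocks-+ n L k)) (map-++ f (reversedBlocks n L k) (reverse (blocks n 0 L)))


-- The blocks for n = 3m + 1.  The identity rᵅcᵝ rewrites  r + β n  for the rank
-- r = 3j + α; its residue mod 3 and its size decide which row of column β, if any,
-- has rank r.
module ResidueOneBlocks where

  open RankBlocks

  r₁c₁ : ∀ m j → 3 * j + 1 + 1 * (3 * m + 1) ≡ 3 * (j + m) + 2
  r₁c₁ = solve-∀
  r₁c₂ : ∀ m j → 3 * (j + 2 * m + 1) ≡ 3 * j + 1 + 2 * (3 * m + 1)
  r₁c₂ = solve-∀
  r₁c₃ : ∀ m j → 3 * j + 1 + 3 * (3 * m + 1) ≡ 3 * (j + 3 * m + 1) + 1
  r₁c₃ = solve-∀
  r₂c₁ : ∀ m j → 3 * (j + m + 1) ≡ 3 * j + 2 + 1 * (3 * m + 1)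
  r₂c₁ = solve-∀
  r₂c₂ : ∀ m j → 3 * j + 2 + 2 * (3 * m + 1) ≡ 3 * (j + 2 * m + 1) + 1
  r₂c₂ = solve-∀
  r₂c₃ : ∀ m j → 3 * j + 2 + 3 * (3 * m + 1) ≡ 3 * (j + 3 * m + 1) + 2
  r₂c₃ = solve-∀
  r₃c₁ : ∀ m j → 3 * j + 3 + 1 * (3 * m + 1) ≡ 3 * (j + m + 1) + 1
  r₃c₁ = solve-∀
  r₃c₂ : ∀ m j → 3 * j + 3 + 2 * (3 * m + 1) ≡ 3 * (j + 2 * m + 1) + 2
  r₃c₂ = solve-∀
  r₃c₃ : ∀ m j → 3 * j + 3 + 3 * (3 * m + 1) ≡ 3 * (j + 3 * m + 2)
  r₃c₃ = solve-∀
  m+2m+1≡n : ∀ m → m + 2 * m + 1 ≡ 3 * m + 1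
  m+2m+1≡n = solve-∀
  2m+m+1≡n : ∀ m → 2 * m + m + 1 ≡ 3 * m + 1
  2m+m+1≡n = solve-∀
  n+1+j≡j+n+1 : ∀ m j → 3 * m + 1 + (1 + j) ≡ j + 3 * m + 2
  n+1+j≡j+n+1 = solve-∀

  module Blocks (m : ℕ) where
    n = 3 * m + 1

    row₂<n : ∀ j → j < m → j + 2 * m + 1 < 3 * m + 1
    row₂<n j lt = subst (suc (j + 2 * m + 1) ≤_) (m+2m+1≡n m) (+-monoˡ-≤ 1 (+-monoˡ-≤ (2 * m) lt))
    n≤row₂ : ∀ j → m ≤ j → 3 * m + 1 ≤ j + 2 * m + 1
    n≤row₂ j le = subst (_≤ j + 2 * m + 1) (m+2m+1≡n m) (+-monoˡ-≤ 1 (+-monoˡ-≤ (2 * m) le))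
    row₁<n : ∀ j → j < 2 * m → j + m + 1 < 3 * m + 1
    row₁<n j lt = subst (suc (j + m + 1) ≤_) (2m+m+1≡n m) (+-monoˡ-≤ 1 (+-monoˡ-≤ m lt))
    n≤row₁ : ∀ j → 2 * m ≤ j → 3 * m + 1 ≤ j + m + 1
    n≤row₁ j le = subst (_≤ j + m + 1) (2m+m+1≡n m) (+-monoˡ-≤ 1 (+-monoˡ-≤ m le))
    n≤row₃ : ∀ j → 3 * m + 1 ≤ j + 3 * m + 2
    n≤row₃ j = subst (3 * m + 1 ≤_) (n+1+j≡j+n+1 m j) (m≤m+n (3 * m + 1) (1 + j))

    rank3j+1 : ∀ j → j < m → cellsOfRank n (3 * j + 1) ≡ (2 , suc (j + 2 * m + 1)) ∷ []
    rank3j+1 j lt = cellsOfRank-rows n (3 * j + 1)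
      (rowsOfRank-none₂ n 1 _ (j + m) (r₁c₁ m j))
      (rowsOfRank-single n 2 _ (j + 2 * m + 1) (r₁c₂ m j) (row₂<n j lt))
      (rowsOfRank-none₁ n 3 _ (j + 3 * m + 1) (r₁c₃ m j))

    noRank3j+1 : ∀ j → m ≤ j → cellsOfRank n (3 * j + 1) ≡ []
    noRank3j+1 j le = cellsOfRank-rows n (3 * j + 1)
      (rowsOfRank-none₂ n 1 _ (j + m) (r₁c₁ m j))
      (rowsOfRank-none-high n 2 _ (j + 2 * m + 1) (sym (r₁c₂ m j)) (n≤row₂ j le))
      (rowsOfRank-none₁ n 3 _ (j + 3 * m + 1) (r₁c₃ m j))

    rank3j+2 : ∀ j → j < 2 * m → cellsOfRank n (3 * j + 2) ≡ (1 , suc (j + m + 1)) ∷ []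
    rank3j+2 j lt = cellsOfRank-rows n (3 * j + 2)
      (rowsOfRank-single n 1 _ (j + m + 1) (r₂c₁ m j) (row₁<n j lt))
      (rowsOfRank-none₁ n 2 _ (j + 2 * m + 1) (r₂c₂ m j))
      (rowsOfRank-none₂ n 3 _ (j + 3 * m + 1) (r₂c₃ m j))

    noRank3j+2 : ∀ j → 2 * m ≤ j → cellsOfRank n (3 * j + 2) ≡ []
    noRank3j+2 j le = cellsOfRank-rows n (3 * j + 2)
      (rowsOfRank-none-high n 1 _ (j + m + 1) (sym (r₂c₁ m j)) (n≤row₁ j le))
      (rowsOfRank-none₁ n 2 _ (j + 2 * m + 1) (r₂c₂ m j))
      (rowsOfRank-none₂ n 3 _ (j + 3 * m + 1) (r₂c₃ m j))

    noRank3j+3 : ∀ j → cellsOfRank n (3 * j + 3) ≡ []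
    noRank3j+3 j = cellsOfRank-rows n (3 * j + 3)
      (rowsOfRank-none₁ n 1 _ (j + m + 1) (r₃c₁ m j))
      (rowsOfRank-none₂ n 2 _ (j + 2 * m + 1) (r₃c₂ m j))
      (rowsOfRank-none-high n 3 _ (j + 3 * m + 2) (r₃c₃ m j) (n≤row₃ j))

    block-pair : ∀ j → j < m → block n j ≡ (2 , suc (j + 2 * m + 1)) ∷ (1 , suc (j + m + 1)) ∷ []
    block-pair j lt rewrite rank3j+1 j lt | rank3j+2 j (<-≤-trans lt (m≤n*m m 2)) | noRank3j+3 j = refl

    block-single : ∀ j → m ≤ j → j < 2 * m → block n j ≡ (1 , suc (j + m + 1)) ∷ []
    block-single j le lt rewrite noRank3j+1 j le | rank3j+2 j lt | noRank3j+3 j = refl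

    block-empty : ∀ j → 2 * m ≤ j → block n j ≡ []
    block-empty j le rewrite noRank3j+1 j (≤-trans (m≤n*m m 2) le) | noRank3j+2 j le | noRank3j+3 j = refl


module ResidueTwoBlocks where

  open RankBlocks

  r₁c₁ : ∀ m j → 3 * (j + m + 1) ≡ 3 * j + 1 + 1 * (3 * m + 2)
  r₁c₁ = solve-∀
  r₁c₂ : ∀ m j → 3 * j + 1 + 2 * (3 * m + 2) ≡ 3 * (j + 2 * m + 1) + 2
  r₁c₂ = solve-∀
  r₁c₃ : ∀ m j → 3 * j + 1 + 3 * (3 * m + 2) ≡ 3 * (j + 3 * m + 2) + 1
  r₁c₃ = solve-∀
  r₂c₁ : ∀ m j → 3 * j + 2 + 1 * (3 * m + 2) ≡ 3 * (j + m + 1) + 1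
  r₂c₁ = solve-∀
  r₂c₂ : ∀ m j → 3 * (j + 2 * m + 2) ≡ 3 * j + 2 + 2 * (3 * m + 2)
  r₂c₂ = solve-∀
  r₂c₃ : ∀ m j → 3 * j + 2 + 3 * (3 * m + 2) ≡ 3 * (j + 3 * m + 2) + 2
  r₂c₃ = solve-∀
  r₃c₁ : ∀ m j → 3 * j + 3 + 1 * (3 * m + 2) ≡ 3 * (j + m + 1) + 2
  r₃c₁ = solve-∀
  r₃c₂ : ∀ m j → 3 * j + 3 + 2 * (3 * m + 2) ≡ 3 * (j + 2 * m + 2) + 1
  r₃c₂ = solve-∀
  r₃c₃ : ∀ m j → 3 * j + 3 + 3 * (3 * m + 2) ≡ 3 * (j + 3 * m + 3)
  r₃c₃ = solve-∀
  m+2m+2≡n : ∀ m → m + 2 * m + 2 ≡ 3 * m + 2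
  m+2m+2≡n = solve-∀
  2m+1+m+1≡n : ∀ m → (2 * m + 1) + m + 1 ≡ 3 * m + 2
  2m+1+m+1≡n = solve-∀
  n+1+j≡j+n+1 : ∀ m j → 3 * m + 2 + (1 + j) ≡ j + 3 * m + 3
  n+1+j≡j+n+1 = solve-∀

  module Blocks (m : ℕ) where
    n = 3 * m + 2

    row₂<n : ∀ j → j < m → j + 2 * m + 2 < 3 * m + 2
    row₂<n j lt = subst (suc (j + 2 * m + 2) ≤_) (m+2m+2≡n m) (+-monoˡ-≤ 2 (+-monoˡ-≤ (2 * m) lt))
    n≤row₂ : ∀ j → m ≤ j → 3 * m + 2 ≤ j + 2 * m + 2
    n≤row₂ j le = subst (_≤ j + 2 * m + 2) (m+2m+2≡n m) (+-monoˡ-≤ 2 (+-monoˡ-≤ (2 * m) le))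
    row₁<n : ∀ j → j < 2 * m + 1 → j + m + 1 < 3 * m + 2
    row₁<n j lt = subst (suc (j + m + 1) ≤_) (2m+1+m+1≡n m) (+-monoˡ-≤ 1 (+-monoˡ-≤ m lt))
    n≤row₁ : ∀ j → 2 * m + 1 ≤ j → 3 * m + 2 ≤ j + m + 1
    n≤row₁ j le = subst (_≤ j + m + 1) (2m+1+m+1≡n m) (+-monoˡ-≤ 1 (+-monoˡ-≤ m le))
    n≤row₃ : ∀ j → 3 * m + 2 ≤ j + 3 * m + 3
    n≤row₃ j = subst (3 * m + 2 ≤_) (n+1+j≡j+n+1 m j) (m≤m+n (3 * m + 2) (1 + j))

    rank3j+1 : ∀ j → j < 2 * m + 1 → cellsOfRank n (3 * j + 1) ≡ (1 , suc (j + m + 1)) ∷ []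
    rank3j+1 j lt = cellsOfRank-rows n (3 * j + 1)
      (rowsOfRank-single n 1 _ (j + m + 1) (r₁c₁ m j) (row₁<n j lt))
      (rowsOfRank-none₂ n 2 _ (j + 2 * m + 1) (r₁c₂ m j))
      (rowsOfRank-none₁ n 3 _ (j + 3 * m + 2) (r₁c₃ m j))

    noRank3j+1 : ∀ j → 2 * m + 1 ≤ j → cellsOfRank n (3 * j + 1) ≡ []
    noRank3j+1 j le = cellsOfRank-rows n (3 * j + 1)
      (rowsOfRank-none-high n 1 _ (j + m + 1) (sym (r₁c₁ m j)) (n≤row₁ j le))
      (rowsOfRank-none₂ n 2 _ (j + 2 * m + 1) (r₁c₂ m j))
      (rowsOfRank-none₁ n 3 _ (j + 3 * m + 2) (r₁c₃ m j))

    rank3j+2 : ∀ j → j < m → cellsOfRank n (3 * j + 2) ≡ (2 , suc (j + 2 * m + 2)) ∷ []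
    rank3j+2 j lt = cellsOfRank-rows n (3 * j + 2)
      (rowsOfRank-none₁ n 1 _ (j + m + 1) (r₂c₁ m j))
      (rowsOfRank-single n 2 _ (j + 2 * m + 2) (r₂c₂ m j) (row₂<n j lt))
      (rowsOfRank-none₂ n 3 _ (j + 3 * m + 2) (r₂c₃ m j))

    noRank3j+2 : ∀ j → m ≤ j → cellsOfRank n (3 * j + 2) ≡ []
    noRank3j+2 j le = cellsOfRank-rows n (3 * j + 2)
      (rowsOfRank-none₁ n 1 _ (j + m + 1) (r₂c₁ m j))
      (rowsOfRank-none-high n 2 _ (j + 2 * m + 2) (sym (r₂c₂ m j)) (n≤row₂ j le))
      (rowsOfRank-none₂ n 3 _ (j + 3 * m + 2) (r₂c₃ m j))

    noRank3j+3 : ∀ j → cellsOfRank n (3 * j + 3) ≡ []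
    noRank3j+3 j = cellsOfRank-rows n (3 * j + 3)
      (rowsOfRank-none₂ n 1 _ (j + m + 1) (r₃c₁ m j))
      (rowsOfRank-none₁ n 2 _ (j + 2 * m + 2) (r₃c₂ m j))
      (rowsOfRank-none-high n 3 _ (j + 3 * m + 3) (r₃c₃ m j) (n≤row₃ j))

    block-pair : ∀ j → j < m → block n j ≡ (1 , suc (j + m + 1)) ∷ (2 , suc (j + 2 * m + 2)) ∷ []
    block-pair j lt rewrite rank3j+1 j (<-≤-trans lt (≤-trans (m≤n*m m 2) (m≤m+n (2 * m) 1))) | rank3j+2 j lt | noRank3j+3 j = refl

    block-single : ∀ j → m ≤ j → j < 2 * m + 1 → block n j ≡ (1 , suc (j + m + 1)) ∷ []
    block-single j le lt rewrite rank3j+1 j lt | noRank3j+2 j le | noRank3j+3 j = refl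

    block-empty : ∀ j → 2 * m + 1 ≤ j → block n j ≡ []
    block-empty j le rewrite noRank3j+1 j le | noRank3j+2 j (≤-trans (m≤n*m m 2) (≤-trans (m≤m+n (2 * m) 1) le)) | noRank3j+3 j = refl


module DyckHeights where

  All-pointsFrom-head : ∀ {P : ℕ × ℕ → Set} x y p → All P (pointsFrom x y p) → P (x , y)
  All-pointsFrom-head x y [] (px ∷ _) = px
  All-pointsFrom-head x y (N ∷ p) (px ∷ _) = px
  All-pointsFrom-head x y (E ∷ p) (px ∷ _) = px

  eastHeight-aboveDiagonal : ∀ n x y p → All (λ q → n * proj₁ q ≤ 3 * proj₂ q) (pointsFrom x y p) →
    ∀ i → i < #E p → n * (suc i + x) ≤ 3 * nth (eastHeightsFrom y p) i
  eastHeight-aboveDiagonal n x y [] a i ()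
  eastHeight-aboveDiagonal n x y (N ∷ p) (_ ∷ a) i lt = eastHeight-aboveDiagonal n x (suc y) p a i lt
  eastHeight-aboveDiagonal n x y (E ∷ p) (_ ∷ a) zero lt = All-pointsFrom-head (suc x) y p a
  eastHeight-aboveDiagonal n x y (E ∷ p) (_ ∷ a) (suc i) (s≤s lt) =
    subst (λ z → n * z ≤ 3 * nth (eastHeightsFrom y p) i) (+-suc (suc i) x) (eastHeight-aboveDiagonal n (suc x) y p a i lt)

  start≤eastHeight : ∀ y p i → i < #E p → y ≤ nth (eastHeightsFrom y p) i
  start≤eastHeight y [] i ()
  start≤eastHeight y (N ∷ p) i lt = <⇒≤ (start≤eastHeight (suc y) p i lt)
  start≤eastHeight y (E ∷ p) zero lt = ≤-refl
  start≤eastHeight y (E ∷ p) (suc i) (s≤s lt) = start≤eastHeight y p i lt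

  eastHeight-mono : ∀ y p i → suc i < #E p → nth (eastHeightsFrom y p) i ≤ nth (eastHeightsFrom y p) (suc i)
  eastHeight-mono y [] i ()
  eastHeight-mono y (N ∷ p) i lt = eastHeight-mono (suc y) p i lt
  eastHeight-mono y (E ∷ p) zero (s≤s lt) = start≤eastHeight y p 0 lt
  eastHeight-mono y (E ∷ p) (suc i) (s≤s lt) = eastHeight-mono y p i lt

  eastHeight≤end : ∀ y p i → i < #E p → nth (eastHeightsFrom y p) i ≤ y + #N p
  eastHeight≤end y [] i ()
  eastHeight≤end y (N ∷ p) i lt = subst (nth (eastHeightsFrom (suc y) p) i ≤_) (sym (+-suc y (#N p))) (eastHeight≤end (suc y) p i lt)
  eastHeight≤end y (E ∷ p) zero lt = m≤m+n y (#N p)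
  eastHeight≤end y (E ∷ p) (suc i) (s≤s lt) = eastHeight≤end y p i lt

  record ColumnHeights (n : ℕ) (p : List Step) : Set where
    field
      h₁≤h₂ : colHeight p 1 ≤ colHeight p 2
      h₂≤n : colHeight p 2 ≤ n
      h₃≡n : colHeight p 3 ≡ n
      n≤3h₁ : n ≤ 3 * colHeight p 1
      2n≤3h₂ : 2 * n ≤ 3 * colHeight p 2

  dyck⇒columnHeights : ∀ n p → IsDyckPath n p → ColumnHeights n p
  dyck⇒columnHeights n p (#E≡3 , #N≡n , above) = record
    { h₁≤h₂ = eastHeight-mono 0 p 0 (col< 1 (s≤s (s≤s z≤n)))
    ; h₂≤n = height≤n 1 (s≤s (s≤s z≤n))
    ; h₃≡n = ≤-antisym (height≤n 2 ≤-refl)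
        (*-cancelˡ-≤ 3 (subst (_≤ 3 * colHeight p 3) (*-comm n 3) (eastHeight-aboveDiagonal n 0 0 p above 2 (col< 2 ≤-refl))))
    ; n≤3h₁ = subst (_≤ 3 * colHeight p 1) (*-identityʳ n) (eastHeight-aboveDiagonal n 0 0 p above 0 (col< 0 (s≤s z≤n)))
    ; 2n≤3h₂ = subst (_≤ 3 * colHeight p 2) (*-comm n 2) (eastHeight-aboveDiagonal n 0 0 p above 1 (col< 1 (s≤s (s≤s z≤n))))
    }
    where
    col< : ∀ i → i < 3 → i < #E p
    col< i l = subst (i <_) (sym #E≡3) l
    height≤n : ∀ i → i < 3 → nth (eastHeightsFrom 0 p) i ≤ n
    height≤n i l = subst (nth (eastHeightsFrom 0 p) i ≤_) #N≡n (eastHeight≤end 0 p i (col< i l))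


module LambdaStatistics where

  open Ranges
  open RankBlocks using (cells-byColumn)

  length-filter-map : ∀ {A B : Set} {P : Pred B 0ℓ} (P? : Decidable P) (f : A → B) xs →
    length (filter P? (map f xs)) ≡ length (filter (λ x → P? (f x)) xs)
  length-filter-map P? f xs = trans (cong length (filter-map P? f xs)) (length-map f (filter (λ x → P? (f x)) xs))

  length-filter-++ : ∀ {A : Set} {P : Pred A 0ℓ} (P? : Decidable P) xs ys →
    length (filter P? (xs ++ ys)) ≡ length (filter P? xs) + length (filter P? ys)
  length-filter-++ P? xs ys = trans (cong length (filter-++ P? xs ys)) (length-++ (filter P? xs))

  length-filter-cells : ∀ {P : Pred Cell 0ℓ} (P? : Decidable P) n →
    length (filter P? (cells n)) ≡
      length (filter (λ b → P? (1 , b)) (range 1 n)) + (length (filter (λ b → P? (2 , b)) (range 1 n)) + (length (filter (λ b → P? (3 , b)) (range 1 n)) + 0))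
  length-filter-cells P? n rewrite cells-byColumn n
    | length-filter-++ P? (map (1 ,_) (range 1 n)) (map (2 ,_) (range 1 n) ++ (map (3 ,_) (range 1 n) ++ []))
    | length-filter-++ P? (map (2 ,_) (range 1 n)) (map (3 ,_) (range 1 n) ++ [])
    | length-filter-++ P? (map (3 ,_) (range 1 n)) []
    | length-filter-map P? (1 ,_) (range 1 n)
    | length-filter-map P? (2 ,_) (range 1 n)
    | length-filter-map P? (3 ,_) (range 1 n) = refl

  filter-cells : ∀ {P : Pred Cell 0ℓ} (P? : Decidable P) n →
    filter P? (cells n) ≡
      map (1 ,_) (filter (λ b → P? (1 , b)) (range 1 n)) ++ (map (2 ,_) (filter (λ b → P? (2 , b)) (range 1 n)) ++ (map (3 ,_) (filter (λ b → P? (3 , b)) (range 1 n)) ++ []))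
  filter-cells P? n rewrite cells-byColumn n
    | filter-++ P? (map (1 ,_) (range 1 n)) (map (2 ,_) (range 1 n) ++ (map (3 ,_) (range 1 n) ++ []))
    | filter-++ P? (map (2 ,_) (range 1 n)) (map (3 ,_) (range 1 n) ++ [])
    | filter-++ P? (map (3 ,_) (range 1 n)) []
    | filter-map P? (1 ,_) (range 1 n)
    | filter-map P? (2 ,_) (range 1 n)
    | filter-map P? (3 ,_) (range 1 n) = refl

  DinvCondition : ℕ → ℕ → ℕ → Set
  DinvCondition n A L = (A * n < 3 * (L + 1)) × ((L ≡ 0) ⊎ (3 * L < n * (A + 1)))

  module Columns (n : ℕ) (p : List Step) (h1 h2 e1 e2 : ℕ)
    (H1 : colHeight p 1 ≡ h1) (H2 : colHeight p 2 ≡ h2) (H3 : colHeight p 3 ≡ n)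
    (E1 : h1 + e1 ≡ n) (E2 : h2 + e2 ≡ n) where

    ¬inλ-below : ∀ a h → colHeight p a ≡ h → ∀ b → 1 ≤ b → b < 1 + h → ¬ (colHeight p a ≤ b ∸ 1)
    ¬inλ-below a h H (suc b) _ (s≤s lt) le = <-irrefl refl (<-≤-trans lt (subst (_≤ b) H le))
    inλ-above : ∀ a h e → colHeight p a ≡ h → ∀ b → suc h ≤ b → b < suc h + e → colHeight p a ≤ b ∸ 1
    inλ-above a h e H (suc b) (s≤s le) _ = subst (_≤ b) (sym H) le

    filter-column-λ-range : ∀ a h e → colHeight p a ≡ h → filter (λ b → inλ? p (a , b)) (range 1 (h + e)) ≡ range (suc h) e
    filter-column-λ-range a h e H rewrite range-++ 1 h e
      | filter-++ (λ b → inλ? p (a , b)) (range 1 h) (range (suc h) e)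
      | filter-range-none (λ b → inλ? p (a , b)) 1 h (¬inλ-below a h H)
      | filter-range-all (λ b → inλ? p (a , b)) (suc h) e (inλ-above a h e H) = refl

    λRows₁ λRows₂ : List ℕ
    λRows₁ = range (suc h1) e1
    λRows₂ = range (suc h2) e2

    filter-column-λ : ∀ a h e → colHeight p a ≡ h → h + e ≡ n → filter (λ b → inλ? p (a , b)) (range 1 n) ≡ range (suc h) e
    filter-column-λ a h e H he = trans (cong (λ z → filter (λ b → inλ? p (a , b)) (range 1 z)) (sym he)) (filter-column-λ-range a h e H)

    lam-byColumn : lam n p ≡ map (1 ,_) λRows₁ ++ (map (2 ,_) λRows₂ ++ (map (3 ,_) [] ++ []))
    lam-byColumn = trans (filter-cells (inλ? p) n)
      (cong₂ (λ x yz → map (1 ,_) x ++ yz) (filter-column-λ 1 h1 e1 H1 E1)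
        (cong₂ (λ y z → map (2 ,_) y ++ (map (3 ,_) z ++ [])) (filter-column-λ 2 h2 e2 H2 E2) (filter-column-λ 3 n 0 H3 (+-identityʳ n))))

    length-filter-lam : ∀ {P : Pred Cell 0ℓ} (P? : Decidable P) →
      length (filter P? (lam n p)) ≡ length (filter (λ b → P? (1 , b)) λRows₁) + (length (filter (λ b → P? (2 , b)) λRows₂) + 0)
    length-filter-lam P? rewrite lam-byColumn
      | length-filter-++ P? (map (1 ,_) λRows₁) (map (2 ,_) λRows₂ ++ [])
      | length-filter-++ P? (map (2 ,_) λRows₂) []
      | length-filter-map P? (1 ,_) λRows₁
      | length-filter-map P? (2 ,_) λRows₂ = refl

    row<n : ∀ i → i < e1 → h1 + i < n
    row<n i lt = subst (h1 + i <_) E1 (+-monoʳ-< h1 lt)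
    arm-col1-low : ∀ i → i < e1 → h1 + i < h2 → arm n p (1 , suc (h1 + i)) ≡ 0
    arm-col1-low i lt l2 rewrite length-filter-lam (λ c → (1 <? proj₁ c) ×-dec (proj₂ c ≟ suc (h1 + i)))
      | count-range-none (λ b → (1 <? 1) ×-dec (b ≟ suc (h1 + i))) (suc h1) e1 (λ b _ _ q → <-irrefl refl (proj₁ q))
      | count-range-none (λ b → (1 <? 2) ×-dec (b ≟ suc (h1 + i))) (suc h2) e2 (λ b l _ q → <-irrefl (sym (proj₂ q)) (<-≤-trans (s≤s l2) l)) = refl

    arm-col1-high : ∀ i → i < e1 → h2 ≤ h1 + i → arm n p (1 , suc (h1 + i)) ≡ 1
    arm-col1-high i lt l2 rewrite length-filter-lam (λ c → (1 <? proj₁ c) ×-dec (proj₂ c ≟ suc (h1 + i)))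
      | count-range-none (λ b → (1 <? 1) ×-dec (b ≟ suc (h1 + i))) (suc h1) e1 (λ b _ _ q → <-irrefl refl (proj₁ q))
      | filter-range-single (λ b → (1 <? 2) ×-dec (b ≟ suc (h1 + i))) (suc h2) e2 (suc (h1 + i)) (λ b _ q → proj₂ q) (s≤s (s≤s z≤n) , refl) (s≤s l2)
          (subst (suc (h1 + i) <_) (cong suc (sym E2)) (s≤s (row<n i lt))) = refl

    arm-col2 : ∀ b → arm n p (2 , b) ≡ 0
    arm-col2 b rewrite length-filter-lam (λ c → (2 <? proj₁ c) ×-dec (proj₂ c ≟ b))
      | count-range-none (λ b' → (2 <? 1) ×-dec (b' ≟ b)) (suc h1) e1 (λ b _ _ q → <-asym (proj₁ q) (s≤s (s≤s z≤n)))
      | count-range-none (λ b' → (2 <? 2) ×-dec (b' ≟ b)) (suc h2) e2 (λ b _ _ q → <-irrefl refl (proj₁ q)) = refl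

    count-range-below : ∀ a h e i → i ≤ e → length (filter (λ b → (a ≟ a) ×-dec (b <? suc (h + i))) (range (suc h) e)) ≡ i
    count-range-below a h e i le rewrite sym (m+[n∸m]≡n le)
      | range-++ (suc h) i (e ∸ i)
      | length-filter-++ (λ b → (a ≟ a) ×-dec (b <? suc (h + i))) (range (suc h) i) (range (suc h + i) (e ∸ i))
      | count-range-all (λ b → (a ≟ a) ×-dec (b <? suc (h + i))) (suc h) i (λ b _ l → refl , l)
      | count-range-none (λ b → (a ≟ a) ×-dec (b <? suc (h + i))) (suc (h + i)) (e ∸ i) (λ b l _ q → <-irrefl refl (<-≤-trans (proj₂ q) l))
      = +-identityʳ i

    leg-col1 : ∀ i → i < e1 → leg n p (1 , suc (h1 + i)) ≡ i
    leg-col1 i lt rewrite length-filter-lam (λ c → (proj₁ c ≟ 1) ×-dec (proj₂ c <? suc (h1 + i)))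
      | count-range-below 1 h1 e1 i (<⇒≤ lt)
      | count-range-none (λ b → (2 ≟ 1) ×-dec (b <? suc (h1 + i))) (suc h2) e2 (λ b _ _ q → 1+n≢n (proj₁ q)) = +-identityʳ i

    leg-col2 : ∀ i → i < e2 → leg n p (2 , suc (h2 + i)) ≡ i
    leg-col2 i lt rewrite length-filter-lam (λ c → (proj₁ c ≟ 2) ×-dec (proj₂ c <? suc (h2 + i)))
      | count-range-below 2 h2 e2 i (<⇒≤ lt)
      | count-range-none (λ b → (1 ≟ 2) ×-dec (b <? suc (h2 + i))) (suc h1) e1 (λ b _ _ q → 1+n≢n (sym (proj₁ q))) = +-identityʳ i

    range-offset : ∀ h b → suc h ≤ b → b ≡ suc (h + (b ∸ suc h))
    range-offset h b le = sym (m+[n∸m]≡n le)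

    dinv-col1-low : ∀ i → i < e1 → h1 + i < h2 → DinvCondition n 0 i → DinvCell n p (1 , suc (h1 + i))
    dinv-col1-low i lt l2 d = subst₂ (DinvCondition n) (sym (arm-col1-low i lt l2)) (sym (leg-col1 i lt)) d
    dinv-col1-low⁻¹ : ∀ i → i < e1 → h1 + i < h2 → DinvCell n p (1 , suc (h1 + i)) → DinvCondition n 0 i
    dinv-col1-low⁻¹ i lt l2 d = subst₂ (DinvCondition n) (arm-col1-low i lt l2) (leg-col1 i lt) d
    dinv-col1-high : ∀ i → i < e1 → h2 ≤ h1 + i → DinvCondition n 1 i → DinvCell n p (1 , suc (h1 + i))
    dinv-col1-high i lt l2 d = subst₂ (DinvCondition n) (sym (arm-col1-high i lt l2)) (sym (leg-col1 i lt)) d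
    dinv-col1-high⁻¹ : ∀ i → i < e1 → h2 ≤ h1 + i → DinvCell n p (1 , suc (h1 + i)) → DinvCondition n 1 i
    dinv-col1-high⁻¹ i lt l2 d = subst₂ (DinvCondition n) (arm-col1-high i lt l2) (leg-col1 i lt) d

    dinv₁? : (b : ℕ) → Dec (DinvCell n p (1 , b))
    dinv₁? b = dinvCell? n p (1 , b)
    dinv₂? : (b : ℕ) → Dec (DinvCell n p (2 , b))
    dinv₂? b = dinvCell? n p (2 , b)

    offset-bounds : ∀ lo k b → suc (h1 + lo) ≤ b → b < suc (h1 + lo) + k → lo ≤ b ∸ suc h1 × b ∸ suc h1 < lo + k
    offset-bounds lo k b l1 l2 = +-cancelˡ-≤ (suc h1) lo j (subst (suc h1 + lo ≤_) e l1) ,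
                        +-cancelˡ-< (suc h1) j (lo + k) (subst₂ _<_ e (cong suc (+-assoc h1 lo k)) l2)
      where
      j = b ∸ suc h1
      e : b ≡ suc h1 + j
      e = range-offset h1 b (≤-trans (s≤s (m≤m+n h1 lo)) l1)

    count-dinv₁-all : ∀ lo k → lo + k ≤ e1 → (∀ i → lo ≤ i → i < lo + k → DinvCell n p (1 , suc (h1 + i))) →
      length (filter dinv₁? (range (suc (h1 + lo)) k)) ≡ k
    count-dinv₁-all lo k le h = count-range-all dinv₁? (suc (h1 + lo)) k (λ b l1 l2 → let (a1 , a2) = offset-bounds lo k b l1 l2 in
      subst (λ z → DinvCell n p (1 , z)) (sym (range-offset h1 b (≤-trans (s≤s (m≤m+n h1 lo)) l1))) (h _ a1 a2))

    count-dinv₁-none : ∀ lo k → lo + k ≤ e1 → (∀ i → lo ≤ i → i < lo + k → ¬ DinvCell n p (1 , suc (h1 + i))) →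
      length (filter dinv₁? (range (suc (h1 + lo)) k)) ≡ 0
    count-dinv₁-none lo k le h = count-range-none dinv₁? (suc (h1 + lo)) k (λ b l1 l2 → let (a1 , a2) = offset-bounds lo k b l1 l2 in
      λ d → h _ a1 a2 (subst (λ z → DinvCell n p (1 , z)) (range-offset h1 b (≤-trans (s≤s (m≤m+n h1 lo)) l1)) d))

    dinv-byColumn : dinv n p ≡ length (filter dinv₁? λRows₁) + length (filter dinv₂? λRows₂)
    dinv-byColumn = trans (length-filter-lam (dinvCell? n p)) (cong (length (filter dinv₁? λRows₁) +_) (+-identityʳ _))

    count-dinv₂ : (∀ i → i < e2 → 3 * i < n) → length (filter dinv₂? λRows₂) ≡ e2
    count-dinv₂ h = count-range-all dinv₂? (suc h2) e2 (λ b l1 l2 → subst (λ z → DinvCell n p (2 , z)) (sym (range-offset h2 b l1))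
       (subst₂ (DinvCondition n) (sym (arm-col2 _)) (sym (leg-col2 _ (offset<e₂ b l1 l2))) (short-leg _ (h _ (offset<e₂ b l1 l2)))))
      where
      offset<e₂ : ∀ b → suc h2 ≤ b → b < suc h2 + e2 → b ∸ suc h2 < e2
      offset<e₂ b l1 l2 = +-cancelˡ-< (suc h2) (b ∸ suc h2) e2 (subst (_< suc h2 + e2) (range-offset h2 b l1) l2)
      short-leg : ∀ i → 3 * i < n → DinvCondition n 0 i
      short-leg i l = subst (λ z → 0 < 3 * z) (+-comm 1 i) (s≤s z≤n) , inj₂ (subst (3 * i <_) (sym (*-identityʳ n)) l)

    areaCell? : (c : Cell) → Dec (¬ (Inλ p c) × (proj₁ c * n ≤ 3 * (proj₂ c ∸ 1)))
    areaCell? c = ¬? (inλ? p c) ×-dec (proj₁ c * n ≤? 3 * (proj₂ c ∸ 1))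

    area-column′ : ∀ a T t e → colHeight p a ≡ T + t → (∀ k → a * n ≤ 3 * k → T ≤ k) → (∀ k → T ≤ k → a * n ≤ 3 * k) →
      length (filter (λ b → areaCell? (a , b)) (range 1 ((T + t) + e))) ≡ t
    area-column′ a T t e H th th' rewrite range-++ 1 (T + t) e | range-++ 1 T t
      | length-filter-++ (λ b → areaCell? (a , b)) (range 1 T ++ range (suc T) t) (range (suc (T + t)) e)
      | length-filter-++ (λ b → areaCell? (a , b)) (range 1 T) (range (suc T) t)
      | count-range-none (λ b → areaCell? (a , b)) 1 T (λ { (suc b) _ (s≤s lt) q → <-irrefl refl (<-≤-trans lt (th b (proj₂ q))) })
      | count-range-all (λ b → areaCell? (a , b)) (suc T) t (λ { (suc b) (s≤s l1) (s≤s l2) → (λ q → <-irrefl refl (<-≤-trans l2 (subst (_≤ b) H q))) , th' b l1 })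
      | count-range-none (λ b → areaCell? (a , b)) (suc (T + t)) e (λ { (suc b) (s≤s l1) _ q → proj₁ q (subst (_≤ b) (sym H) l1) })
      = +-identityʳ t

    area-column : ∀ a h T t e → colHeight p a ≡ h → T + t ≡ h → h + e ≡ n → (∀ k → a * n ≤ 3 * k → T ≤ k) → (∀ k → T ≤ k → a * n ≤ 3 * k) →
      length (filter (λ b → areaCell? (a , b)) (range 1 n)) ≡ t
    area-column a h T t e H Et Ee th th' =
      trans (cong (λ z → length (filter (λ b → areaCell? (a , b)) (range 1 z))) (sym (trans (cong (_+ e) Et) Ee)))
            (area-column′ a T t e (trans H (sym Et)) th th')

    area-col3 : length (filter (λ b → areaCell? (3 , b)) (range 1 n)) ≡ 0
    area-col3 = count-range-none (λ b → areaCell? (3 , b)) 1 n (λ { (suc b) _ (s≤s lt) q → <-irrefl refl (<-≤-trans lt (*-cancelˡ-≤ 3 (proj₂ q))) })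

    area-byColumn : area n p ≡ length (filter (λ b → areaCell? (1 , b)) (range 1 n)) + length (filter (λ b → areaCell? (2 , b)) (range 1 n))
    area-byColumn = trans (length-filter-cells areaCell? n)
      (cong (length (filter (λ b → areaCell? (1 , b)) (range 1 n)) +_)
        (trans (cong (λ c → length (filter (λ b → areaCell? (2 , b)) (range 1 n)) + (c + 0)) area-col3) (+-identityʳ _)))


module Thresholds where

  open LambdaStatistics using (DinvCondition)

  3b+3≡3[b+1] : ∀ b → 3 * b + 3 ≡ 3 * (b + 1)
  3b+3≡3[b+1] = solve-∀

  3a<3b+r⇒a≤b : ∀ a b r → r ≤ 3 → 3 * a < 3 * b + r → a ≤ b
  3a<3b+r⇒a≤b a b r r≤3 lt = ≤-pred (subst (a <_) (+-comm b 1) (*-cancelˡ-< 3 a (b + 1) (<-≤-trans lt (≤-trans (+-monoʳ-≤ (3 * b) r≤3) (≤-reflexive (3b+3≡3[b+1] b))))))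

  a≤b⇒3a<3b+r : ∀ a b r → 1 ≤ r → a ≤ b → 3 * a < 3 * b + r
  a≤b⇒3a<3b+r a b r 1≤r le = ≤-trans (s≤s (*-monoʳ-≤ 3 le)) (≤-trans (≤-reflexive (+-comm 1 (3 * b))) (+-monoʳ-≤ (3 * b) 1≤r))

  3b+r≤3a⇒b<a : ∀ a b r → 1 ≤ r → 3 * b + r ≤ 3 * a → b + 1 ≤ a
  3b+r≤3a⇒b<a a b r 1≤r le = subst (_≤ a) (+-comm 1 b) (*-cancelˡ-< 3 b a (<-≤-trans (a≤b⇒3a<3b+r b b r 1≤r ≤-refl) le))

  b<a⇒3b+r≤3a : ∀ a b r → r ≤ 3 → b + 1 ≤ a → 3 * b + r ≤ 3 * a
  b<a⇒3b+r≤3a a b r r≤3 le = ≤-trans (+-monoʳ-≤ (3 * b) r≤3) (≤-trans (≤-reflexive (3b+3≡3[b+1] b)) (*-monoʳ-≤ 3 le))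

  module Residue (m r : ℕ) (1≤r : 1 ≤ r) (r≤2 : r ≤ 2) where
    n = 3 * m + r
    r≤3 : r ≤ 3
    r≤3 = ≤-trans r≤2 (s≤s (s≤s z≤n))

    i≤m⇒3i<n : ∀ i → i ≤ m → 3 * i < n
    i≤m⇒3i<n i le = a≤b⇒3a<3b+r i m r 1≤r le
    m<i⇒3i≮n : ∀ i → m < i → ¬ (3 * i < n)
    m<i⇒3i≮n i lt q = <-irrefl refl (<-≤-trans lt (3a<3b+r⇒a≤b i m r r≤3 q))
    m≤i⇒n<3[i+1] : ∀ i → m ≤ i → n < 3 * (i + 1)
    m≤i⇒n<3[i+1] i le = subst (n <_) (3b+3≡3[b+1] i) (≤-trans (s≤s (+-monoʳ-≤ (3 * m) r≤2)) (≤-trans (≤-reflexive (sym (+-suc (3 * m) 2))) (+-monoˡ-≤ 3 (*-monoʳ-≤ 3 le))))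
    i<m⇒n≮3[i+1] : ∀ i → i < m → ¬ (n < 3 * (i + 1))
    i<m⇒n≮3[i+1] i lt q = <-irrefl refl (<-≤-trans q (≤-trans (*-monoʳ-≤ 3 (subst (_≤ m) (+-comm 1 i) lt)) (m≤m+n (3 * m) r)))
    i≤2m⇒3i<2n : ∀ i → i ≤ 2 * m → 3 * i < n * 2
    i≤2m⇒3i<2n i le = subst (3 * i <_) (sym (eq m r)) (a≤b⇒3a<3b+r i (2 * m) (2 * r) (≤-trans 1≤r (m≤n*m r 2)) le)
      where
      eq : ∀ m r → (3 * m + r) * 2 ≡ 3 * (2 * m) + 2 * r
      eq = solve-∀

    0<3[i+1] : ∀ i → 0 < 3 * (i + 1)
    0<3[i+1] i = subst (λ z → 0 < 3 * z) (+-comm 1 i) (s≤s z≤n)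

    dinvCondition-arm0 : ∀ i → i ≤ m → DinvCondition n 0 i
    dinvCondition-arm0 i le = 0<3[i+1] i , inj₂ (subst (3 * i <_) (sym (*-identityʳ n)) (i≤m⇒3i<n i le))
    ¬dinvCondition-arm0 : ∀ i → m < i → ¬ DinvCondition n 0 i
    ¬dinvCondition-arm0 _ () (_ , inj₁ refl)
    ¬dinvCondition-arm0 i lt (_ , inj₂ q) = m<i⇒3i≮n i lt (subst (3 * i <_) (*-identityʳ n) q)
    dinvCondition-arm1 : ∀ i → m ≤ i → i ≤ 2 * m → DinvCondition n 1 i
    dinvCondition-arm1 i l1 l2 = subst (_< 3 * (i + 1)) (sym (+-identityʳ n)) (m≤i⇒n<3[i+1] i l1) , inj₂ (i≤2m⇒3i<2n i l2)
    ¬dinvCondition-arm1 : ∀ i → i < m → ¬ DinvCondition n 1 i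
    ¬dinvCondition-arm1 i lt (q , _) = i<m⇒n≮3[i+1] i lt (subst (_< 3 * (i + 1)) (+-identityʳ n) q)

    n≤3k⇒m<k : ∀ k → 1 * n ≤ 3 * k → m + 1 ≤ k
    n≤3k⇒m<k k le = 3b+r≤3a⇒b<a k m r 1≤r (subst (_≤ 3 * k) (+-identityʳ n) le)
    m<k⇒n≤3k : ∀ k → m + 1 ≤ k → 1 * n ≤ 3 * k
    m<k⇒n≤3k k le = subst (_≤ 3 * k) (sym (+-identityʳ n)) (b<a⇒3b+r≤3a k m r r≤3 le)

  2n≡3[2m]+2 : ∀ m → 2 * (3 * m + 1) ≡ 3 * (2 * m) + 2
  2n≡3[2m]+2 = solve-∀
  2n≡3[2m+1]+1 : ∀ m → 2 * (3 * m + 2) ≡ 3 * (2 * m + 1) + 1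
  2n≡3[2m+1]+1 = solve-∀

  2n≤3k⇒2m<k : ∀ m k → 2 * (3 * m + 1) ≤ 3 * k → 2 * m + 1 ≤ k
  2n≤3k⇒2m<k m k le = 3b+r≤3a⇒b<a k (2 * m) 2 (s≤s z≤n) (subst (_≤ 3 * k) (2n≡3[2m]+2 m) le)
  2m<k⇒2n≤3k : ∀ m k → 2 * m + 1 ≤ k → 2 * (3 * m + 1) ≤ 3 * k
  2m<k⇒2n≤3k m k le = subst (_≤ 3 * k) (sym (2n≡3[2m]+2 m)) (b<a⇒3b+r≤3a k (2 * m) 2 (s≤s (s≤s z≤n)) le)
  2n≤3k⇒2m+1<k : ∀ m k → 2 * (3 * m + 2) ≤ 3 * k → 2 * m + 2 ≤ k
  2n≤3k⇒2m+1<k m k le = subst (_≤ k) (+-assoc (2 * m) 1 1)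
    (3b+r≤3a⇒b<a k (2 * m + 1) 1 (s≤s z≤n) (subst (_≤ 3 * k) (2n≡3[2m+1]+1 m) le))
  2m+1<k⇒2n≤3k : ∀ m k → 2 * m + 2 ≤ k → 2 * (3 * m + 2) ≤ 3 * k
  2m+1<k⇒2n≤3k m k le = subst (_≤ 3 * k) (sym (2n≡3[2m+1]+1 m))
    (b<a⇒3b+r≤3a k (2 * m + 1) 1 (s≤s z≤n) (subst (_≤ k) (sym (+-assoc (2 * m) 1 1)) le))

  2*m≡m+m : ∀ m → 2 * m ≡ m + m
  2*m≡m+m m = cong (m +_) (+-identityʳ m)

  2*m+1≡m+suc-m : ∀ m → 2 * m + 1 ≡ m + suc m
  2*m+1≡m+suc-m m = trans (cong (_+ 1) (2*m≡m+m m)) (trans (+-assoc m m 1) (cong (m +_) (+-comm m 1)))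


module BlockFlags where

  open RankBlocks

  FlagBound : ℕ → Bool → ℕ → ℕ → Set
  FlagBound t true L k = t ≤ L
  FlagBound t false L k = L + k ≤ t

  -- With colHeight p a = X + t, the cell of column a in row (L + i) + X + 1 lies in λ
  -- exactly when t ≤ L + i; FlagBound says the answer is β for every i < k.
  column-flag : ∀ (p : List Step) a X t L k β → colHeight p a ≡ X + t → FlagBound t β L k →
    ∀ i → i < k → does (colHeight p a ≤? (L + i) + X) ≡ β
  column-flag p a X t L k true H s i lt rewrite H = dec-true (_ ≤? _) (subst (_≤ L + i + X) (+-comm t X) (+-monoˡ-≤ X (≤-trans s (m≤m+n L i))))
  column-flag p a X t L k false H s i lt rewrite H = dec-false (_ ≤? _) (λ le → <-irrefl refl (<-≤-trans (+-monoʳ-< L lt)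
    (≤-trans s (+-cancelʳ-≤ X t (L + i) (subst (_≤ L + i + X) (+-comm X t) le)))))

  boxedFlag : List Step → Cell → Bool
  boxedFlag p c = does (inλ? p c)

  module FlagsResidueOne (m : ℕ) (p : List Step) (t1 t2 : ℕ) (H1 : colHeight p 1 ≡ (m + 1) + t1) (H2 : colHeight p 2 ≡ (2 * m + 1) + t2) where
    open ResidueOneBlocks.Blocks m
    below-m : ∀ L k i → L + k ≤ m → i < k → L + i < m
    below-m L k i le lt = <-≤-trans (+-monoʳ-< L lt) le

    pair-flags : ∀ L k β1 β2 → L + k ≤ m → FlagBound t1 β1 L k → FlagBound t2 β2 L k →
      ∀ i → i < k → map (boxedFlag p) (reverse (block n (L + i))) ≡ β1 ∷ β2 ∷ []
    pair-flags L k β1 β2 le s1 s2 i lt rewrite block-pair (L + i) (below-m L k i le lt) =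
      cong₂ (λ a b → a ∷ b ∷ [])
        (trans (cong (λ z → does (colHeight p 1 ≤? z)) (+-assoc (L + i) m 1)) (column-flag p 1 (m + 1) t1 L k β1 H1 s1 i lt))
        (trans (cong (λ z → does (colHeight p 2 ≤? z)) (+-assoc (L + i) (2 * m) 1)) (column-flag p 2 (2 * m + 1) t2 L k β2 H2 s2 i lt))

    pair-colours : ∀ L k → L + k ≤ m → ∀ i → i < k → map proj₁ (reverse (block n (L + i))) ≡ 1 ∷ 2 ∷ []
    pair-colours L k le i lt rewrite block-pair (L + i) (below-m L k i le lt) = refl

    single-flags : ∀ L k β1 → m ≤ L → L + k ≤ 2 * m → FlagBound t1 β1 L k →
      ∀ i → i < k → map (boxedFlag p) (reverse (block n (L + i))) ≡ β1 ∷ []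
    single-flags L k β1 l1 l2 s1 i lt rewrite block-single (L + i) (≤-trans l1 (m≤m+n L i)) (<-≤-trans (+-monoʳ-< L lt) l2) =
      cong (_∷ []) (trans (cong (λ z → does (colHeight p 1 ≤? z)) (+-assoc (L + i) m 1)) (column-flag p 1 (m + 1) t1 L k β1 H1 s1 i lt))

    single-colours : ∀ L k → m ≤ L → L + k ≤ 2 * m → ∀ i → i < k → map proj₁ (reverse (block n (L + i))) ≡ 1 ∷ []
    single-colours L k l1 l2 i lt rewrite block-single (L + i) (≤-trans l1 (m≤m+n L i)) (<-≤-trans (+-monoʳ-< L lt) l2) = refl

    empty-blocks : ∀ {A : Set} (f : Cell → A) L k → 2 * m ≤ L → ∀ i → i < k → map f (reverse (block n (L + i))) ≡ []
    empty-blocks f L k le i lt rewrite block-empty (L + i) (≤-trans le (m≤m+n L i)) = refl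

  module FlagsResidueTwo (m : ℕ) (p : List Step) (t1 t2 : ℕ) (H1 : colHeight p 1 ≡ (m + 1) + t1) (H2 : colHeight p 2 ≡ (2 * m + 2) + t2) where
    open ResidueTwoBlocks.Blocks m
    below-m : ∀ L k i → L + k ≤ m → i < k → L + i < m
    below-m L k i le lt = <-≤-trans (+-monoʳ-< L lt) le

    pair-flags : ∀ L k β1 β2 → L + k ≤ m → FlagBound t1 β1 L k → FlagBound t2 β2 L k →
      ∀ i → i < k → map (boxedFlag p) (reverse (block n (L + i))) ≡ β2 ∷ β1 ∷ []
    pair-flags L k β1 β2 le s1 s2 i lt rewrite block-pair (L + i) (below-m L k i le lt) =
      cong₂ (λ a b → b ∷ a ∷ [])
        (trans (cong (λ z → does (colHeight p 1 ≤? z)) (+-assoc (L + i) m 1)) (column-flag p 1 (m + 1) t1 L k β1 H1 s1 i lt))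
        (trans (cong (λ z → does (colHeight p 2 ≤? z)) (+-assoc (L + i) (2 * m) 2)) (column-flag p 2 (2 * m + 2) t2 L k β2 H2 s2 i lt))

    pair-colours : ∀ L k → L + k ≤ m → ∀ i → i < k → map proj₁ (reverse (block n (L + i))) ≡ 2 ∷ 1 ∷ []
    pair-colours L k le i lt rewrite block-pair (L + i) (below-m L k i le lt) = refl

    single-flags : ∀ L k β1 → m ≤ L → L + k ≤ 2 * m + 1 → FlagBound t1 β1 L k →
      ∀ i → i < k → map (boxedFlag p) (reverse (block n (L + i))) ≡ β1 ∷ []
    single-flags L k β1 l1 l2 s1 i lt rewrite block-single (L + i) (≤-trans l1 (m≤m+n L i)) (<-≤-trans (+-monoʳ-< L lt) l2) =
      cong (_∷ []) (trans (cong (λ z → does (colHeight p 1 ≤? z)) (+-assoc (L + i) m 1)) (column-flag p 1 (m + 1) t1 L k β1 H1 s1 i lt))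

    single-colours : ∀ L k → m ≤ L → L + k ≤ 2 * m + 1 → ∀ i → i < k → map proj₁ (reverse (block n (L + i))) ≡ 1 ∷ []
    single-colours L k l1 l2 i lt rewrite block-single (L + i) (≤-trans l1 (m≤m+n L i)) (<-≤-trans (+-monoʳ-< L lt) l2) = refl

    empty-blocks : ∀ {A : Set} (f : Cell → A) L k → 2 * m + 1 ≤ L → ∀ i → i < k → map f (reverse (block n (L + i))) ≡ []
    empty-blocks f L k le i lt rewrite block-empty (L + i) (≤-trans le (m≤m+n L i)) = refl


module FlagPatterns where

  open Construction using (constructionFlags; skipFlags; runFlags)
  open SkipCounting using (noBox; afterBox; inGap; skipsFrom)
  open RankBlocks using (repeat)

  T F : Bool
  T = true
  F = false

  allFalse : List ℕ → List Bool
  allFalse = map (λ _ → false)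

  map-repeat : ∀ {A B : Set} (f : A → B) k xs → map f (repeat k xs) ≡ repeat k (map f xs)
  map-repeat f zero xs = refl
  map-repeat f (suc k) xs = trans (map-++ f xs (repeat k xs)) (cong (map f xs ++_) (map-repeat f k xs))

  repeat-++-comm : ∀ {A : Set} k (xs : List A) → repeat k xs ++ xs ≡ xs ++ repeat k xs
  repeat-++-comm zero xs = sym (++-identityʳ xs)
  repeat-++-comm (suc k) xs = trans (++-assoc xs (repeat k xs) xs) (cong (xs ++_) (repeat-++-comm k xs))

  reverse-repeat : ∀ {A : Set} k (xs : List A) → reverse (repeat k xs) ≡ repeat k (reverse xs)
  reverse-repeat zero xs = refl
  reverse-repeat (suc k) xs = trans (reverse-++ xs (repeat k xs)) (trans (cong (_++ reverse xs) (reverse-repeat k xs)) (repeat-++-comm k (reverse xs)))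

  runFlags-ones : ∀ k s Z → runFlags 1 s (repeat k (1 ∷ []) ++ Z) ≡ repeat k (F ∷ []) ++ runFlags 1 s Z
  runFlags-ones zero s Z = refl
  runFlags-ones (suc k) s Z = cong (false ∷_) (runFlags-ones k s Z)

  skipFlags-pairs₁₂ : ∀ k Z → skipFlags k (repeat k (1 ∷ 2 ∷ []) ++ Z) ≡ repeat k (F ∷ T ∷ []) ++ allFalse Z
  skipFlags-pairs₁₂ zero Z = refl
  skipFlags-pairs₁₂ (suc k) Z = cong (λ z → false ∷ true ∷ z) (skipFlags-pairs₁₂ k Z)

  skipFlags-pairs₂₁ : ∀ k Z → skipFlags k (repeat k (2 ∷ 1 ∷ []) ++ Z) ≡ repeat k (F ∷ T ∷ []) ++ allFalse Z
  skipFlags-pairs₂₁ zero Z = refl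
  skipFlags-pairs₂₁ (suc k) Z = cong (λ z → false ∷ true ∷ z) (skipFlags-pairs₂₁ k Z)

  skipFlags-shifted₁₂ : ∀ y Z → skipFlags y (2 ∷ (repeat y (1 ∷ 2 ∷ []) ++ Z)) ≡ F ∷ (repeat y (T ∷ F ∷ []) ++ allFalse Z)
  skipFlags-shifted₁₂ zero Z = refl
  skipFlags-shifted₁₂ (suc y) Z = cong (λ z → false ∷ true ∷ z) (skipFlags-shifted₁₂ y Z)

  skipFlags-shifted₂₁ : ∀ y Z → skipFlags y (1 ∷ (repeat y (2 ∷ 1 ∷ []) ++ Z)) ≡ F ∷ (repeat y (T ∷ F ∷ []) ++ allFalse Z)
  skipFlags-shifted₂₁ zero Z = refl
  skipFlags-shifted₂₁ (suc y) Z = cong (λ z → false ∷ true ∷ z) (skipFlags-shifted₂₁ y Z)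

  allFalse-++ : ∀ xs ys → allFalse (xs ++ ys) ≡ allFalse xs ++ allFalse ys
  allFalse-++ xs ys = map-++ _ xs ys

  allFalse-repeat : ∀ k xs → allFalse (repeat k xs) ≡ repeat k (allFalse xs)
  allFalse-repeat k xs = map-repeat _ k xs

  skipsFrom-FF : ∀ k ys → skipsFrom noBox (repeat k (F ∷ F ∷ []) ++ ys) ≡ skipsFrom noBox ys
  skipsFrom-FF zero ys = refl
  skipsFrom-FF (suc k) ys = skipsFrom-FF k ys

  skipsFrom-TF : ∀ y ys → skipsFrom noBox (repeat (suc y) (T ∷ F ∷ []) ++ ys) ≡ y + skipsFrom inGap ys
  skipsFrom-TF y ys = go y ys
    where
    go : ∀ y ys → skipsFrom afterBox (F ∷ (repeat y (T ∷ F ∷ []) ++ ys)) ≡ y + skipsFrom inGap ys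
    go zero ys = refl
    go (suc y) ys = cong suc (go y ys)

  skipsFrom-FT : ∀ y ys → skipsFrom noBox (repeat (suc y) (F ∷ T ∷ []) ++ ys) ≡ y + skipsFrom afterBox ys
  skipsFrom-FT y ys = go y ys
    where
    go : ∀ y ys → skipsFrom afterBox (repeat y (F ∷ T ∷ []) ++ ys) ≡ y + skipsFrom afterBox ys
    go zero ys = refl
    go (suc y) ys = cong suc (go y ys)

  skipsFrom-F-inGap : ∀ k ys → skipsFrom inGap (repeat k (F ∷ []) ++ ys) ≡ skipsFrom inGap ys
  skipsFrom-F-inGap zero ys = refl
  skipsFrom-F-inGap (suc k) ys = skipsFrom-F-inGap k ys

  skipsFrom-T-afterBox : ∀ k ys → skipsFrom afterBox (repeat k (T ∷ []) ++ ys) ≡ skipsFrom afterBox ys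
  skipsFrom-T-afterBox zero ys = refl
  skipsFrom-T-afterBox (suc k) ys = skipsFrom-T-afterBox k ys

  skipsFrom-TT-afterBox : ∀ k ys → skipsFrom afterBox (repeat k (T ∷ T ∷ []) ++ ys) ≡ skipsFrom afterBox ys
  skipsFrom-TT-afterBox zero ys = refl
  skipsFrom-TT-afterBox (suc k) ys = skipsFrom-TT-afterBox k ys

  double : ℕ → ℕ
  double zero = 0
  double (suc k) = suc (suc (double k))

  double≡+ : ∀ k → double k ≡ k + k
  double≡+ zero = refl
  double≡+ (suc k) = cong suc (trans (cong suc (double≡+ k)) (sym (+-suc k k)))

  constructionFlags-singles : ∀ c k d s Z → constructionFlags (k + d) s (repeat k (c ∷ []) ++ Z) ≡ repeat k (T ∷ []) ++ constructionFlags d s Z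
  constructionFlags-singles c zero d s Z = refl
  constructionFlags-singles c (suc k) d s Z = cong (true ∷_) (constructionFlags-singles c k d s Z)

  constructionFlags-pairs : ∀ a b k d s Z → constructionFlags (double k + d) s (repeat k (a ∷ b ∷ []) ++ Z) ≡ repeat k (T ∷ T ∷ []) ++ constructionFlags d s Z
  constructionFlags-pairs a b zero d s Z = refl
  constructionFlags-pairs a b (suc k) d s Z = cong (λ z → true ∷ true ∷ z) (constructionFlags-pairs a b k d s Z)

  allFalse-pairs : ∀ a b k → allFalse (repeat k (a ∷ b ∷ []) ++ []) ≡ repeat k (F ∷ F ∷ []) ++ []
  allFalse-pairs a b k = trans (allFalse-++ (repeat k (a ∷ b ∷ [])) []) (cong (_++ []) (allFalse-repeat k (a ∷ b ∷ [])))

  allFalse-singles : ∀ a k → allFalse (repeat k (a ∷ [])) ≡ repeat k (F ∷ [])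
  allFalse-singles a k = allFalse-repeat k (a ∷ [])

  skipsFrom-F-noBox : ∀ k ys → skipsFrom noBox (repeat k (F ∷ []) ++ ys) ≡ skipsFrom noBox ys
  skipsFrom-F-noBox zero ys = refl
  skipsFrom-F-noBox (suc k) ys = skipsFrom-F-noBox k ys

  skipsFrom-afterBox-T : ∀ z k → skipsFrom afterBox (repeat z (T ∷ T ∷ []) ++ (repeat k (T ∷ []) ++ [])) ≡ 0
  skipsFrom-afterBox-T z k = trans (skipsFrom-TT-afterBox z _) (trans (skipsFrom-T-afterBox k []) refl)

  skipsFrom-noBox-T : ∀ z k → skipsFrom noBox (repeat z (T ∷ T ∷ []) ++ (repeat k (T ∷ []) ++ [])) ≡ 0
  skipsFrom-noBox-T zero zero = refl
  skipsFrom-noBox-T zero (suc k) = skipsFrom-afterBox-T 0 k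
  skipsFrom-noBox-T (suc z) k = skipsFrom-afterBox-T z k

  skipsFrom-inGap-T : ∀ z k → skipsFrom inGap (repeat z (T ∷ T ∷ []) ++ (repeat (suc k) (T ∷ []) ++ [])) ≡ 1
  skipsFrom-inGap-T zero k = cong suc (skipsFrom-afterBox-T 0 k)
  skipsFrom-inGap-T (suc z) k = cong suc (skipsFrom-afterBox-T z (suc k))

  reverse-segments : ∀ {A : Set} (a b c d : List A) →
    reverse (a ++ (b ++ (c ++ (d ++ [])))) ≡ reverse d ++ (reverse c ++ (reverse b ++ (reverse a ++ [])))
  reverse-segments a b c d =
    trans (sym (++-identityʳ _)) (trans (shift a _ _) (trans (shift b _ _) (trans (shift c _ _) (shift d [] _))))
    where
    shift : ∀ {A : Set} (xs ys zs : List A) → reverse (xs ++ ys) ++ zs ≡ reverse ys ++ (reverse xs ++ zs)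
    shift xs ys zs = trans (cong (_++ zs) (reverse-++ xs ys)) (++-assoc (reverse ys) (reverse xs) zs)

  skipFlags-A1 : ∀ u f g → skipFlags g (repeat u (1 ∷ []) ++ (repeat g (1 ∷ 2 ∷ []) ++ (repeat (u + f) (1 ∷ 2 ∷ []) ++ []))) ≡
                      repeat u (F ∷ []) ++ (repeat g (F ∷ T ∷ []) ++ (repeat (u + f) (F ∷ F ∷ []) ++ []))
  skipFlags-A1 u f zero = trans (allFalse-++ (repeat u (1 ∷ [])) _) (cong₂ _++_ (allFalse-singles 1 u) (allFalse-pairs 1 2 (u + f)))
  skipFlags-A1 zero f (suc g) = trans (skipFlags-pairs₁₂ (suc g) _) (cong (repeat (suc g) (F ∷ T ∷ []) ++_) (allFalse-pairs 1 2 f))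
  skipFlags-A1 (suc u) f (suc g) = cong (false ∷_) (trans (runFlags-ones u g _) (cong (repeat u (F ∷ []) ++_)
    (cong (λ z → false ∷ true ∷ z) (trans (skipFlags-pairs₁₂ g _) (cong (repeat g (F ∷ T ∷ []) ++_) (allFalse-pairs 1 2 (suc u + f)))))))

  constructionFlags-A1 : ∀ u f g →
    constructionFlags (f + g) g (repeat (f + g) (1 ∷ []) ++ (repeat u (1 ∷ []) ++ (repeat g (1 ∷ 2 ∷ []) ++ (repeat (u + f) (1 ∷ 2 ∷ []) ++ [])))) ≡
    repeat (f + g) (T ∷ []) ++ (repeat u (F ∷ []) ++ (repeat g (F ∷ T ∷ []) ++ (repeat (u + f) (F ∷ F ∷ []) ++ [])))
  constructionFlags-A1 u f g =
    trans (cong (λ z → constructionFlags z g (repeat (f + g) (1 ∷ []) ++ Z)) (sym (+-identityʳ (f + g))))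
          (trans (constructionFlags-singles 1 (f + g) 0 g Z) (cong (repeat (f + g) (T ∷ []) ++_) (skipFlags-A1 u f g)))
    where Z = repeat u (1 ∷ []) ++ (repeat g (1 ∷ 2 ∷ []) ++ (repeat (u + f) (1 ∷ 2 ∷ []) ++ []))

  skipsFrom-A1 : ∀ u f g →
    skipsFrom noBox (reverse (repeat (f + g) (T ∷ []) ++ (repeat u (F ∷ []) ++ (repeat g (F ∷ T ∷ []) ++ (repeat (u + f) (F ∷ F ∷ []) ++ []))))) ≡ g
  skipsFrom-A1 u f g rewrite reverse-segments (repeat (f + g) (T ∷ [])) (repeat u (F ∷ [])) (repeat g (F ∷ T ∷ [])) (repeat (u + f) (F ∷ F ∷ []))
    | reverse-repeat (u + f) (F ∷ F ∷ []) | reverse-repeat g (F ∷ T ∷ []) | reverse-repeat u (F ∷ []) | reverse-repeat (f + g) (T ∷ [])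
    | skipsFrom-FF (u + f) (repeat g (T ∷ F ∷ []) ++ (repeat u (F ∷ []) ++ (repeat (f + g) (T ∷ []) ++ []))) = go g
    where
    go : ∀ g → skipsFrom noBox (repeat g (T ∷ F ∷ []) ++ (repeat u (F ∷ []) ++ (repeat (f + g) (T ∷ []) ++ []))) ≡ g
    go zero = trans (skipsFrom-F-noBox u _) (skipsFrom-noBox-T 0 (f + 0))
    go (suc g) rewrite skipsFrom-TF g (repeat u (F ∷ []) ++ (repeat (f + suc g) (T ∷ []) ++ [])) | skipsFrom-F-inGap u (repeat (f + suc g) (T ∷ []) ++ [])
      | +-suc f g = trans (cong (g +_) (skipsFrom-inGap-T 0 (f + g))) (+-comm g 1)

  constructionFlags-B1 : ∀ m z y t2 →
    constructionFlags (m + (double (suc z) + 0)) y (repeat m (1 ∷ []) ++ (repeat (suc z) (1 ∷ 2 ∷ []) ++ (repeat y (1 ∷ 2 ∷ []) ++ (repeat t2 (1 ∷ 2 ∷ []) ++ [])))) ≡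
    repeat m (T ∷ []) ++ (repeat (suc z) (T ∷ T ∷ []) ++ (repeat y (F ∷ T ∷ []) ++ (repeat t2 (F ∷ F ∷ []) ++ [])))
  constructionFlags-B1 m z y t2 rewrite constructionFlags-singles 1 m (double (suc z) + 0) y (repeat (suc z) (1 ∷ 2 ∷ []) ++ (repeat y (1 ∷ 2 ∷ []) ++ (repeat t2 (1 ∷ 2 ∷ []) ++ [])))
    | constructionFlags-pairs 1 2 (suc z) 0 y (repeat y (1 ∷ 2 ∷ []) ++ (repeat t2 (1 ∷ 2 ∷ []) ++ []))
    | skipFlags-pairs₁₂ y (repeat t2 (1 ∷ 2 ∷ []) ++ []) | allFalse-pairs 1 2 t2 = refl

  skipsFrom-B1 : ∀ m z y t2 →
    skipsFrom noBox (reverse (repeat m (T ∷ []) ++ (repeat (suc z) (T ∷ T ∷ []) ++ (repeat y (F ∷ T ∷ []) ++ (repeat t2 (F ∷ F ∷ []) ++ []))))) ≡ y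
  skipsFrom-B1 m z y t2 rewrite reverse-segments (repeat m (T ∷ [])) (repeat (suc z) (T ∷ T ∷ [])) (repeat y (F ∷ T ∷ [])) (repeat t2 (F ∷ F ∷ []))
    | reverse-repeat t2 (F ∷ F ∷ []) | reverse-repeat y (F ∷ T ∷ []) | reverse-repeat (suc z) (T ∷ T ∷ []) | reverse-repeat m (T ∷ [])
    | skipsFrom-FF t2 (repeat y (T ∷ F ∷ []) ++ (repeat (suc z) (T ∷ T ∷ []) ++ (repeat m (T ∷ []) ++ []))) = go y
    where
    go : ∀ y → skipsFrom noBox (repeat y (T ∷ F ∷ []) ++ (repeat (suc z) (T ∷ T ∷ []) ++ (repeat m (T ∷ []) ++ []))) ≡ y
    go zero = skipsFrom-noBox-T (suc z) m
    go (suc y) rewrite skipsFrom-TF y (repeat (suc z) (T ∷ T ∷ []) ++ (repeat m (T ∷ []) ++ [])) =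
      trans (cong (y +_) (cong suc (skipsFrom-afterBox-T z m))) (+-comm y 1)

  constructionFlags-C1 : ∀ m z y t1 →
    constructionFlags (m + (double z + 1)) y (repeat m (1 ∷ []) ++ (repeat z (1 ∷ 2 ∷ []) ++ (repeat (suc y) (1 ∷ 2 ∷ []) ++ (repeat t1 (1 ∷ 2 ∷ []) ++ [])))) ≡
    repeat m (T ∷ []) ++ (repeat z (T ∷ T ∷ []) ++ (repeat (suc y) (T ∷ F ∷ []) ++ (repeat t1 (F ∷ F ∷ []) ++ [])))
  constructionFlags-C1 m z y t1 rewrite constructionFlags-singles 1 m (double z + 1) y (repeat z (1 ∷ 2 ∷ []) ++ (repeat (suc y) (1 ∷ 2 ∷ []) ++ (repeat t1 (1 ∷ 2 ∷ []) ++ [])))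
    | constructionFlags-pairs 1 2 z 1 y (repeat (suc y) (1 ∷ 2 ∷ []) ++ (repeat t1 (1 ∷ 2 ∷ []) ++ []))
    | skipFlags-shifted₁₂ y (repeat t1 (1 ∷ 2 ∷ []) ++ []) | allFalse-pairs 1 2 t1 = refl

  skipsFrom-C1 : ∀ m z y t1 →
    skipsFrom noBox (reverse (repeat m (T ∷ []) ++ (repeat z (T ∷ T ∷ []) ++ (repeat (suc y) (T ∷ F ∷ []) ++ (repeat t1 (F ∷ F ∷ []) ++ []))))) ≡ y
  skipsFrom-C1 m z y t1 rewrite reverse-segments (repeat m (T ∷ [])) (repeat z (T ∷ T ∷ [])) (repeat (suc y) (T ∷ F ∷ [])) (repeat t1 (F ∷ F ∷ []))
    | reverse-repeat t1 (F ∷ F ∷ []) | reverse-repeat (suc y) (T ∷ F ∷ []) | reverse-repeat z (T ∷ T ∷ []) | reverse-repeat m (T ∷ [])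
    | skipsFrom-FF t1 (repeat (suc y) (F ∷ T ∷ []) ++ (repeat z (T ∷ T ∷ []) ++ (repeat m (T ∷ []) ++ [])))
    | skipsFrom-FT y (repeat z (T ∷ T ∷ []) ++ (repeat m (T ∷ []) ++ [])) = trans (cong (y +_) (skipsFrom-afterBox-T z m)) (+-identityʳ y)

  skipFlags-A2 : ∀ u f g → skipFlags g (repeat (suc u) (1 ∷ []) ++ (repeat g (2 ∷ 1 ∷ []) ++ (repeat (u + f) (2 ∷ 1 ∷ []) ++ []))) ≡
                      repeat (suc u) (F ∷ []) ++ (repeat g (T ∷ F ∷ []) ++ (repeat (u + f) (F ∷ F ∷ []) ++ []))
  skipFlags-A2 u f zero = trans (allFalse-++ (repeat (suc u) (1 ∷ [])) _) (cong₂ _++_ (allFalse-singles 1 (suc u)) (allFalse-pairs 2 1 (u + f)))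
  skipFlags-A2 u f (suc g) = cong (false ∷_) (trans (runFlags-ones u g _) (cong (repeat u (F ∷ []) ++_)
    (cong (true ∷_) (trans (skipFlags-shifted₂₁ g _) (cong (λ z → false ∷ (repeat g (T ∷ F ∷ []) ++ z)) (allFalse-pairs 2 1 (u + f)))))))

  constructionFlags-A2 : ∀ u f g →
    constructionFlags (f + g) g (repeat (f + g) (1 ∷ []) ++ (repeat (suc u) (1 ∷ []) ++ (repeat g (2 ∷ 1 ∷ []) ++ (repeat (u + f) (2 ∷ 1 ∷ []) ++ [])))) ≡
    repeat (f + g) (T ∷ []) ++ (repeat (suc u) (F ∷ []) ++ (repeat g (T ∷ F ∷ []) ++ (repeat (u + f) (F ∷ F ∷ []) ++ [])))
  constructionFlags-A2 u f g =
    trans (cong (λ z → constructionFlags z g (repeat (f + g) (1 ∷ []) ++ Z)) (sym (+-identityʳ (f + g))))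
          (trans (constructionFlags-singles 1 (f + g) 0 g Z) (cong (repeat (f + g) (T ∷ []) ++_) (skipFlags-A2 u f g)))
    where Z = repeat (suc u) (1 ∷ []) ++ (repeat g (2 ∷ 1 ∷ []) ++ (repeat (u + f) (2 ∷ 1 ∷ []) ++ []))

  skipsFrom-A2 : ∀ u f g →
    skipsFrom noBox (reverse (repeat (f + g) (T ∷ []) ++ (repeat (suc u) (F ∷ []) ++ (repeat g (T ∷ F ∷ []) ++ (repeat (u + f) (F ∷ F ∷ []) ++ []))))) ≡ g
  skipsFrom-A2 u f g rewrite reverse-segments (repeat (f + g) (T ∷ [])) (repeat (suc u) (F ∷ [])) (repeat g (T ∷ F ∷ [])) (repeat (u + f) (F ∷ F ∷ []))
    | reverse-repeat (u + f) (F ∷ F ∷ []) | reverse-repeat g (T ∷ F ∷ []) | reverse-repeat (suc u) (F ∷ []) | reverse-repeat (f + g) (T ∷ [])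
    | skipsFrom-FF (u + f) (repeat g (F ∷ T ∷ []) ++ (repeat (suc u) (F ∷ []) ++ (repeat (f + g) (T ∷ []) ++ []))) = go g
    where
    go : ∀ g → skipsFrom noBox (repeat g (F ∷ T ∷ []) ++ (repeat (suc u) (F ∷ []) ++ (repeat (f + g) (T ∷ []) ++ []))) ≡ g
    go zero = trans (skipsFrom-F-noBox (suc u) _) (skipsFrom-noBox-T 0 (f + 0))
    go (suc g) rewrite skipsFrom-FT g (repeat (suc u) (F ∷ []) ++ (repeat (f + suc g) (T ∷ []) ++ [])) | skipsFrom-F-inGap u (repeat (f + suc g) (T ∷ []) ++ [])
      | +-suc f g = trans (cong (g +_) (skipsFrom-inGap-T 0 (f + g))) (+-comm g 1)

  constructionFlags-B2 : ∀ m z y t2 →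
    constructionFlags (suc m + (double z + 1)) y (repeat (suc m) (1 ∷ []) ++ (repeat z (2 ∷ 1 ∷ []) ++ (repeat (suc y) (2 ∷ 1 ∷ []) ++ (repeat t2 (2 ∷ 1 ∷ []) ++ [])))) ≡
    repeat (suc m) (T ∷ []) ++ (repeat z (T ∷ T ∷ []) ++ (repeat (suc y) (T ∷ F ∷ []) ++ (repeat t2 (F ∷ F ∷ []) ++ [])))
  constructionFlags-B2 m z y t2 rewrite constructionFlags-singles 1 (suc m) (double z + 1) y (repeat z (2 ∷ 1 ∷ []) ++ (repeat (suc y) (2 ∷ 1 ∷ []) ++ (repeat t2 (2 ∷ 1 ∷ []) ++ [])))
    | constructionFlags-pairs 2 1 z 1 y (repeat (suc y) (2 ∷ 1 ∷ []) ++ (repeat t2 (2 ∷ 1 ∷ []) ++ []))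
    | skipFlags-shifted₂₁ y (repeat t2 (2 ∷ 1 ∷ []) ++ []) | allFalse-pairs 2 1 t2 = refl

  skipsFrom-B2 : ∀ m z y t2 →
    skipsFrom noBox (reverse (repeat (suc m) (T ∷ []) ++ (repeat z (T ∷ T ∷ []) ++ (repeat (suc y) (T ∷ F ∷ []) ++ (repeat t2 (F ∷ F ∷ []) ++ []))))) ≡ y
  skipsFrom-B2 m z y t2 rewrite reverse-segments (repeat (suc m) (T ∷ [])) (repeat z (T ∷ T ∷ [])) (repeat (suc y) (T ∷ F ∷ [])) (repeat t2 (F ∷ F ∷ []))
    | reverse-repeat t2 (F ∷ F ∷ []) | reverse-repeat (suc y) (T ∷ F ∷ []) | reverse-repeat z (T ∷ T ∷ []) | reverse-repeat (suc m) (T ∷ [])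
    | skipsFrom-FF t2 (repeat (suc y) (F ∷ T ∷ []) ++ (repeat z (T ∷ T ∷ []) ++ (repeat (suc m) (T ∷ []) ++ [])))
    | skipsFrom-FT y (repeat z (T ∷ T ∷ []) ++ (repeat (suc m) (T ∷ []) ++ [])) = trans (cong (y +_) (skipsFrom-afterBox-T z (suc m))) (+-identityʳ y)

  constructionFlags-C2 : ∀ m z y t1 →
    constructionFlags (suc m + (double z + 0)) y (repeat (suc m) (1 ∷ []) ++ (repeat z (2 ∷ 1 ∷ []) ++ (repeat y (2 ∷ 1 ∷ []) ++ (repeat t1 (2 ∷ 1 ∷ []) ++ [])))) ≡
    repeat (suc m) (T ∷ []) ++ (repeat z (T ∷ T ∷ []) ++ (repeat y (F ∷ T ∷ []) ++ (repeat t1 (F ∷ F ∷ []) ++ [])))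
  constructionFlags-C2 m z y t1 rewrite constructionFlags-singles 1 (suc m) (double z + 0) y (repeat z (2 ∷ 1 ∷ []) ++ (repeat y (2 ∷ 1 ∷ []) ++ (repeat t1 (2 ∷ 1 ∷ []) ++ [])))
    | constructionFlags-pairs 2 1 z 0 y (repeat y (2 ∷ 1 ∷ []) ++ (repeat t1 (2 ∷ 1 ∷ []) ++ []))
    | skipFlags-pairs₂₁ y (repeat t1 (2 ∷ 1 ∷ []) ++ []) | allFalse-pairs 2 1 t1 = refl

  skipsFrom-C2 : ∀ m z y t1 →
    skipsFrom noBox (reverse (repeat (suc m) (T ∷ []) ++ (repeat z (T ∷ T ∷ []) ++ (repeat y (F ∷ T ∷ []) ++ (repeat t1 (F ∷ F ∷ []) ++ []))))) ≡ y
  skipsFrom-C2 m z y t1 rewrite reverse-segments (repeat (suc m) (T ∷ [])) (repeat z (T ∷ T ∷ [])) (repeat y (F ∷ T ∷ [])) (repeat t1 (F ∷ F ∷ []))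
    | reverse-repeat t1 (F ∷ F ∷ []) | reverse-repeat y (F ∷ T ∷ []) | reverse-repeat z (T ∷ T ∷ []) | reverse-repeat (suc m) (T ∷ [])
    | skipsFrom-FF t1 (repeat y (T ∷ F ∷ []) ++ (repeat z (T ∷ T ∷ []) ++ (repeat (suc m) (T ∷ []) ++ []))) = go y
    where
    go : ∀ y → skipsFrom noBox (repeat y (T ∷ F ∷ []) ++ (repeat z (T ∷ T ∷ []) ++ (repeat (suc m) (T ∷ []) ++ []))) ≡ y
    go zero = skipsFrom-noBox-T z (suc m)
    go (suc y) rewrite skipsFrom-TF y (repeat z (T ∷ T ∷ []) ++ (repeat (suc m) (T ∷ []) ++ [])) =
      trans (cong (y +_) (skipsFrom-inGap-T z m)) (+-comm y 1)


module Reduction where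

  open Construction using (construction-flags; constructionFlags)
  open SkipCounting using (countSkips-runs; skipsFrom; noBox)
  open BlockFlags using (boxedFlag)

  skip-flags : ∀ n p → skip n p ≡ skipsFrom noBox (reverse (map (boxedFlag p) (reverse (rankCells n))))
  skip-flags n p = trans (countSkips-runs false (boxedFlags (rankWordOf n p))) (cong (skipsFrom noBox)
    (trans (sym (map-∘ {g = λ e → proj₂ (proj₂ e)} {f = λ c → (rank n c , proj₁ c , boxedFlag p c)} (rankCells n)))
      (trans (cong (map (boxedFlag p)) (sym (reverse-involutive (rankCells n)))) (reverse-map (boxedFlag p) (reverse (rankCells n))))))

  Correct : ℕ → List Step → Set
  Correct n p = construction (area n p) (skip n p) (dinv n p) ≡ rankWordOf n p

  construction≡rankWordOf : ∀ n p a s d → area n p ≡ a → skip n p ≡ s → dinv n p ≡ d → a + s + d + 1 ≡ n →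
    constructionFlags d s (map proj₁ (reverse (rankCells n))) ≡ map (boxedFlag p) (reverse (rankCells n)) →
    Correct n p
  construction≡rankWordOf n p a s d refl refl refl e h = construction-flags (area n p) (skip n p) (dinv n p) n (boxedFlag p) e h


module CaseA1 where

  open Ranges
  open RankBlocks using (repeat; reverse-rankCells-segments; map-reversedBlocks)
  open Construction using (constructionFlags)
  open SkipCounting using (skipsFrom; noBox)
  open LambdaStatistics
  open Thresholds
  open BlockFlags
  open FlagPatterns
  open Reduction

  ring-blocks : ∀ u f g → (u + f) + g + u + (f + g) + (u + f + g + 1) ≡ 3 * (u + f + g) + 1
  ring-blocks = solve-∀
  ring-nonempty : ∀ u f g → 2 * (u + f + g) ≡ (u + f) + g + u + (f + g)
  ring-nonempty = solve-∀
  ring-h₁+e₁ : ∀ u f g → (u + f + g + 1) + (u + f + g + u) + (f + g) ≡ 3 * (u + f + g) + 1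
  ring-h₁+e₁ = solve-∀
  ring-h₂+e₂ : ∀ u f g → (2 * (u + f + g) + 1) + (u + f) + g ≡ 3 * (u + f + g) + 1
  ring-h₂+e₂ = solve-∀
  ring-h₁+f : ∀ u f g → (u + f + g + 1) + (u + f + g + u) + f ≡ (2 * (u + f + g) + 1) + (u + f)
  ring-h₁+f = solve-∀
  ring-statistics : ∀ u f g → (u + f + g + u) + (u + f) + g + (f + g) + 1 ≡ 3 * (u + f + g) + 1
  ring-statistics = solve-∀

  module A1 (u f g : ℕ) (p : List Step) where
    m = u + f + g
    n = 3 * m + 1
    t1 = m + u
    t2 = u + f
    h1 = (m + 1) + t1
    h2 = (2 * m + 1) + t2

    module _ (H1 : colHeight p 1 ≡ h1) (H2 : colHeight p 2 ≡ h2) (H3 : colHeight p 3 ≡ n) where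
      open FlagsResidueOne m p t1 t2 H1 H2
      open Residue m 1 (s≤s z≤n) (s≤s z≤n) using (n≤3k⇒m<k; m<k⇒n≤3k; i≤m⇒3i<n; dinvCondition-arm0; ¬dinvCondition-arm1)

      blocks-sum : (u + f) + g + u + (f + g) + (m + 1) ≡ n
      blocks-sum = ring-blocks u f g

      m+x≤2m : ∀ x → x ≤ m → m + x ≤ 2 * m
      m+x≤2m x le = ≤-trans (+-monoʳ-≤ m le) (≤-reflexive (sym (2*m≡m+m m)))

      u≤m : u ≤ m
      u≤m = ≤-trans (m≤m+n u f) (m≤m+n (u + f) g)

      colours-reversed : map proj₁ (reverse (rankCells n)) ≡
        repeat (f + g) (1 ∷ []) ++ (repeat u (1 ∷ []) ++ (repeat g (1 ∷ 2 ∷ []) ++ (repeat (u + f) (1 ∷ 2 ∷ []) ++ [])))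
      colours-reversed = trans (reverse-rankCells-segments proj₁ n (u + f) g u (f + g) (m + 1) blocks-sum (empty-blocks proj₁ _ (m + 1) (≤-reflexive (ring-nonempty u f g))))
        (cong₂ _++_ (map-reversedBlocks proj₁ n _ (f + g) _ (single-colours (m + u) (f + g) (m≤m+n m u) (≤-reflexive (sym (ring-nonempty u f g)))))
        (cong₂ _++_ (map-reversedBlocks proj₁ n _ u _ (single-colours m u ≤-refl (m+x≤2m u u≤m)))
        (cong₂ _++_ (map-reversedBlocks proj₁ n _ g _ (pair-colours (u + f) g ≤-refl))
        (cong₂ _++_ (map-reversedBlocks proj₁ n 0 (u + f) _ (pair-colours 0 (u + f) (m≤m+n (u + f) g))) refl))))

      flags-reversed : map (boxedFlag p) (reverse (rankCells n)) ≡
        repeat (f + g) (T ∷ []) ++ (repeat u (F ∷ []) ++ (repeat g (F ∷ T ∷ []) ++ (repeat (u + f) (F ∷ F ∷ []) ++ [])))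
      flags-reversed = trans (reverse-rankCells-segments (boxedFlag p) n (u + f) g u (f + g) (m + 1) blocks-sum (empty-blocks (boxedFlag p) _ (m + 1) (≤-reflexive (ring-nonempty u f g))))
        (cong₂ _++_ (map-reversedBlocks (boxedFlag p) n _ (f + g) _ (single-flags (m + u) (f + g) true (m≤m+n m u) (≤-reflexive (sym (ring-nonempty u f g))) ≤-refl))
        (cong₂ _++_ (map-reversedBlocks (boxedFlag p) n _ u _ (single-flags m u false ≤-refl (m+x≤2m u u≤m) ≤-refl))
        (cong₂ _++_ (map-reversedBlocks (boxedFlag p) n _ g _ (pair-flags (u + f) g false true ≤-refl (m≤m+n m u) ≤-refl))
        (cong₂ _++_ (map-reversedBlocks (boxedFlag p) n 0 (u + f) _ (pair-flags 0 (u + f) false false (m≤m+n (u + f) g)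
                        (≤-trans (m≤m+n (u + f) g) (m≤m+n m u)) ≤-refl)) refl))))

      h₁+e₁≡n : h1 + (f + g) ≡ n
      h₁+e₁≡n = ring-h₁+e₁ u f g
      h₂+e₂≡n : h2 + g ≡ n
      h₂+e₂≡n = ring-h₂+e₂ u f g

      open Columns n p h1 h2 (f + g) g H1 H2 H3 h₁+e₁≡n h₂+e₂≡n

      area≡ : area n p ≡ t1 + t2
      area≡ = trans area-byColumn (cong₂ _+_ (area-column 1 h1 (m + 1) t1 (f + g) H1 refl h₁+e₁≡n n≤3k⇒m<k m<k⇒n≤3k)
                             (area-column 2 h2 (2 * m + 1) t2 g H2 refl h₂+e₂≡n (2n≤3k⇒2m<k m) (2m<k⇒2n≤3k m)))

      f≤m : f ≤ m
      f≤m = ≤-trans (m≤n+m f u) (m≤m+n (u + f) g)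
      f+g≤m : f + g ≤ m
      f+g≤m = +-monoˡ-≤ g (m≤n+m f u)

      dinv₁-count : length (filter dinv₁? (range (suc h1) (f + g))) ≡ f + 0
      dinv₁-count = trans (cong (λ r → length (filter dinv₁? r)) (range-++ (suc h1) f g))
            (trans (length-filter-++ dinv₁? (range (suc h1) f) (range (suc h1 + f) g)) (cong₂ _+_ dinv-low no-dinv-middle))
        where
        dinv-low : length (filter dinv₁? (range (suc h1) f)) ≡ f
        dinv-low = trans (cong (λ z → length (filter dinv₁? (range (suc z) f))) (sym (+-identityʳ h1)))
                         (count-dinv₁-all 0 f (m≤m+n f g) (λ i _ lt → dinv-col1-low i (<-≤-trans lt (m≤m+n f g))
                            (subst (h1 + i <_) (ring-h₁+f u f g) (+-monoʳ-< h1 lt)) (dinvCondition-arm0 i (≤-trans (<⇒≤ lt) f≤m))))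
        no-dinv-middle : length (filter dinv₁? (range (suc h1 + f) g)) ≡ 0
        no-dinv-middle = count-dinv₁-none f g ≤-refl (λ i l1 l2 d → ¬dinvCondition-arm1 i (<-≤-trans l2 f+g≤m)
          (dinv-col1-high⁻¹ i l2 (subst (_≤ h1 + i) (ring-h₁+f u f g) (+-monoʳ-≤ h1 l1)) d))

      dinv≡ : dinv n p ≡ f + g
      dinv≡ = trans dinv-byColumn (cong₂ _+_ (trans dinv₁-count (+-identityʳ f)) (count-dinv₂ (λ i lt → i≤m⇒3i<n i (≤-trans (<⇒≤ lt) (m≤n+m g (u + f))))))

      skip≡ : skip n p ≡ g
      skip≡ = trans (skip-flags n p) (trans (cong (λ z → skipsFrom noBox (reverse z)) flags-reversed) (skipsFrom-A1 u f g))

      flags≡constructionFlags : constructionFlags (f + g) g (map proj₁ (reverse (rankCells n))) ≡ map (boxedFlag p) (reverse (rankCells n))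
      flags≡constructionFlags = trans (cong (constructionFlags (f + g) g) colours-reversed) (trans (constructionFlags-A1 u f g) (sym flags-reversed))

      theorem : Correct n p
      theorem = construction≡rankWordOf n p _ _ _ area≡ skip≡ dinv≡ (ring-statistics u f g) flags≡constructionFlags

  correct : ∀ m p u f g → u + f + g ≡ m → colHeight p 1 ≡ (m + 1) + (m + u) → colHeight p 2 ≡ (2 * m + 1) + (u + f) →
    colHeight p 3 ≡ 3 * m + 1 → Correct (3 * m + 1) p
  correct .(u + f + g) p u f g refl = A1.theorem u f g p


module CaseB1 where

  open Ranges
  open RankBlocks using (repeat; reverse-rankCells-segments; map-reversedBlocks)
  open Construction using (constructionFlags)
  open SkipCounting using (skipsFrom; noBox)
  open LambdaStatistics
  open Thresholds
  open BlockFlags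
  open FlagPatterns
  open Reduction

  ring-blocks : ∀ t2 y z → t2 + y + suc z + (t2 + y + suc z) + (t2 + y + suc z + 1) ≡ 3 * (t2 + y + suc z) + 1
  ring-blocks = solve-∀
  ring-h₁+e₁ : ∀ t2 y z → (t2 + y + suc z + 1) + (t2 + y) + (t2 + y + suc z + suc z) ≡ 3 * (t2 + y + suc z) + 1
  ring-h₁+e₁ = solve-∀
  ring-h₂+e₂ : ∀ t2 y z → (2 * (t2 + y + suc z) + 1) + t2 + (y + suc z) ≡ 3 * (t2 + y + suc z) + 1
  ring-h₂+e₂ = solve-∀
  ring-h₁+f : ∀ t2 y z → (t2 + y + suc z + 1) + (t2 + y) + (t2 + suc z) ≡ (2 * (t2 + y + suc z) + 1) + t2
  ring-h₁+f = solve-∀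
  ring-e₁ : ∀ t2 y z → (t2 + suc z) + y + suc z ≡ t2 + y + suc z + suc z
  ring-e₁ = solve-∀
  ring-dinv : ∀ t2 y z → (t2 + suc z) + 0 + suc z + (y + suc z) ≡ t2 + y + suc z + (suc z + suc z + 0)
  ring-dinv = solve-∀
  ring-statistics : ∀ t2 y z → (t2 + y) + t2 + y + (t2 + y + suc z + (suc z + suc z + 0)) + 1 ≡ 3 * (t2 + y + suc z) + 1
  ring-statistics = solve-∀

  module B1 (t2 y z : ℕ) (p : List Step) where
    t1 = t2 + y
    m = t2 + y + suc z
    n = 3 * m + 1
    h1 = (m + 1) + t1
    h2 = (2 * m + 1) + t2
    e1 = m + suc z
    e2 = y + suc z
    f = t2 + suc z

    module _ (H1 : colHeight p 1 ≡ h1) (H2 : colHeight p 2 ≡ h2) (H3 : colHeight p 3 ≡ n) where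
      open FlagsResidueOne m p t1 t2 H1 H2
      open Residue m 1 (s≤s z≤n) (s≤s z≤n) using (n≤3k⇒m<k; m<k⇒n≤3k; i≤m⇒3i<n; dinvCondition-arm0; ¬dinvCondition-arm1; dinvCondition-arm1)

      blocks-sum : t2 + y + suc z + m + (m + 1) ≡ n
      blocks-sum = ring-blocks t2 y z

      t1≤m : t1 ≤ m
      t1≤m = m≤m+n t1 (suc z)
      t2≤t1 : t2 ≤ t1
      t2≤t1 = m≤m+n t2 y

      colours-reversed : map proj₁ (reverse (rankCells n)) ≡
        repeat m (1 ∷ []) ++ (repeat (suc z) (1 ∷ 2 ∷ []) ++ (repeat y (1 ∷ 2 ∷ []) ++ (repeat t2 (1 ∷ 2 ∷ []) ++ [])))
      colours-reversed = trans (reverse-rankCells-segments proj₁ n t2 y (suc z) m (m + 1) blocks-sum (empty-blocks proj₁ _ (m + 1) (≤-reflexive (2*m≡m+m m))))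
        (cong₂ _++_ (map-reversedBlocks proj₁ n _ m _ (single-colours m m ≤-refl (≤-reflexive (sym (2*m≡m+m m)))))
        (cong₂ _++_ (map-reversedBlocks proj₁ n _ (suc z) _ (pair-colours t1 (suc z) ≤-refl))
        (cong₂ _++_ (map-reversedBlocks proj₁ n _ y _ (pair-colours t2 y t1≤m))
        (cong₂ _++_ (map-reversedBlocks proj₁ n 0 t2 _ (pair-colours 0 t2 (≤-trans t2≤t1 t1≤m))) refl))))

      flags-reversed : map (boxedFlag p) (reverse (rankCells n)) ≡
        repeat m (T ∷ []) ++ (repeat (suc z) (T ∷ T ∷ []) ++ (repeat y (F ∷ T ∷ []) ++ (repeat t2 (F ∷ F ∷ []) ++ [])))
      flags-reversed = trans (reverse-rankCells-segments (boxedFlag p) n t2 y (suc z) m (m + 1) blocks-sum (empty-blocks (boxedFlag p) _ (m + 1) (≤-reflexive (2*m≡m+m m))))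
        (cong₂ _++_ (map-reversedBlocks (boxedFlag p) n _ m _ (single-flags m m true ≤-refl (≤-reflexive (sym (2*m≡m+m m))) t1≤m))
        (cong₂ _++_ (map-reversedBlocks (boxedFlag p) n _ (suc z) _ (pair-flags t1 (suc z) true true ≤-refl ≤-refl t2≤t1))
        (cong₂ _++_ (map-reversedBlocks (boxedFlag p) n _ y _ (pair-flags t2 y false true t1≤m ≤-refl ≤-refl))
        (cong₂ _++_ (map-reversedBlocks (boxedFlag p) n 0 t2 _ (pair-flags 0 t2 false false (≤-trans t2≤t1 t1≤m) t2≤t1 ≤-refl)) refl))))

      h₁+e₁≡n : h1 + e1 ≡ n
      h₁+e₁≡n = ring-h₁+e₁ t2 y z
      h₂+e₂≡n : h2 + e2 ≡ n
      h₂+e₂≡n = ring-h₂+e₂ t2 y z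

      open Columns n p h1 h2 e1 e2 H1 H2 H3 h₁+e₁≡n h₂+e₂≡n

      area≡ : area n p ≡ t1 + t2
      area≡ = trans area-byColumn (cong₂ _+_ (area-column 1 h1 (m + 1) t1 e1 H1 refl h₁+e₁≡n n≤3k⇒m<k m<k⇒n≤3k)
                             (area-column 2 h2 (2 * m + 1) t2 e2 H2 refl h₂+e₂≡n (2n≤3k⇒2m<k m) (2m<k⇒2n≤3k m)))

      f≤m : f ≤ m
      f≤m = +-monoˡ-≤ (suc z) t2≤t1
      f+y≡m : f + y ≡ m
      f+y≡m = solve-∀-helper t2 y z
        where
        solve-∀-helper : ∀ t2 y z → t2 + suc z + y ≡ t2 + y + suc z
        solve-∀-helper = solve-∀
      f+y≤e1 : f + y ≤ e1
      f+y≤e1 = ≤-trans (≤-reflexive f+y≡m) (m≤m+n m (suc z))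
      e1≤2m : e1 ≤ 2 * m
      e1≤2m = ≤-trans (+-monoʳ-≤ m (m≤n+m (suc z) t1)) (≤-reflexive (sym (2*m≡m+m m)))

      dinv₁-count′ : length (filter dinv₁? (range (suc h1) ((f + y) + suc z))) ≡ (f + 0) + suc z
      dinv₁-count′ = trans (cong (λ r → length (filter dinv₁? r)) (range-++ (suc h1) (f + y) (suc z)))
             (trans (length-filter-++ dinv₁? (range (suc h1) (f + y)) (range (suc h1 + (f + y)) (suc z)))
               (cong₂ _+_ dinv-low-middle dinv-high))
        where
        dinv-low : length (filter dinv₁? (range (suc h1) f)) ≡ f
        dinv-low = trans (cong (λ q → length (filter dinv₁? (range (suc q) f))) (sym (+-identityʳ h1)))
                  (count-dinv₁-all 0 f (≤-trans (m≤m+n f y) f+y≤e1) (λ i _ lt → dinv-col1-low i (<-≤-trans lt (≤-trans (m≤m+n f y) f+y≤e1))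
                     (subst (h1 + i <_) (ring-h₁+f t2 y z) (+-monoʳ-< h1 lt)) (dinvCondition-arm0 i (≤-trans (<⇒≤ lt) f≤m))))
        no-dinv-middle : length (filter dinv₁? (range (suc h1 + f) y)) ≡ 0
        no-dinv-middle = count-dinv₁-none f y f+y≤e1 (λ i l1 l2 d → ¬dinvCondition-arm1 i (subst (i <_) f+y≡m l2)
              (dinv-col1-high⁻¹ i (<-≤-trans l2 f+y≤e1) (subst (_≤ h1 + i) (ring-h₁+f t2 y z) (+-monoʳ-≤ h1 l1)) d))
        dinv-low-middle : length (filter dinv₁? (range (suc h1) (f + y))) ≡ f + 0
        dinv-low-middle = trans (cong (λ r → length (filter dinv₁? r)) (range-++ (suc h1) f y))
             (trans (length-filter-++ dinv₁? (range (suc h1) f) (range (suc h1 + f) y)) (cong₂ _+_ dinv-low no-dinv-middle))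
        dinv-high : length (filter dinv₁? (range (suc h1 + (f + y)) (suc z))) ≡ suc z
        dinv-high = count-dinv₁-all (f + y) (suc z) (≤-reflexive (cong (_+ suc z) f+y≡m))
          (λ i l1 l2 → dinv-col1-high i (<-≤-trans l2 (≤-reflexive (cong (_+ suc z) f+y≡m)))
            (subst (_≤ h1 + i) (ring-h₁+f t2 y z) (+-monoʳ-≤ h1 (≤-trans (m≤m+n f y) l1)))
            (dinvCondition-arm1 i (subst (_≤ i) f+y≡m l1) (≤-trans (<⇒≤ (subst (i <_) (cong (_+ suc z) f+y≡m) l2)) e1≤2m)))

      dinv₁-count : length (filter dinv₁? (range (suc h1) e1)) ≡ (f + 0) + suc z
      dinv₁-count = trans (cong (λ q → length (filter dinv₁? (range (suc h1) q))) (sym (ring-e₁ t2 y z))) dinv₁-count′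

      e2≤m : e2 ≤ m
      e2≤m = subst (e2 ≤_) (sym (+-assoc t2 y (suc z))) (m≤n+m e2 t2)

      dinv≡ : dinv n p ≡ m + (double (suc z) + 0)
      dinv≡ = trans dinv-byColumn (trans (cong₂ _+_ dinv₁-count
                     (count-dinv₂ (λ i lt → i≤m⇒3i<n i (≤-trans (<⇒≤ lt) e2≤m))))
                (trans (ring-dinv t2 y z) (cong (λ q → m + (q + 0)) (sym (double≡+ (suc z))))))

      skip≡ : skip n p ≡ y
      skip≡ = trans (skip-flags n p) (trans (cong (λ z → skipsFrom noBox (reverse z)) flags-reversed) (skipsFrom-B1 m z y t2))

      flags≡constructionFlags : constructionFlags (m + (double (suc z) + 0)) y (map proj₁ (reverse (rankCells n))) ≡ map (boxedFlag p) (reverse (rankCells n))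
      flags≡constructionFlags = trans (cong (constructionFlags (m + (double (suc z) + 0)) y) colours-reversed) (trans (constructionFlags-B1 m z y t2) (sym flags-reversed))

      theorem : Correct n p
      theorem = construction≡rankWordOf n p _ _ _ area≡ skip≡ dinv≡
        (trans (cong (λ q → t1 + t2 + y + (m + (q + 0)) + 1) (double≡+ (suc z))) (ring-statistics t2 y z)) flags≡constructionFlags

  correct : ∀ m p t2 y z → t2 + y + suc z ≡ m → colHeight p 1 ≡ (m + 1) + (t2 + y) → colHeight p 2 ≡ (2 * m + 1) + t2 →
    colHeight p 3 ≡ 3 * m + 1 → Correct (3 * m + 1) p
  correct .(t2 + y + suc z) p t2 y z refl = B1.theorem t2 y z p


module CaseC1 where

  open Ranges
  open RankBlocks using (repeat; reverse-rankCells-segments; map-reversedBlocks)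
  open Construction using (constructionFlags)
  open SkipCounting using (skipsFrom; noBox)
  open LambdaStatistics
  open Thresholds
  open BlockFlags
  open FlagPatterns
  open Reduction

  ring-blocks : ∀ t1 y z → t1 + suc y + z + (t1 + suc y + z) + (t1 + suc y + z + 1) ≡ 3 * (t1 + suc y + z) + 1
  ring-blocks = solve-∀
  ring-h₁+e₁ : ∀ t1 y z → (t1 + suc y + z + 1) + t1 + ((t1 + suc y + z + 1) + y + z) ≡ 3 * (t1 + suc y + z) + 1
  ring-h₁+e₁ = solve-∀
  ring-h₂+e₂ : ∀ t1 y z → (2 * (t1 + suc y + z) + 1) + (t1 + suc y) + z ≡ 3 * (t1 + suc y + z) + 1
  ring-h₂+e₂ = solve-∀
  ring-h₁+f : ∀ t1 y z → (t1 + suc y + z + 1) + t1 + ((t1 + suc y + z + 1) + y) ≡ (2 * (t1 + suc y + z) + 1) + (t1 + suc y)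
  ring-h₁+f = solve-∀
  ring-dinv : ∀ m z → (m + 1) + 0 + z + z ≡ m + (z + z + 1)
  ring-dinv = solve-∀
  ring-statistics : ∀ t1 y z → t1 + (t1 + suc y) + y + ((t1 + suc y + z) + (z + z + 1)) + 1 ≡ 3 * (t1 + suc y + z) + 1
  ring-statistics = solve-∀
  e₁≤2m : ∀ t1 y z → (t1 + suc y + z + 1) + y + z ≤ 2 * (t1 + suc y + z)
  e₁≤2m t1 y z = ≤-trans (m≤m+n _ t1) (≤-reflexive (sym (eq t1 y z)))
    where
    eq : ∀ t1 y z → 2 * (t1 + suc y + z) ≡ (t1 + suc y + z + 1) + y + z + t1
    eq = solve-∀

  module C1 (t1 y z : ℕ) (p : List Step) where
    t2 = t1 + suc y
    m = t2 + z
    n = 3 * m + 1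
    h1 = (m + 1) + t1
    h2 = (2 * m + 1) + t2
    f = (m + 1) + y
    e1 = f + z

    module _ (H1 : colHeight p 1 ≡ h1) (H2 : colHeight p 2 ≡ h2) (H3 : colHeight p 3 ≡ n) where
      open FlagsResidueOne m p t1 t2 H1 H2
      open Residue m 1 (s≤s z≤n) (s≤s z≤n) using (n≤3k⇒m<k; m<k⇒n≤3k; i≤m⇒3i<n; dinvCondition-arm0; ¬dinvCondition-arm0; dinvCondition-arm1)

      blocks-sum : t1 + suc y + z + m + (m + 1) ≡ n
      blocks-sum = ring-blocks t1 y z

      t1≤t2 : t1 ≤ t2
      t1≤t2 = m≤m+n t1 (suc y)
      t2≤m : t2 ≤ m
      t2≤m = m≤m+n t2 z
      t1≤m : t1 ≤ m
      t1≤m = ≤-trans t1≤t2 t2≤m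

      colours-reversed : map proj₁ (reverse (rankCells n)) ≡
        repeat m (1 ∷ []) ++ (repeat z (1 ∷ 2 ∷ []) ++ (repeat (suc y) (1 ∷ 2 ∷ []) ++ (repeat t1 (1 ∷ 2 ∷ []) ++ [])))
      colours-reversed = trans (reverse-rankCells-segments proj₁ n t1 (suc y) z m (m + 1) blocks-sum (empty-blocks proj₁ _ (m + 1) (≤-reflexive (2*m≡m+m m))))
        (cong₂ _++_ (map-reversedBlocks proj₁ n _ m _ (single-colours m m ≤-refl (≤-reflexive (sym (2*m≡m+m m)))))
        (cong₂ _++_ (map-reversedBlocks proj₁ n _ z _ (pair-colours t2 z ≤-refl))
        (cong₂ _++_ (map-reversedBlocks proj₁ n _ (suc y) _ (pair-colours t1 (suc y) t2≤m))
        (cong₂ _++_ (map-reversedBlocks proj₁ n 0 t1 _ (pair-colours 0 t1 t1≤m)) refl))))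

      flags-reversed : map (boxedFlag p) (reverse (rankCells n)) ≡
        repeat m (T ∷ []) ++ (repeat z (T ∷ T ∷ []) ++ (repeat (suc y) (T ∷ F ∷ []) ++ (repeat t1 (F ∷ F ∷ []) ++ [])))
      flags-reversed = trans (reverse-rankCells-segments (boxedFlag p) n t1 (suc y) z m (m + 1) blocks-sum (empty-blocks (boxedFlag p) _ (m + 1) (≤-reflexive (2*m≡m+m m))))
        (cong₂ _++_ (map-reversedBlocks (boxedFlag p) n _ m _ (single-flags m m true ≤-refl (≤-reflexive (sym (2*m≡m+m m))) t1≤m))
        (cong₂ _++_ (map-reversedBlocks (boxedFlag p) n _ z _ (pair-flags t2 z true true ≤-refl t1≤t2 ≤-refl))
        (cong₂ _++_ (map-reversedBlocks (boxedFlag p) n _ (suc y) _ (pair-flags t1 (suc y) true false t2≤m ≤-refl ≤-refl))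
        (cong₂ _++_ (map-reversedBlocks (boxedFlag p) n 0 t1 _ (pair-flags 0 t1 false false t1≤m ≤-refl t1≤t2)) refl))))

      h₁+e₁≡n : h1 + e1 ≡ n
      h₁+e₁≡n = ring-h₁+e₁ t1 y z
      h₂+e₂≡n : h2 + z ≡ n
      h₂+e₂≡n = ring-h₂+e₂ t1 y z
      h₁+f≡h₂ : h1 + f ≡ h2
      h₁+f≡h₂ = ring-h₁+f t1 y z

      open Columns n p h1 h2 e1 z H1 H2 H3 h₁+e₁≡n h₂+e₂≡n

      area≡ : area n p ≡ t1 + t2
      area≡ = trans area-byColumn (cong₂ _+_ (area-column 1 h1 (m + 1) t1 e1 H1 refl h₁+e₁≡n n≤3k⇒m<k m<k⇒n≤3k)
                             (area-column 2 h2 (2 * m + 1) t2 z H2 refl h₂+e₂≡n (2n≤3k⇒2m<k m) (2m<k⇒2n≤3k m)))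

      i<m+1⇒i≤m : ∀ i → i < m + 1 → i ≤ m
      i<m+1⇒i≤m i lt = ≤-pred (subst (i <_) (+-comm m 1) lt)
      m+1≤f : m + 1 ≤ f
      m+1≤f = m≤m+n (m + 1) y
      f≤e1 : f ≤ e1
      f≤e1 = m≤m+n f z

      dinv₁-count′ : length (filter dinv₁? (range (suc h1) e1)) ≡ (m + 1) + 0 + z
      dinv₁-count′ = trans (cong (λ r → length (filter dinv₁? r)) (range-++ (suc h1) f z))
             (trans (length-filter-++ dinv₁? (range (suc h1) f) (range (suc h1 + f) z)) (cong₂ _+_ dinv-low-middle dinv-high))
        where
        dinv-low : length (filter dinv₁? (range (suc h1) (m + 1))) ≡ m + 1
        dinv-low = trans (cong (λ q → length (filter dinv₁? (range (suc q) (m + 1)))) (sym (+-identityʳ h1)))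
                  (count-dinv₁-all 0 (m + 1) (≤-trans m+1≤f f≤e1) (λ i _ lt → dinv-col1-low i (<-≤-trans lt (≤-trans m+1≤f f≤e1))
                     (subst (h1 + i <_) h₁+f≡h₂ (+-monoʳ-< h1 (<-≤-trans lt m+1≤f))) (dinvCondition-arm0 i (i<m+1⇒i≤m i lt))))
        no-dinv-middle : length (filter dinv₁? (range (suc h1 + (m + 1)) y)) ≡ 0
        no-dinv-middle = count-dinv₁-none (m + 1) y f≤e1 (λ i l1 l2 d → ¬dinvCondition-arm0 i (<-≤-trans (subst (m <_) (+-comm 1 m) ≤-refl) l1)
              (dinv-col1-low⁻¹ i (<-≤-trans l2 f≤e1) (subst (h1 + i <_) h₁+f≡h₂ (+-monoʳ-< h1 l2)) d))
        dinv-low-middle : length (filter dinv₁? (range (suc h1) f)) ≡ (m + 1) + 0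
        dinv-low-middle = trans (cong (λ r → length (filter dinv₁? r)) (range-++ (suc h1) (m + 1) y))
             (trans (length-filter-++ dinv₁? (range (suc h1) (m + 1)) (range (suc h1 + (m + 1)) y)) (cong₂ _+_ dinv-low no-dinv-middle))
        dinv-high : length (filter dinv₁? (range (suc h1 + f) z)) ≡ z
        dinv-high = count-dinv₁-all f z ≤-refl (λ i l1 l2 → dinv-col1-high i l2 (subst (_≤ h1 + i) h₁+f≡h₂ (+-monoʳ-≤ h1 l1))
              (dinvCondition-arm1 i (≤-trans (m≤m+n m 1) (≤-trans m+1≤f l1)) (≤-trans (<⇒≤ l2) (e₁≤2m t1 y z))))

      z≤m : z ≤ m
      z≤m = m≤n+m z t2

      dinv≡ : dinv n p ≡ m + (double z + 1)
      dinv≡ = trans dinv-byColumn (trans (cong₂ _+_ dinv₁-count′ (count-dinv₂ (λ i lt → i≤m⇒3i<n i (≤-trans (<⇒≤ lt) z≤m))))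
                (trans (ring-dinv m z) (cong (λ q → m + (q + 1)) (sym (double≡+ z)))))

      skip≡ : skip n p ≡ y
      skip≡ = trans (skip-flags n p) (trans (cong (λ q → skipsFrom noBox (reverse q)) flags-reversed) (skipsFrom-C1 m z y t1))

      flags≡constructionFlags : constructionFlags (m + (double z + 1)) y (map proj₁ (reverse (rankCells n))) ≡ map (boxedFlag p) (reverse (rankCells n))
      flags≡constructionFlags = trans (cong (constructionFlags (m + (double z + 1)) y) colours-reversed) (trans (constructionFlags-C1 m z y t1) (sym flags-reversed))

      theorem : Correct n p
      theorem = construction≡rankWordOf n p _ _ _ area≡ skip≡ dinv≡
        (trans (cong (λ q → t1 + t2 + y + (m + (q + 1)) + 1) (double≡+ z)) (ring-statistics t1 y z)) flags≡constructionFlags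

  correct : ∀ m p t1 y z → t1 + suc y + z ≡ m → colHeight p 1 ≡ (m + 1) + t1 → colHeight p 2 ≡ (2 * m + 1) + (t1 + suc y) →
    colHeight p 3 ≡ 3 * m + 1 → Correct (3 * m + 1) p
  correct .(t1 + suc y + z) p t1 y z refl = C1.theorem t1 y z p


module CaseA2 where

  open Ranges
  open RankBlocks using (repeat; reverse-rankCells-segments; map-reversedBlocks)
  open Construction using (constructionFlags)
  open SkipCounting using (skipsFrom; noBox)
  open LambdaStatistics
  open Thresholds
  open BlockFlags
  open FlagPatterns
  open Reduction

  ring-blocks : ∀ u f g → (u + f) + g + suc u + (f + g) + (u + f + g + 1) ≡ 3 * (u + f + g) + 2
  ring-blocks = solve-∀
  ring-nonempty : ∀ u f g → 2 * (u + f + g) + 1 ≡ (u + f) + g + suc u + (f + g)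
  ring-nonempty = solve-∀
  ring-h₁+e₁ : ∀ u f g → (u + f + g + 1) + (u + f + g + suc u) + (f + g) ≡ 3 * (u + f + g) + 2
  ring-h₁+e₁ = solve-∀
  ring-h₂+e₂ : ∀ u f g → (2 * (u + f + g) + 2) + (u + f) + g ≡ 3 * (u + f + g) + 2
  ring-h₂+e₂ = solve-∀
  ring-h₁+f : ∀ u f g → (u + f + g + 1) + (u + f + g + suc u) + f ≡ (2 * (u + f + g) + 2) + (u + f)
  ring-h₁+f = solve-∀
  ring-statistics : ∀ u f g → (u + f + g + suc u) + (u + f) + g + (f + g) + 1 ≡ 3 * (u + f + g) + 2
  ring-statistics = solve-∀
  m+suc-u≤2m+1 : ∀ u f g → (u + f + g) + suc u ≤ 2 * (u + f + g) + 1
  m+suc-u≤2m+1 u f g = ≤-trans (+-monoʳ-≤ (u + f + g) (s≤s (≤-trans (m≤m+n u f) (m≤m+n (u + f) g)))) (≤-reflexive (eq u f g))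
    where
    eq : ∀ u f g → (u + f + g) + suc (u + f + g) ≡ 2 * (u + f + g) + 1
    eq = solve-∀

  module A2 (u f g : ℕ) (p : List Step) where
    m = u + f + g
    n = 3 * m + 2
    t1 = m + suc u
    t2 = u + f
    h1 = (m + 1) + t1
    h2 = (2 * m + 2) + t2

    module _ (H1 : colHeight p 1 ≡ h1) (H2 : colHeight p 2 ≡ h2) (H3 : colHeight p 3 ≡ n) where
      open FlagsResidueTwo m p t1 t2 H1 H2
      open Residue m 2 (s≤s z≤n) (s≤s (s≤s z≤n)) using (n≤3k⇒m<k; m<k⇒n≤3k; i≤m⇒3i<n; dinvCondition-arm0; ¬dinvCondition-arm1)

      blocks-sum : (u + f) + g + suc u + (f + g) + (m + 1) ≡ n
      blocks-sum = ring-blocks u f g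

      colours-reversed : map proj₁ (reverse (rankCells n)) ≡
        repeat (f + g) (1 ∷ []) ++ (repeat (suc u) (1 ∷ []) ++ (repeat g (2 ∷ 1 ∷ []) ++ (repeat (u + f) (2 ∷ 1 ∷ []) ++ [])))
      colours-reversed = trans (reverse-rankCells-segments proj₁ n (u + f) g (suc u) (f + g) (m + 1) blocks-sum (empty-blocks proj₁ _ (m + 1) (≤-reflexive (ring-nonempty u f g))))
        (cong₂ _++_ (map-reversedBlocks proj₁ n _ (f + g) _ (single-colours t1 (f + g) (m≤m+n m (suc u)) (≤-reflexive (sym (ring-nonempty u f g)))))
        (cong₂ _++_ (map-reversedBlocks proj₁ n _ (suc u) _ (single-colours m (suc u) ≤-refl (m+suc-u≤2m+1 u f g)))
        (cong₂ _++_ (map-reversedBlocks proj₁ n _ g _ (pair-colours (u + f) g ≤-refl))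
        (cong₂ _++_ (map-reversedBlocks proj₁ n 0 (u + f) _ (pair-colours 0 (u + f) (m≤m+n (u + f) g))) refl))))

      flags-reversed : map (boxedFlag p) (reverse (rankCells n)) ≡
        repeat (f + g) (T ∷ []) ++ (repeat (suc u) (F ∷ []) ++ (repeat g (T ∷ F ∷ []) ++ (repeat (u + f) (F ∷ F ∷ []) ++ [])))
      flags-reversed = trans (reverse-rankCells-segments (boxedFlag p) n (u + f) g (suc u) (f + g) (m + 1) blocks-sum (empty-blocks (boxedFlag p) _ (m + 1) (≤-reflexive (ring-nonempty u f g))))
        (cong₂ _++_ (map-reversedBlocks (boxedFlag p) n _ (f + g) _ (single-flags t1 (f + g) true (m≤m+n m (suc u)) (≤-reflexive (sym (ring-nonempty u f g))) ≤-refl))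
        (cong₂ _++_ (map-reversedBlocks (boxedFlag p) n _ (suc u) _ (single-flags m (suc u) false ≤-refl (m+suc-u≤2m+1 u f g) ≤-refl))
        (cong₂ _++_ (map-reversedBlocks (boxedFlag p) n _ g _ (pair-flags (u + f) g false true ≤-refl (m≤m+n m (suc u)) ≤-refl))
        (cong₂ _++_ (map-reversedBlocks (boxedFlag p) n 0 (u + f) _ (pair-flags 0 (u + f) false false (m≤m+n (u + f) g)
                        (≤-trans (m≤m+n (u + f) g) (m≤m+n m (suc u))) ≤-refl)) refl))))

      h₁+e₁≡n : h1 + (f + g) ≡ n
      h₁+e₁≡n = ring-h₁+e₁ u f g
      h₂+e₂≡n : h2 + g ≡ n
      h₂+e₂≡n = ring-h₂+e₂ u f g

      open Columns n p h1 h2 (f + g) g H1 H2 H3 h₁+e₁≡n h₂+e₂≡n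

      area≡ : area n p ≡ t1 + t2
      area≡ = trans area-byColumn (cong₂ _+_ (area-column 1 h1 (m + 1) t1 (f + g) H1 refl h₁+e₁≡n n≤3k⇒m<k m<k⇒n≤3k)
                             (area-column 2 h2 (2 * m + 2) t2 g H2 refl h₂+e₂≡n (2n≤3k⇒2m+1<k m) (2m+1<k⇒2n≤3k m)))

      f≤m : f ≤ m
      f≤m = ≤-trans (m≤n+m f u) (m≤m+n (u + f) g)
      f+g≤m : f + g ≤ m
      f+g≤m = +-monoˡ-≤ g (m≤n+m f u)

      dinv₁-count : length (filter dinv₁? (range (suc h1) (f + g))) ≡ f + 0
      dinv₁-count = trans (cong (λ r → length (filter dinv₁? r)) (range-++ (suc h1) f g))
            (trans (length-filter-++ dinv₁? (range (suc h1) f) (range (suc h1 + f) g)) (cong₂ _+_ dinv-low no-dinv-middle))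
        where
        dinv-low : length (filter dinv₁? (range (suc h1) f)) ≡ f
        dinv-low = trans (cong (λ z → length (filter dinv₁? (range (suc z) f))) (sym (+-identityʳ h1)))
                         (count-dinv₁-all 0 f (m≤m+n f g) (λ i _ lt → dinv-col1-low i (<-≤-trans lt (m≤m+n f g))
                            (subst (h1 + i <_) (ring-h₁+f u f g) (+-monoʳ-< h1 lt)) (dinvCondition-arm0 i (≤-trans (<⇒≤ lt) f≤m))))
        no-dinv-middle : length (filter dinv₁? (range (suc h1 + f) g)) ≡ 0
        no-dinv-middle = count-dinv₁-none f g ≤-refl (λ i l1 l2 d → ¬dinvCondition-arm1 i (<-≤-trans l2 f+g≤m)
          (dinv-col1-high⁻¹ i l2 (subst (_≤ h1 + i) (ring-h₁+f u f g) (+-monoʳ-≤ h1 l1)) d))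

      dinv≡ : dinv n p ≡ f + g
      dinv≡ = trans dinv-byColumn (cong₂ _+_ (trans dinv₁-count (+-identityʳ f)) (count-dinv₂ (λ i lt → i≤m⇒3i<n i (≤-trans (<⇒≤ lt) (m≤n+m g (u + f))))))

      skip≡ : skip n p ≡ g
      skip≡ = trans (skip-flags n p) (trans (cong (λ z → skipsFrom noBox (reverse z)) flags-reversed) (skipsFrom-A2 u f g))

      flags≡constructionFlags : constructionFlags (f + g) g (map proj₁ (reverse (rankCells n))) ≡ map (boxedFlag p) (reverse (rankCells n))
      flags≡constructionFlags = trans (cong (constructionFlags (f + g) g) colours-reversed) (trans (constructionFlags-A2 u f g) (sym flags-reversed))

      theorem : Correct n p
      theorem = construction≡rankWordOf n p _ _ _ area≡ skip≡ dinv≡ (ring-statistics u f g) flags≡constructionFlags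

  correct : ∀ m p u f g → u + f + g ≡ m → colHeight p 1 ≡ (m + 1) + (m + suc u) → colHeight p 2 ≡ (2 * m + 2) + (u + f) →
    colHeight p 3 ≡ 3 * m + 2 → Correct (3 * m + 2) p
  correct .(u + f + g) p u f g refl = A2.theorem u f g p


module CaseB2 where

  open Ranges
  open RankBlocks using (repeat; reverse-rankCells-segments; map-reversedBlocks)
  open Construction using (constructionFlags)
  open SkipCounting using (skipsFrom; noBox)
  open LambdaStatistics
  open Thresholds
  open BlockFlags
  open FlagPatterns
  open Reduction

  ring-blocks : ∀ t2 y z → t2 + suc y + z + suc (t2 + suc y + z) + (t2 + suc y + z + 1) ≡ 3 * (t2 + suc y + z) + 2
  ring-blocks = solve-∀
  ring-h₁+e₁ : ∀ t2 y z → (t2 + suc y + z + 1) + (t2 + suc y) + (t2 + suc y + z + suc z) ≡ 3 * (t2 + suc y + z) + 2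
  ring-h₁+e₁ = solve-∀
  ring-h₂+e₂ : ∀ t2 y z → (2 * (t2 + suc y + z) + 2) + t2 + (suc y + z) ≡ 3 * (t2 + suc y + z) + 2
  ring-h₂+e₂ = solve-∀
  ring-h₁+f : ∀ t2 y z → (t2 + suc y + z + 1) + (t2 + suc y) + (t2 + suc z) ≡ (2 * (t2 + suc y + z) + 2) + t2
  ring-h₁+f = solve-∀
  ring-e₁ : ∀ t2 y z → (t2 + suc z) + y + suc z ≡ t2 + suc y + z + suc z
  ring-e₁ = solve-∀
  ring-f+y : ∀ t2 y z → t2 + suc z + y ≡ t2 + suc y + z
  ring-f+y = solve-∀
  ring-dinv : ∀ t2 y z → (t2 + suc z) + 0 + suc z + (suc y + z) ≡ suc (t2 + suc y + z) + (z + z + 1)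
  ring-dinv = solve-∀
  ring-statistics : ∀ t2 y z → (t2 + suc y) + t2 + y + (suc (t2 + suc y + z) + (z + z + 1)) + 1 ≡ 3 * (t2 + suc y + z) + 2
  ring-statistics = solve-∀
  m+suc-z≤2m : ∀ t2 y z → t2 + suc y + z + suc z ≤ 2 * (t2 + suc y + z)
  m+suc-z≤2m t2 y z = ≤-trans (m≤m+n _ (t2 + y)) (≤-reflexive (eq t2 y z))
    where
    eq : ∀ t2 y z → t2 + suc y + z + suc z + (t2 + y) ≡ 2 * (t2 + suc y + z)
    eq = solve-∀
  e₂≤m : ∀ t2 y z → suc y + z ≤ t2 + suc y + z
  e₂≤m t2 y z = subst (suc y + z ≤_) (sym (+-assoc t2 (suc y) z)) (m≤n+m (suc y + z) t2)

  module B2 (t2 y z : ℕ) (p : List Step) where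
    t1 = t2 + suc y
    m = t1 + z
    n = 3 * m + 2
    h1 = (m + 1) + t1
    h2 = (2 * m + 2) + t2
    e1 = m + suc z
    e2 = suc y + z
    f = t2 + suc z

    module _ (H1 : colHeight p 1 ≡ h1) (H2 : colHeight p 2 ≡ h2) (H3 : colHeight p 3 ≡ n) where
      open FlagsResidueTwo m p t1 t2 H1 H2
      open Residue m 2 (s≤s z≤n) (s≤s (s≤s z≤n)) using (n≤3k⇒m<k; m<k⇒n≤3k; i≤m⇒3i<n; dinvCondition-arm0; ¬dinvCondition-arm1; dinvCondition-arm1)

      blocks-sum : t2 + suc y + z + suc m + (m + 1) ≡ n
      blocks-sum = ring-blocks t2 y z

      t1≤m : t1 ≤ m
      t1≤m = m≤m+n t1 z
      t2≤t1 : t2 ≤ t1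
      t2≤t1 = m≤m+n t2 (suc y)

      colours-reversed : map proj₁ (reverse (rankCells n)) ≡
        repeat (suc m) (1 ∷ []) ++ (repeat z (2 ∷ 1 ∷ []) ++ (repeat (suc y) (2 ∷ 1 ∷ []) ++ (repeat t2 (2 ∷ 1 ∷ []) ++ [])))
      colours-reversed = trans (reverse-rankCells-segments proj₁ n t2 (suc y) z (suc m) (m + 1) blocks-sum (empty-blocks proj₁ _ (m + 1) (≤-reflexive (2*m+1≡m+suc-m m))))
        (cong₂ _++_ (map-reversedBlocks proj₁ n _ (suc m) _ (single-colours m (suc m) ≤-refl (≤-reflexive (sym (2*m+1≡m+suc-m m)))))
        (cong₂ _++_ (map-reversedBlocks proj₁ n _ z _ (pair-colours t1 z ≤-refl))
        (cong₂ _++_ (map-reversedBlocks proj₁ n _ (suc y) _ (pair-colours t2 (suc y) t1≤m))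
        (cong₂ _++_ (map-reversedBlocks proj₁ n 0 t2 _ (pair-colours 0 t2 (≤-trans t2≤t1 t1≤m))) refl))))

      flags-reversed : map (boxedFlag p) (reverse (rankCells n)) ≡
        repeat (suc m) (T ∷ []) ++ (repeat z (T ∷ T ∷ []) ++ (repeat (suc y) (T ∷ F ∷ []) ++ (repeat t2 (F ∷ F ∷ []) ++ [])))
      flags-reversed = trans (reverse-rankCells-segments (boxedFlag p) n t2 (suc y) z (suc m) (m + 1) blocks-sum (empty-blocks (boxedFlag p) _ (m + 1) (≤-reflexive (2*m+1≡m+suc-m m))))
        (cong₂ _++_ (map-reversedBlocks (boxedFlag p) n _ (suc m) _ (single-flags m (suc m) true ≤-refl (≤-reflexive (sym (2*m+1≡m+suc-m m))) t1≤m))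
        (cong₂ _++_ (map-reversedBlocks (boxedFlag p) n _ z _ (pair-flags t1 z true true ≤-refl ≤-refl t2≤t1))
        (cong₂ _++_ (map-reversedBlocks (boxedFlag p) n _ (suc y) _ (pair-flags t2 (suc y) false true t1≤m ≤-refl ≤-refl))
        (cong₂ _++_ (map-reversedBlocks (boxedFlag p) n 0 t2 _ (pair-flags 0 t2 false false (≤-trans t2≤t1 t1≤m) t2≤t1 ≤-refl)) refl))))

      h₁+e₁≡n : h1 + e1 ≡ n
      h₁+e₁≡n = ring-h₁+e₁ t2 y z
      h₂+e₂≡n : h2 + e2 ≡ n
      h₂+e₂≡n = ring-h₂+e₂ t2 y z
      h₁+f≡h₂ : h1 + f ≡ h2
      h₁+f≡h₂ = ring-h₁+f t2 y z

      open Columns n p h1 h2 e1 e2 H1 H2 H3 h₁+e₁≡n h₂+e₂≡n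

      area≡ : area n p ≡ t1 + t2
      area≡ = trans area-byColumn (cong₂ _+_ (area-column 1 h1 (m + 1) t1 e1 H1 refl h₁+e₁≡n n≤3k⇒m<k m<k⇒n≤3k)
                             (area-column 2 h2 (2 * m + 2) t2 e2 H2 refl h₂+e₂≡n (2n≤3k⇒2m+1<k m) (2m+1<k⇒2n≤3k m)))

      f+y≡m : f + y ≡ m
      f+y≡m = ring-f+y t2 y z
      f≤m : f ≤ m
      f≤m = subst (f ≤_) f+y≡m (m≤m+n f y)
      f+y≤e1 : f + y ≤ e1
      f+y≤e1 = ≤-trans (≤-reflexive f+y≡m) (m≤m+n m (suc z))

      dinv₁-count′ : length (filter dinv₁? (range (suc h1) ((f + y) + suc z))) ≡ (f + 0) + suc z
      dinv₁-count′ = trans (cong (λ r → length (filter dinv₁? r)) (range-++ (suc h1) (f + y) (suc z)))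
             (trans (length-filter-++ dinv₁? (range (suc h1) (f + y)) (range (suc h1 + (f + y)) (suc z)))
               (cong₂ _+_ dinv-low-middle dinv-high))
        where
        dinv-low : length (filter dinv₁? (range (suc h1) f)) ≡ f
        dinv-low = trans (cong (λ q → length (filter dinv₁? (range (suc q) f))) (sym (+-identityʳ h1)))
                  (count-dinv₁-all 0 f (≤-trans (m≤m+n f y) f+y≤e1) (λ i _ lt → dinv-col1-low i (<-≤-trans lt (≤-trans (m≤m+n f y) f+y≤e1))
                     (subst (h1 + i <_) h₁+f≡h₂ (+-monoʳ-< h1 lt)) (dinvCondition-arm0 i (≤-trans (<⇒≤ lt) f≤m))))
        no-dinv-middle : length (filter dinv₁? (range (suc h1 + f) y)) ≡ 0
        no-dinv-middle = count-dinv₁-none f y f+y≤e1 (λ i l1 l2 d → ¬dinvCondition-arm1 i (subst (i <_) f+y≡m l2)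
              (dinv-col1-high⁻¹ i (<-≤-trans l2 f+y≤e1) (subst (_≤ h1 + i) h₁+f≡h₂ (+-monoʳ-≤ h1 l1)) d))
        dinv-low-middle : length (filter dinv₁? (range (suc h1) (f + y))) ≡ f + 0
        dinv-low-middle = trans (cong (λ r → length (filter dinv₁? r)) (range-++ (suc h1) f y))
             (trans (length-filter-++ dinv₁? (range (suc h1) f) (range (suc h1 + f) y)) (cong₂ _+_ dinv-low no-dinv-middle))
        dinv-high : length (filter dinv₁? (range (suc h1 + (f + y)) (suc z))) ≡ suc z
        dinv-high = count-dinv₁-all (f + y) (suc z) (≤-reflexive (cong (_+ suc z) f+y≡m)) (λ i l1 l2 → dinv-col1-high i (<-≤-trans l2 (≤-reflexive (cong (_+ suc z) f+y≡m)))
              (subst (_≤ h1 + i) h₁+f≡h₂ (+-monoʳ-≤ h1 (≤-trans (m≤m+n f y) l1)))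
              (dinvCondition-arm1 i (subst (_≤ i) f+y≡m l1) (≤-trans (<⇒≤ (subst (i <_) (cong (_+ suc z) f+y≡m) l2)) (m+suc-z≤2m t2 y z))))

      dinv₁-count : length (filter dinv₁? (range (suc h1) e1)) ≡ (f + 0) + suc z
      dinv₁-count = trans (cong (λ q → length (filter dinv₁? (range (suc h1) q))) (sym (ring-e₁ t2 y z))) dinv₁-count′

      dinv≡ : dinv n p ≡ suc m + (double z + 1)
      dinv≡ = trans dinv-byColumn (trans (cong₂ _+_ dinv₁-count (count-dinv₂ (λ i lt → i≤m⇒3i<n i (≤-trans (<⇒≤ lt) (e₂≤m t2 y z)))))
                (trans (ring-dinv t2 y z) (cong (λ q → suc m + (q + 1)) (sym (double≡+ z)))))

      skip≡ : skip n p ≡ y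
      skip≡ = trans (skip-flags n p) (trans (cong (λ q → skipsFrom noBox (reverse q)) flags-reversed) (skipsFrom-B2 m z y t2))

      flags≡constructionFlags : constructionFlags (suc m + (double z + 1)) y (map proj₁ (reverse (rankCells n))) ≡ map (boxedFlag p) (reverse (rankCells n))
      flags≡constructionFlags = trans (cong (constructionFlags (suc m + (double z + 1)) y) colours-reversed) (trans (constructionFlags-B2 m z y t2) (sym flags-reversed))

      theorem : Correct n p
      theorem = construction≡rankWordOf n p (t1 + t2) y (suc m + (double z + 1)) area≡ skip≡ dinv≡
        (trans (cong (λ q → t1 + t2 + y + (suc m + (q + 1)) + 1) (double≡+ z)) (ring-statistics t2 y z)) flags≡constructionFlags

  correct : ∀ m p t2 y z → t2 + suc y + z ≡ m → colHeight p 1 ≡ (m + 1) + (t2 + suc y) → colHeight p 2 ≡ (2 * m + 2) + t2 →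
    colHeight p 3 ≡ 3 * m + 2 → Correct (3 * m + 2) p
  correct .(t2 + suc y + z) p t2 y z refl = B2.theorem t2 y z p


module CaseC2 where

  open Ranges
  open RankBlocks using (repeat; reverse-rankCells-segments; map-reversedBlocks)
  open Construction using (constructionFlags)
  open SkipCounting using (skipsFrom; noBox)
  open LambdaStatistics
  open Thresholds
  open BlockFlags
  open FlagPatterns
  open Reduction

  ring-blocks : ∀ t1 y z → t1 + y + z + suc (t1 + y + z) + (t1 + y + z + 1) ≡ 3 * (t1 + y + z) + 2
  ring-blocks = solve-∀
  ring-h₁+e₁ : ∀ t1 y z → (t1 + y + z + 1) + t1 + ((t1 + y + z + 1) + y + z) ≡ 3 * (t1 + y + z) + 2
  ring-h₁+e₁ = solve-∀
  ring-h₂+e₂ : ∀ t1 y z → (2 * (t1 + y + z) + 2) + (t1 + y) + z ≡ 3 * (t1 + y + z) + 2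
  ring-h₂+e₂ = solve-∀
  ring-h₁+f : ∀ t1 y z → (t1 + y + z + 1) + t1 + ((t1 + y + z + 1) + y) ≡ (2 * (t1 + y + z) + 2) + (t1 + y)
  ring-h₁+f = solve-∀
  ring-dinv : ∀ m z → (m + 1) + 0 + z + z ≡ suc m + (z + z + 0)
  ring-dinv = solve-∀
  ring-statistics : ∀ t1 y z → t1 + (t1 + y) + y + (suc (t1 + y + z) + (z + z + 0)) + 1 ≡ 3 * (t1 + y + z) + 2
  ring-statistics = solve-∀
  e₁≤2m+1 : ∀ t1 y z → (t1 + y + z + 1) + y + z ≤ 2 * (t1 + y + z) + 1
  e₁≤2m+1 t1 y z = ≤-trans (m≤m+n _ t1) (≤-reflexive (sym (eq t1 y z)))
    where
    eq : ∀ t1 y z → 2 * (t1 + y + z) + 1 ≡ (t1 + y + z + 1) + y + z + t1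
    eq = solve-∀

  module C2 (t1 y z : ℕ) (p : List Step) where
    t2 = t1 + y
    m = t2 + z
    n = 3 * m + 2
    h1 = (m + 1) + t1
    h2 = (2 * m + 2) + t2
    f = (m + 1) + y
    e1 = f + z

    module _ (H1 : colHeight p 1 ≡ h1) (H2 : colHeight p 2 ≡ h2) (H3 : colHeight p 3 ≡ n) where
      open FlagsResidueTwo m p t1 t2 H1 H2
      open Residue m 2 (s≤s z≤n) (s≤s (s≤s z≤n)) using (n≤3k⇒m<k; m<k⇒n≤3k; i≤m⇒3i<n; dinvCondition-arm0; ¬dinvCondition-arm0; dinvCondition-arm1)

      blocks-sum : t1 + y + z + suc m + (m + 1) ≡ n
      blocks-sum = ring-blocks t1 y z

      t1≤t2 : t1 ≤ t2
      t1≤t2 = m≤m+n t1 y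
      t2≤m : t2 ≤ m
      t2≤m = m≤m+n t2 z
      t1≤m : t1 ≤ m
      t1≤m = ≤-trans t1≤t2 t2≤m

      colours-reversed : map proj₁ (reverse (rankCells n)) ≡
        repeat (suc m) (1 ∷ []) ++ (repeat z (2 ∷ 1 ∷ []) ++ (repeat y (2 ∷ 1 ∷ []) ++ (repeat t1 (2 ∷ 1 ∷ []) ++ [])))
      colours-reversed = trans (reverse-rankCells-segments proj₁ n t1 y z (suc m) (m + 1) blocks-sum (empty-blocks proj₁ _ (m + 1) (≤-reflexive (2*m+1≡m+suc-m m))))
        (cong₂ _++_ (map-reversedBlocks proj₁ n _ (suc m) _ (single-colours m (suc m) ≤-refl (≤-reflexive (sym (2*m+1≡m+suc-m m)))))
        (cong₂ _++_ (map-reversedBlocks proj₁ n _ z _ (pair-colours t2 z ≤-refl))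
        (cong₂ _++_ (map-reversedBlocks proj₁ n _ y _ (pair-colours t1 y t2≤m))
        (cong₂ _++_ (map-reversedBlocks proj₁ n 0 t1 _ (pair-colours 0 t1 t1≤m)) refl))))

      flags-reversed : map (boxedFlag p) (reverse (rankCells n)) ≡
        repeat (suc m) (T ∷ []) ++ (repeat z (T ∷ T ∷ []) ++ (repeat y (F ∷ T ∷ []) ++ (repeat t1 (F ∷ F ∷ []) ++ [])))
      flags-reversed = trans (reverse-rankCells-segments (boxedFlag p) n t1 y z (suc m) (m + 1) blocks-sum (empty-blocks (boxedFlag p) _ (m + 1) (≤-reflexive (2*m+1≡m+suc-m m))))
        (cong₂ _++_ (map-reversedBlocks (boxedFlag p) n _ (suc m) _ (single-flags m (suc m) true ≤-refl (≤-reflexive (sym (2*m+1≡m+suc-m m))) t1≤m))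
        (cong₂ _++_ (map-reversedBlocks (boxedFlag p) n _ z _ (pair-flags t2 z true true ≤-refl t1≤t2 ≤-refl))
        (cong₂ _++_ (map-reversedBlocks (boxedFlag p) n _ y _ (pair-flags t1 y true false t2≤m ≤-refl ≤-refl))
        (cong₂ _++_ (map-reversedBlocks (boxedFlag p) n 0 t1 _ (pair-flags 0 t1 false false t1≤m ≤-refl t1≤t2)) refl))))

      h₁+e₁≡n : h1 + e1 ≡ n
      h₁+e₁≡n = ring-h₁+e₁ t1 y z
      h₂+e₂≡n : h2 + z ≡ n
      h₂+e₂≡n = ring-h₂+e₂ t1 y z
      h₁+f≡h₂ : h1 + f ≡ h2
      h₁+f≡h₂ = ring-h₁+f t1 y z

      open Columns n p h1 h2 e1 z H1 H2 H3 h₁+e₁≡n h₂+e₂≡n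

      area≡ : area n p ≡ t1 + t2
      area≡ = trans area-byColumn (cong₂ _+_ (area-column 1 h1 (m + 1) t1 e1 H1 refl h₁+e₁≡n n≤3k⇒m<k m<k⇒n≤3k)
                             (area-column 2 h2 (2 * m + 2) t2 z H2 refl h₂+e₂≡n (2n≤3k⇒2m+1<k m) (2m+1<k⇒2n≤3k m)))

      i<m+1⇒i≤m : ∀ i → i < m + 1 → i ≤ m
      i<m+1⇒i≤m i lt = ≤-pred (subst (i <_) (+-comm m 1) lt)
      m+1≤f : m + 1 ≤ f
      m+1≤f = m≤m+n (m + 1) y
      f≤e1 : f ≤ e1
      f≤e1 = m≤m+n f z

      dinv₁-count′ : length (filter dinv₁? (range (suc h1) e1)) ≡ (m + 1) + 0 + z
      dinv₁-count′ = trans (cong (λ r → length (filter dinv₁? r)) (range-++ (suc h1) f z))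
             (trans (length-filter-++ dinv₁? (range (suc h1) f) (range (suc h1 + f) z)) (cong₂ _+_ dinv-low-middle dinv-high))
        where
        dinv-low : length (filter dinv₁? (range (suc h1) (m + 1))) ≡ m + 1
        dinv-low = trans (cong (λ q → length (filter dinv₁? (range (suc q) (m + 1)))) (sym (+-identityʳ h1)))
                  (count-dinv₁-all 0 (m + 1) (≤-trans m+1≤f f≤e1) (λ i _ lt → dinv-col1-low i (<-≤-trans lt (≤-trans m+1≤f f≤e1))
                     (subst (h1 + i <_) h₁+f≡h₂ (+-monoʳ-< h1 (<-≤-trans lt m+1≤f))) (dinvCondition-arm0 i (i<m+1⇒i≤m i lt))))
        no-dinv-middle : length (filter dinv₁? (range (suc h1 + (m + 1)) y)) ≡ 0
        no-dinv-middle = count-dinv₁-none (m + 1) y f≤e1 (λ i l1 l2 d → ¬dinvCondition-arm0 i (<-≤-trans (subst (m <_) (+-comm 1 m) ≤-refl) l1)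
              (dinv-col1-low⁻¹ i (<-≤-trans l2 f≤e1) (subst (h1 + i <_) h₁+f≡h₂ (+-monoʳ-< h1 l2)) d))
        dinv-low-middle : length (filter dinv₁? (range (suc h1) f)) ≡ (m + 1) + 0
        dinv-low-middle = trans (cong (λ r → length (filter dinv₁? r)) (range-++ (suc h1) (m + 1) y))
             (trans (length-filter-++ dinv₁? (range (suc h1) (m + 1)) (range (suc h1 + (m + 1)) y)) (cong₂ _+_ dinv-low no-dinv-middle))
        dinv-high : length (filter dinv₁? (range (suc h1 + f) z)) ≡ z
        dinv-high = count-dinv₁-all f z ≤-refl (λ i l1 l2 → dinv-col1-high i l2 (subst (_≤ h1 + i) h₁+f≡h₂ (+-monoʳ-≤ h1 l1))
              (dinvCondition-arm1 i (≤-trans (m≤m+n m 1) (≤-trans m+1≤f l1)) (≤-pred (subst (suc i ≤_) (+-comm (2 * m) 1) (≤-trans l2 (e₁≤2m+1 t1 y z))))))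

      z≤m : z ≤ m
      z≤m = m≤n+m z t2

      dinv≡ : dinv n p ≡ suc m + (double z + 0)
      dinv≡ = trans dinv-byColumn (trans (cong₂ _+_ dinv₁-count′ (count-dinv₂ (λ i lt → i≤m⇒3i<n i (≤-trans (<⇒≤ lt) z≤m))))
                (trans (ring-dinv m z) (cong (λ q → suc m + (q + 0)) (sym (double≡+ z)))))

      skip≡ : skip n p ≡ y
      skip≡ = trans (skip-flags n p) (trans (cong (λ q → skipsFrom noBox (reverse q)) flags-reversed) (skipsFrom-C2 m z y t1))

      flags≡constructionFlags : constructionFlags (suc m + (double z + 0)) y (map proj₁ (reverse (rankCells n))) ≡ map (boxedFlag p) (reverse (rankCells n))
      flags≡constructionFlags = trans (cong (constructionFlags (suc m + (double z + 0)) y) colours-reversed) (trans (constructionFlags-C2 m z y t1) (sym flags-reversed))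

      theorem : Correct n p
      theorem = construction≡rankWordOf n p (t1 + t2) y (suc m + (double z + 0)) area≡ skip≡ dinv≡
        (trans (cong (λ q → t1 + t2 + y + (suc m + (q + 0)) + 1) (double≡+ z)) (ring-statistics t1 y z)) flags≡constructionFlags

  correct : ∀ m p t1 y z → t1 + y + z ≡ m → colHeight p 1 ≡ (m + 1) + t1 → colHeight p 2 ≡ (2 * m + 2) + (t1 + y) →
    colHeight p 3 ≡ 3 * m + 2 → Correct (3 * m + 2) p
  correct .(t1 + y + z) p t1 y z refl = C2.theorem t1 y z p


module Residues where

  open DyckHeights using (ColumnHeights)
  open Thresholds
  open Reduction using (Correct)

  3∤n⇒residue : ∀ n → ¬ (3 ∣ n) → (Σ ℕ λ m → n ≡ 3 * m + 1) ⊎ (Σ ℕ λ m → n ≡ 3 * m + 2)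
  3∤n⇒residue n 3∤n with n % 3 | m%n<n n 3 | m≡m%n+[m/n]*n n 3
  ... | 0 | _ | e = ⊥-elim (3∤n (divides (n / 3) e))
  ... | 1 | _ | e = inj₁ (n / 3 , trans e (trans (+-comm 1 (n / 3 * 3)) (cong (_+ 1) (*-comm (n / 3) 3))))
  ... | 2 | _ | e = inj₂ (n / 3 , trans e (trans (+-comm 2 (n / 3 * 3)) (cong (_+ 2) (*-comm (n / 3) 3))))
  ... | suc (suc (suc _)) | s≤s (s≤s (s≤s ())) | _

  -- Write h₁ = m + 1 + t₁ and h₂ = 2m + ρ + t₂, the least heights allowed by the diagonal
  -- plus excesses.  The cases A, B, C locate t₁ relative to m and to t₂; each one fixes
  -- the pattern of boxed flags along the reversed rank word.
  correct-3m+1 : ∀ m p → ColumnHeights (3 * m + 1) p → Correct (3 * m + 1) p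
  correct-3m+1 m p H = split (m ≤? t₁) (t₂ ≤? t₁)
    where
    open ColumnHeights H
    open Residue m 1 (s≤s z≤n) (s≤s z≤n) using (n≤3k⇒m<k)
    m<h₁ : m + 1 ≤ colHeight p 1
    m<h₁ = n≤3k⇒m<k (colHeight p 1) (subst (_≤ 3 * colHeight p 1) (sym (+-identityʳ (3 * m + 1))) n≤3h₁)
    t₁ t₂ : ℕ
    t₁ = proj₁ (m≤n⇒∃[o]m+o≡n m<h₁)
    t₂ = proj₁ (m≤n⇒∃[o]m+o≡n (2n≤3k⇒2m<k m (colHeight p 2) 2n≤3h₂))
    h₁≡ : colHeight p 1 ≡ (m + 1) + t₁
    h₁≡ = sym (proj₂ (m≤n⇒∃[o]m+o≡n m<h₁))
    h₂≡ : colHeight p 2 ≡ (2 * m + 1) + t₂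
    h₂≡ = sym (proj₂ (m≤n⇒∃[o]m+o≡n (2n≤3k⇒2m<k m (colHeight p 2) 2n≤3h₂)))
    t₂≤m : t₂ ≤ m
    t₂≤m = +-cancelˡ-≤ (2 * m + 1) t₂ m (subst₂ _≤_ h₂≡ (ring-n m) h₂≤n)
      where
      ring-n : ∀ m → 3 * m + 1 ≡ (2 * m + 1) + m
      ring-n = solve-∀
    t₁≤m+t₂ : t₁ ≤ m + t₂
    t₁≤m+t₂ = +-cancelˡ-≤ (m + 1) t₁ (m + t₂) (subst₂ _≤_ h₁≡ (trans h₂≡ (ring-h₂ m t₂)) h₁≤h₂)
      where
      ring-h₂ : ∀ m t → (2 * m + 1) + t ≡ (m + 1) + (m + t)
      ring-h₂ = solve-∀
    split : Dec (m ≤ t₁) → Dec (t₂ ≤ t₁) → Correct (3 * m + 1) p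
    split (yes m≤t₁) _ =
      let (u , m+u≡t₁) = m≤n⇒∃[o]m+o≡n m≤t₁
          (f , u+f≡t₂) = m≤n⇒∃[o]m+o≡n (+-cancelˡ-≤ m u t₂ (subst (_≤ m + t₂) (sym m+u≡t₁) t₁≤m+t₂))
          (g , t₂+g≡m) = m≤n⇒∃[o]m+o≡n t₂≤m
      in CaseA1.correct m p u f g (trans (cong (_+ g) u+f≡t₂) t₂+g≡m)
           (trans h₁≡ (cong ((m + 1) +_) (sym m+u≡t₁))) (trans h₂≡ (cong ((2 * m + 1) +_) (sym u+f≡t₂))) h₃≡n
    split (no m≰t₁) (yes t₂≤t₁) =
      let (y , t₂+y≡t₁) = m≤n⇒∃[o]m+o≡n t₂≤t₁
          (z , t₁+1+z≡m) = m≤n⇒∃[o]m+o≡n (≰⇒> m≰t₁)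
      in CaseB1.correct m p t₂ y z (trans (cong (_+ suc z) t₂+y≡t₁) (trans (+-suc t₁ z) t₁+1+z≡m))
           (trans h₁≡ (cong ((m + 1) +_) (sym t₂+y≡t₁))) h₂≡ h₃≡n
    split (no _) (no t₂≰t₁) =
      let (y , t₁+1+y≡t₂) = m≤n⇒∃[o]m+o≡n (≰⇒> t₂≰t₁)
          (z , t₂+z≡m) = m≤n⇒∃[o]m+o≡n t₂≤m
          t₁+suc-y≡t₂ = trans (+-suc t₁ y) t₁+1+y≡t₂
      in CaseC1.correct m p t₁ y z (trans (cong (_+ z) t₁+suc-y≡t₂) t₂+z≡m) h₁≡
           (trans h₂≡ (cong ((2 * m + 1) +_) (sym t₁+suc-y≡t₂))) h₃≡n

  correct-3m+2 : ∀ m p → ColumnHeights (3 * m + 2) p → Correct (3 * m + 2) p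
  correct-3m+2 m p H = split (suc m ≤? t₁) (suc t₂ ≤? t₁)
    where
    open ColumnHeights H
    open Residue m 2 (s≤s z≤n) (s≤s (s≤s z≤n)) using (n≤3k⇒m<k)
    m<h₁ : m + 1 ≤ colHeight p 1
    m<h₁ = n≤3k⇒m<k (colHeight p 1) (subst (_≤ 3 * colHeight p 1) (sym (+-identityʳ (3 * m + 2))) n≤3h₁)
    t₁ t₂ : ℕ
    t₁ = proj₁ (m≤n⇒∃[o]m+o≡n m<h₁)
    t₂ = proj₁ (m≤n⇒∃[o]m+o≡n (2n≤3k⇒2m+1<k m (colHeight p 2) 2n≤3h₂))
    h₁≡ : colHeight p 1 ≡ (m + 1) + t₁
    h₁≡ = sym (proj₂ (m≤n⇒∃[o]m+o≡n m<h₁))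
    h₂≡ : colHeight p 2 ≡ (2 * m + 2) + t₂
    h₂≡ = sym (proj₂ (m≤n⇒∃[o]m+o≡n (2n≤3k⇒2m+1<k m (colHeight p 2) 2n≤3h₂)))
    t₂≤m : t₂ ≤ m
    t₂≤m = +-cancelˡ-≤ (2 * m + 2) t₂ m (subst₂ _≤_ h₂≡ (ring-n m) h₂≤n)
      where
      ring-n : ∀ m → 3 * m + 2 ≡ (2 * m + 2) + m
      ring-n = solve-∀
    t₁≤m+1+t₂ : t₁ ≤ suc m + t₂
    t₁≤m+1+t₂ = +-cancelˡ-≤ (m + 1) t₁ (suc m + t₂) (subst₂ _≤_ h₁≡ (trans h₂≡ (ring-h₂ m t₂)) h₁≤h₂)
      where
      ring-h₂ : ∀ m t → (2 * m + 2) + t ≡ (m + 1) + (suc m + t)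
      ring-h₂ = solve-∀
    split : Dec (suc m ≤ t₁) → Dec (suc t₂ ≤ t₁) → Correct (3 * m + 2) p
    split (yes m<t₁) _ =
      let (u , m+1+u≡t₁) = m≤n⇒∃[o]m+o≡n m<t₁
          (f , u+f≡t₂) = m≤n⇒∃[o]m+o≡n (+-cancelˡ-≤ (suc m) u t₂ (subst (_≤ suc m + t₂) (sym m+1+u≡t₁) t₁≤m+1+t₂))
          (g , t₂+g≡m) = m≤n⇒∃[o]m+o≡n t₂≤m
      in CaseA2.correct m p u f g (trans (cong (_+ g) u+f≡t₂) t₂+g≡m)
           (trans h₁≡ (cong ((m + 1) +_) (trans (sym m+1+u≡t₁) (sym (+-suc m u)))))
           (trans h₂≡ (cong ((2 * m + 2) +_) (sym u+f≡t₂))) h₃≡n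
    split (no m≮t₁) (yes t₂<t₁) =
      let (y , t₂+1+y≡t₁) = m≤n⇒∃[o]m+o≡n t₂<t₁
          (z , t₁+z≡m) = m≤n⇒∃[o]m+o≡n (≤-pred (≰⇒> m≮t₁))
          t₂+suc-y≡t₁ = trans (+-suc t₂ y) t₂+1+y≡t₁
      in CaseB2.correct m p t₂ y z (trans (cong (_+ z) t₂+suc-y≡t₁) t₁+z≡m)
           (trans h₁≡ (cong ((m + 1) +_) (sym t₂+suc-y≡t₁))) h₂≡ h₃≡n
    split (no _) (no t₂≮t₁) =
      let (y , t₁+y≡t₂) = m≤n⇒∃[o]m+o≡n (≤-pred (≰⇒> t₂≮t₁))
          (z , t₂+z≡m) = m≤n⇒∃[o]m+o≡n t₂≤m
      in CaseC2.correct m p t₁ y z (trans (cong (_+ z) t₁+y≡t₂) t₂+z≡m) h₁≡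
           (trans h₂≡ (cong ((2 * m + 2) +_) (sym t₁+y≡t₂))) h₃≡n


mainTheorem7 : (n : ℕ) → 1 ≤ n → ¬ (3 ∣ n) → (Π : List Step) → IsDyckPath n Π →
    construction (area n Π) (skip n Π) (dinv n Π) ≡ rankWordOf n Π
mainTheorem7 n _ 3∤n Π dyck with Residues.3∤n⇒residue n 3∤n
... | inj₁ (m , refl) = Residues.correct-3m+1 m Π (DyckHeights.dyck⇒columnHeights _ Π dyck)
... | inj₂ (m , refl) = Residues.correct-3m+2 m Π (DyckHeights.dyck⇒columnHeights _ Π dyck)
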